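{- For all positive integers $r, n$, \[ U_{2r}(n) = 2^{n+1} \sum_{1 \le j \le k \le r} (-1)^j \frac{\left(-\frac{n}{2}\right)_k \left(\frac12\right)_k}{(k-j)!\,(k+j)!}\,j^{2r}, \] \[ U_{2r+1}(2n) = 2n\binom{2n}{n}\sum_{1 \le j \le k \le r} (-1)^{j}\frac{(-n)_{k}}{(k-j)!\,(k+1)_j}\,j^{2r}, \] \[ U_{2r-1}(2n-1) = \binom{2n}{n}\sum_{1 \le j \le k \le r} (-1)^{j}\frac{(-n)_{k}}{(k-j)!\,(k)_j}\,\left(j-\tfrac12\right)^{2r-1}. \]
   Context: For $r\in\mathbb{N}$ and $n\in\mathbb{Z}$ define \[ U_r(n) = \sum_{k\in\mathbb{Z}} \binom{n}{k}\left|\frac{n}{2}-k\right|^r, \] where $0^0=1$, and for $n\ge0$ the binomial coefficient $\binom{n}{k}$ is $0$ if $k<0$ or $k>n$ and $\frac{n!}{(n-k)!\,k!}$ otherwise; $U_r(n)=0$ for $n<0$. For $k\in\mathbb{N}$ and real $x$, $(x)_k = x(x+1)\cdots(x+k-1)$ is the rising factorial (Pochhammer symbol), with $(x)_0=1$. -}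

module Defs where

open import Data.Nat as ℕ using (ℕ; zero; suc; _!)
open import Data.Nat.Combinatorics using (_C_)
open import Data.Integer using (+_)
open import Data.Rational using (ℚ; 0ℚ; 1ℚ; _+_; _*_; _-_; -_; ∣_∣; _÷_; ≢-nonZero)
open import Data.Rational.Properties using (_≟_)
import Data.Rational as Q
open import Relation.Nullary using (yes; no)

ℕ→ℚ : ℕ → ℚ
ℕ→ℚ n = (+ n) Q./ 1

½ : ℚ
½ = (+ 1) Q./ 2

infixr 8 _^_
_^_ : ℚ → ℕ → ℚ
x ^ zero  = 1ℚ
x ^ suc m = x * (x ^ m)

poch : ℚ → ℕ → ℚ
poch x zero    = 1ℚ
poch x (suc k) = poch x k * (x + ℕ→ℚ k)

-- division on ℚ; only ever applied to nonzero divisors in the statement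
-- (the value 0 for a zero divisor is an irrelevant junk convention)
infixl 7 _÷₀_
_÷₀_ : ℚ → ℚ → ℚ
p ÷₀ q with q ≟ 0ℚ
... | yes _  = 0ℚ
... | no q≢0 = _÷_ p q {{≢-nonZero q≢0}}

-- Σ[ i ∈ [a, b] ] f i  =  f a + f (a+1) + ... + f b   (empty if b < a)
-- implemented as sum over i = a, ..., a + len - 1
sumFrom : ℕ → ℕ → (ℕ → ℚ) → ℚ
sumFrom a zero      f = 0ℚ
sumFrom a (suc len) f = f a + sumFrom (suc a) len f

sumIcc : ℕ → ℕ → (ℕ → ℚ) → ℚ
sumIcc a b f = sumFrom a (suc b ℕ.∸ a) f

sum1jkr : ℕ → (ℕ → ℕ → ℚ) → ℚ
sum1jkr r g = sumIcc 1 r (λ k → sumIcc 1 k (λ j → g j k))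

-- U_r(n) = Σ_{k ∈ ℤ} C(n,k) |n/2 - k|^r  for n ≥ 0; the binomial coefficient
-- vanishes outside 0 ≤ k ≤ n, so the sum is over k = 0..n.
U : ℕ → ℕ → ℚ
U r n = sumIcc 0 n (λ k → ℕ→ℚ (n C k) * (∣ ℕ→ℚ n * ½ - ℕ→ℚ k ∣ ^ r))

sgn : ℕ → ℚ
sgn j = (- 1ℚ) ^ j

-- Write |t|^r through the central factorials t^[m], for which the central difference
-- δf(t) = f(t + 1/2) - f(t - 1/2) acts as a derivative: δ t^[m+1] = (m+1) t^[m]. Hence
-- t^N = Σ_m a_m t^[m] with a_m m! = δ^m(t^N)(0), and expanding δ^m by the binomial theorem and
-- folding it with the parity of t^N gives a_m as the inner sums over j. Since
-- U_r(n) = Σ_i C(n,i) g(n/2 - i) with g = |t|^r, it remains to evaluate this binomial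
-- functional on t^[m]. Two Pascal steps express it for n + 2 through 4 g + δδ g at n, which
-- for g = t^[2k] gives a recurrence solved by 2^n (-1)^k (-n/2)_k (1/2)_k: this is U_{2r}(n).
-- For odd n the same computation with g(|t|), g = t^[2k+1], picks up a boundary term from
-- the kink of |t| at ±1/2 and gives U_{2r-1}(2n-1). Finally C(2n,i)(n - i) =
-- n (C(2n-1,i) - C(2n-1,i-1)) and Abel summation reduce U_{2r+1}(2n) to the odd case applied
-- to δ(t^{2r}).

module Submission where

open import Defs
open import Data.Nat as ℕ using (ℕ; zero; suc; _!; _≤_; _<_; _≥_; z≤n; s≤s)
import Data.Nat.Properties as ℕP
open import Data.Nat.Combinatorics
  using (_C_; nCk+nC[k+1]≡[n+1]C[k+1]; k>n⇒nCk≡0; nCk≡nC[n∸k]; nCk≡n!/k![n-k]!; k![n∸k]!∣n!)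
open import Data.Nat.DivMod using (m*[n/m]≡n)
import Data.Nat.Coprimality as Coprime
import Data.Integer as ℤ
import Data.Integer.Properties as ℤP
open import Data.Rational as Q using (ℚ; 0ℚ; 1ℚ; _+_; _*_; _-_; -_; ∣_∣; mkℚ)
import Data.Rational.Properties as QP
open import Data.Rational.Solver using (module +-*-Solver)
open +-*-Solver using (solve; _:+_; _:*_; _:-_; :-_; con; _:=_)
open import Data.Sum using (_⊎_; inj₁; inj₂)
open import Data.Empty using (⊥-elim)
open import Data.Product using (_×_; _,_)
open import Relation.Nullary using (yes; no)
open import Relation.Binary.Definitions using (Tri; tri<; tri≈; tri>)
open import Relation.Binary.PropositionalEquality
open ≡-Reasoning

cong₃ : ∀ {A B C D : Set} (f : A → B → C → D) {x x′ y y′ z z′} → x ≡ x′ → y ≡ y′ → z ≡ z′ → f x y z ≡ f x′ y′ z′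
cong₃ f refl refl refl = refl

ℕ→ℚ≡mkℚ : ∀ n → ℕ→ℚ n ≡ mkℚ (ℤ.+ n) 0 (Coprime.sym (Coprime.1-coprimeTo n))
ℕ→ℚ≡mkℚ n = QP.normalize-coprime (Coprime.sym (Coprime.1-coprimeTo n))

ℕ→ℚ-suc : ∀ n → ℕ→ℚ (suc n) ≡ 1ℚ + ℕ→ℚ n
ℕ→ℚ-suc n rewrite ℕ→ℚ≡mkℚ n =
  cong (λ z → z Q./ 1) (sym (cong (λ w → ℤ.+ 1 ℤ.+ w) (ℤP.*-identityʳ (ℤ.+ n))))

ℕ→ℚ-+ : ∀ m n → ℕ→ℚ (m ℕ.+ n) ≡ ℕ→ℚ m + ℕ→ℚ n
ℕ→ℚ-+ zero    n = sym (QP.+-identityˡ (ℕ→ℚ n))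
ℕ→ℚ-+ (suc m) n = begin
  ℕ→ℚ (suc (m ℕ.+ n))    ≡⟨ ℕ→ℚ-suc (m ℕ.+ n) ⟩
  1ℚ + ℕ→ℚ (m ℕ.+ n)     ≡⟨ cong (1ℚ +_) (ℕ→ℚ-+ m n) ⟩
  1ℚ + (ℕ→ℚ m + ℕ→ℚ n)   ≡⟨ sym (QP.+-assoc 1ℚ (ℕ→ℚ m) (ℕ→ℚ n)) ⟩
  (1ℚ + ℕ→ℚ m) + ℕ→ℚ n   ≡⟨ cong (_+ ℕ→ℚ n) (sym (ℕ→ℚ-suc m)) ⟩
  ℕ→ℚ (suc m) + ℕ→ℚ n    ∎

ℕ→ℚ-* : ∀ m n → ℕ→ℚ (m ℕ.* n) ≡ ℕ→ℚ m * ℕ→ℚ n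
ℕ→ℚ-* zero    n = sym (QP.*-zeroˡ (ℕ→ℚ n))
ℕ→ℚ-* (suc m) n = begin
  ℕ→ℚ (n ℕ.+ m ℕ.* n)     ≡⟨ ℕ→ℚ-+ n (m ℕ.* n) ⟩
  ℕ→ℚ n + ℕ→ℚ (m ℕ.* n)   ≡⟨ cong (ℕ→ℚ n +_) (ℕ→ℚ-* m n) ⟩
  ℕ→ℚ n + ℕ→ℚ m * ℕ→ℚ n   ≡⟨ solve 2 (λ a b → b :+ a :* b := (con 1ℚ :+ a) :* b) refl (ℕ→ℚ m) (ℕ→ℚ n) ⟩
  (1ℚ + ℕ→ℚ m) * ℕ→ℚ n    ≡⟨ cong (_* ℕ→ℚ n) (sym (ℕ→ℚ-suc m)) ⟩
  ℕ→ℚ (suc m) * ℕ→ℚ n     ∎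

ℕ→ℚ-∸ : ∀ m n → n ≤ m → ℕ→ℚ (m ℕ.∸ n) ≡ ℕ→ℚ m - ℕ→ℚ n
ℕ→ℚ-∸ m n n≤m = begin
  ℕ→ℚ (m ℕ.∸ n)                  ≡⟨ solve 2 (λ a b → a := a :+ b :- b) refl (ℕ→ℚ (m ℕ.∸ n)) (ℕ→ℚ n) ⟩
  ℕ→ℚ (m ℕ.∸ n) + ℕ→ℚ n - ℕ→ℚ n  ≡⟨ cong (_- ℕ→ℚ n) (sym (ℕ→ℚ-+ (m ℕ.∸ n) n)) ⟩
  ℕ→ℚ (m ℕ.∸ n ℕ.+ n) - ℕ→ℚ n    ≡⟨ cong (λ z → ℕ→ℚ z - ℕ→ℚ n) (ℕP.m∸n+n≡m n≤m) ⟩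
  ℕ→ℚ m - ℕ→ℚ n                  ∎

ℕ→ℚ-injective : ∀ {m n} → ℕ→ℚ m ≡ ℕ→ℚ n → m ≡ n
ℕ→ℚ-injective {m} {n} eq rewrite ℕ→ℚ≡mkℚ m | ℕ→ℚ≡mkℚ n = ℤP.+-injective (cong Q.↥_ eq)

ℕ→ℚ-≢0 : ∀ n → .{{ℕ.NonZero n}} → ℕ→ℚ n ≢ 0ℚ
ℕ→ℚ-≢0 (suc n) eq with () ← ℕ→ℚ-injective {suc n} {0} eq

ℕ→ℚ-!≢0 : ∀ n → ℕ→ℚ (n !) ≢ 0ℚ
ℕ→ℚ-!≢0 n = ℕ→ℚ-≢0 (n !) {{n ℕP.!≢0}}

∣ℕ→ℚ∣ : ∀ a → ∣ ℕ→ℚ a ∣ ≡ ℕ→ℚ a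
∣ℕ→ℚ∣ a rewrite ℕ→ℚ≡mkℚ a = refl

∣ℕ→ℚ+½∣ : ∀ a → ∣ ℕ→ℚ a + ½ ∣ ≡ ℕ→ℚ a + ½
∣ℕ→ℚ+½∣ a = QP.0≤p⇒∣p∣≡p (QP.nonNegative⁻¹ (ℕ→ℚ a + ½)
  {{QP.nonNeg+nonNeg⇒nonNeg (ℕ→ℚ a) {{QP.normalize-nonNeg a 1}} ½ {{_}}}})

∣-[ℕ→ℚ+½]∣ : ∀ a → ∣ - (ℕ→ℚ a + ½) ∣ ≡ ℕ→ℚ a + ½
∣-[ℕ→ℚ+½]∣ a = trans (QP.∣-p∣≡∣p∣ (ℕ→ℚ a + ½)) (∣ℕ→ℚ+½∣ a)

*-cancelʳ-≢0 : ∀ a b q → q ≢ 0ℚ → a * q ≡ b * q → a ≡ b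
*-cancelʳ-≢0 a b q q≢0 eq = begin
  a               ≡⟨ sym (QP.*-identityʳ a) ⟩
  a * 1ℚ          ≡⟨ cong (a *_) (sym (QP.*-inverseʳ q {{Q.≢-nonZero q≢0}})) ⟩
  a * (q * iq)    ≡⟨ sym (QP.*-assoc a q iq) ⟩
  a * q * iq      ≡⟨ cong (_* iq) eq ⟩
  b * q * iq      ≡⟨ QP.*-assoc b q iq ⟩
  b * (q * iq)    ≡⟨ cong (b *_) (QP.*-inverseʳ q {{Q.≢-nonZero q≢0}}) ⟩
  b * 1ℚ          ≡⟨ QP.*-identityʳ b ⟩
  b               ∎
  where iq = Q.1/_ q {{Q.≢-nonZero q≢0}}

*-≢0 : ∀ a b → a ≢ 0ℚ → b ≢ 0ℚ → a * b ≢ 0ℚ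
*-≢0 a b a≢0 b≢0 ab≡0 = b≢0 (begin
  b               ≡⟨ sym (QP.*-identityˡ b) ⟩
  1ℚ * b          ≡⟨ cong (_* b) (sym (QP.*-inverseˡ a {{Q.≢-nonZero a≢0}})) ⟩
  ia * a * b      ≡⟨ QP.*-assoc ia a b ⟩
  ia * (a * b)    ≡⟨ cong (ia *_) ab≡0 ⟩
  ia * 0ℚ         ≡⟨ QP.*-zeroʳ ia ⟩
  0ℚ              ∎)
  where ia = Q.1/_ a {{Q.≢-nonZero a≢0}}

÷₀-*-cancel : ∀ p q → q ≢ 0ℚ → (p ÷₀ q) * q ≡ p
÷₀-*-cancel p q q≢0 with q QP.≟ 0ℚ
... | yes q≡0 = ⊥-elim (q≢0 q≡0)
... | no  q≢0 = begin
  p * iq * q      ≡⟨ QP.*-assoc p iq q ⟩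
  p * (iq * q)    ≡⟨ cong (p *_) (QP.*-inverseˡ q {{Q.≢-nonZero q≢0}}) ⟩
  p * 1ℚ          ≡⟨ QP.*-identityʳ p ⟩
  p               ∎
  where iq = Q.1/_ q {{Q.≢-nonZero q≢0}}

÷₀-unique : ∀ a p q → q ≢ 0ℚ → a * q ≡ p → a ≡ p ÷₀ q
÷₀-unique a p q q≢0 eq = *-cancelʳ-≢0 a (p ÷₀ q) q q≢0 (trans eq (sym (÷₀-*-cancel p q q≢0)))

÷₀-*-both : ∀ p q c → q ≢ 0ℚ → c ≢ 0ℚ → p ÷₀ q ≡ (p * c) ÷₀ (q * c)
÷₀-*-both p q c q≢0 c≢0 = ÷₀-unique (p ÷₀ q) (p * c) (q * c) (*-≢0 q c q≢0 c≢0)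
  (trans (sym (QP.*-assoc (p ÷₀ q) q c)) (cong (_* c) (÷₀-*-cancel p q q≢0)))

x≡-x⇒x≡0 : ∀ x → x ≡ - x → x ≡ 0ℚ
x≡-x⇒x≡0 x e = begin
  x               ≡⟨ solve 1 (λ x → x := (x :+ x) :* con ½) refl x ⟩
  (x + x) * ½     ≡⟨ cong (λ z → (x + z) * ½) e ⟩
  (x + - x) * ½   ≡⟨ solve 1 (λ x → (x :+ :- x) :* con ½ := con 0ℚ) refl x ⟩
  0ℚ              ∎

sgn-suc : ∀ n → sgn (suc n) ≡ - sgn n
sgn-suc n = solve 1 (λ s → con (- 1ℚ) :* s := :- s) refl (sgn n)

sgn-+ : ∀ m n → sgn (m ℕ.+ n) ≡ sgn m * sgn n
sgn-+ zero    n = sym (QP.*-identityˡ (sgn n))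
sgn-+ (suc m) n = trans (cong (- 1ℚ *_) (sgn-+ m n)) (sym (QP.*-assoc (- 1ℚ) (sgn m) (sgn n)))

sgn*sgn : ∀ n → sgn n * sgn n ≡ 1ℚ
sgn*sgn zero    = refl
sgn*sgn (suc n) = trans (solve 1 (λ s → con (- 1ℚ) :* s :* (con (- 1ℚ) :* s) := s :* s) refl (sgn n)) (sgn*sgn n)

sgn-∸ : ∀ k i → i ≤ k → sgn (k ℕ.∸ i) ≡ sgn k * sgn i
sgn-∸ k i i≤k = begin
  sgn (k ℕ.∸ i)                   ≡⟨ sym (QP.*-identityʳ (sgn (k ℕ.∸ i))) ⟩
  sgn (k ℕ.∸ i) * 1ℚ              ≡⟨ cong (sgn (k ℕ.∸ i) *_) (sym (sgn*sgn i)) ⟩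
  sgn (k ℕ.∸ i) * (sgn i * sgn i) ≡⟨ sym (QP.*-assoc (sgn (k ℕ.∸ i)) (sgn i) (sgn i)) ⟩
  sgn (k ℕ.∸ i) * sgn i * sgn i   ≡⟨ cong (_* sgn i) (sym (sgn-+ (k ℕ.∸ i) i)) ⟩
  sgn (k ℕ.∸ i ℕ.+ i) * sgn i     ≡⟨ cong (λ z → sgn z * sgn i) (ℕP.m∸n+n≡m i≤k) ⟩
  sgn k * sgn i                   ∎

-[x]^n : ∀ x n → (- x) ^ n ≡ sgn n * x ^ n
-[x]^n x zero    = refl
-[x]^n x (suc n) = begin
  - x * (- x) ^ n          ≡⟨ cong (- x *_) (-[x]^n x n) ⟩
  - x * (sgn n * x ^ n)    ≡⟨ solve 3 (λ a s p → (:- a) :* (s :* p) := con (- 1ℚ) :* s :* (a :* p)) refl x (sgn n) (x ^ n) ⟩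
  sgn (suc n) * (x * x ^ n) ∎

0^suc : ∀ n → 0ℚ ^ suc n ≡ 0ℚ
0^suc n = QP.*-zeroˡ (0ℚ ^ n)

infix 8 2·_ 1+2·_

2·_ : ℕ → ℕ
2· zero  = 0
2· suc k = suc (suc (2· k))

1+2·_ : ℕ → ℕ
1+2· k = suc (2· k)

2·≡2* : ∀ k → 2· k ≡ 2 ℕ.* k
2·≡2* zero    = refl
2·≡2* (suc k) = trans (cong (λ z → suc (suc z)) (2·≡2* k)) (cong suc (sym (ℕP.+-suc k (k ℕ.+ 0))))

2·≡+ : ∀ k → 2· k ≡ k ℕ.+ k
2·≡+ k = trans (2·≡2* k) (cong (k ℕ.+_) (ℕP.+-identityʳ k))

2·-mono-≤ : ∀ {a b} → a ≤ b → 2· a ≤ 2· b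
2·-mono-≤ z≤n       = z≤n
2·-mono-≤ (s≤s a≤b) = s≤s (s≤s (2·-mono-≤ a≤b))

m≤2·m : ∀ m → m ≤ 2· m
m≤2·m m = ℕP.≤-trans (ℕP.m≤m+n m m) (ℕP.≤-reflexive (sym (2·≡+ m)))

2·m∸m≡m : ∀ m → 2· m ℕ.∸ m ≡ m
2·m∸m≡m m = trans (cong (ℕ._∸ m) (2·≡+ m)) (ℕP.m+n∸m≡n m m)

ℕ→ℚ-2· : ∀ k → ℕ→ℚ (2· k) ≡ ℕ→ℚ k + ℕ→ℚ k
ℕ→ℚ-2· k = trans (cong ℕ→ℚ (2·≡+ k)) (ℕ→ℚ-+ k k)

half : ℕ → ℚ
half m = ℕ→ℚ m * ½

half-suc : ∀ m → half (suc m) ≡ half m + ½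
half-suc m = trans (cong (_* ½) (ℕ→ℚ-suc m)) (solve 1 (λ a → (con 1ℚ :+ a) :* con ½ := a :* con ½ :+ con ½) refl (ℕ→ℚ m))

half-suc-suc : ∀ m → half (suc (suc m)) ≡ half m + 1ℚ
half-suc-suc m = trans (half-suc (suc m))
  (trans (cong (_+ ½) (half-suc m)) (solve 1 (λ a → a :+ con ½ :+ con ½ := a :+ con 1ℚ) refl (half m)))

half+half : ∀ m → half m + half m ≡ ℕ→ℚ m
half+half m = solve 1 (λ a → a :* con ½ :+ a :* con ½ := a) refl (ℕ→ℚ m)

half-2· : ∀ k → half (2· k) ≡ ℕ→ℚ k
half-2· k = trans (cong (_* ½) (ℕ→ℚ-2· k)) (solve 1 (λ a → (a :+ a) :* con ½ := a) refl (ℕ→ℚ k))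

half-1+2· : ∀ k → half (1+2· k) ≡ ℕ→ℚ k + ½
half-1+2· k = trans (half-suc (2· k)) (cong (_+ ½) (half-2· k))

sgn-2· : ∀ k → sgn (2· k) ≡ 1ℚ
sgn-2· zero    = refl
sgn-2· (suc k) = trans (solve 1 (λ s → con (- 1ℚ) :* (con (- 1ℚ) :* s) := s) refl (sgn (2· k))) (sgn-2· k)

sgn-1+2· : ∀ k → sgn (1+2· k) ≡ - 1ℚ
sgn-1+2· k = trans (sgn-suc (2· k)) (cong -_ (sgn-2· k))

-[x]^2· : ∀ x r → (- x) ^ 2· r ≡ x ^ 2· r
-[x]^2· x r = trans (-[x]^n x (2· r)) (trans (cong (_* x ^ 2· r) (sgn-2· r)) (QP.*-identityˡ _))

-[x]^1+2· : ∀ x r → (- x) ^ 1+2· r ≡ - (x ^ 1+2· r)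
-[x]^1+2· x r = trans (-[x]^n x (1+2· r))
  (trans (cong (_* x ^ 1+2· r) (sgn-1+2· r)) (solve 1 (λ p → :- con 1ℚ :* p := :- p) refl _))

0^2· : ∀ r → 0 < r → 0ℚ ^ 2· r ≡ 0ℚ
0^2· (suc r) _ = 0^suc (1+2· r)

∣x∣^2· : ∀ x r → ∣ x ∣ ^ 2· r ≡ x ^ 2· r
∣x∣^2· x r with QP.∣p∣≡p∨∣p∣≡-p x
... | inj₁ e = cong (_^ 2· r) e
... | inj₂ e = trans (cong (_^ 2· r) e) (-[x]^2· x r)

Σ : ℕ → (ℕ → ℚ) → ℚ
Σ N f = sumFrom 0 N f

sumFrom-suc : ∀ a N f → sumFrom (suc a) N f ≡ sumFrom a N (λ i → f (suc i))
sumFrom-suc a zero    f = refl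
sumFrom-suc a (suc N) f = cong (f (suc a) +_) (sumFrom-suc (suc a) N f)

sumFrom≡Σ : ∀ a N f → sumFrom a N f ≡ Σ N (λ i → f (a ℕ.+ i))
sumFrom≡Σ zero    N f = refl
sumFrom≡Σ (suc a) N f = trans (sumFrom-suc a N f) (sumFrom≡Σ a N (λ i → f (suc i)))

Σ-head : ∀ N f → Σ (suc N) f ≡ f 0 + Σ N (λ i → f (suc i))
Σ-head N f = cong (f 0 +_) (sumFrom-suc 0 N f)

Σ-last : ∀ N f → Σ (suc N) f ≡ Σ N f + f N
Σ-last zero    f = trans (QP.+-identityʳ (f 0)) (sym (QP.+-identityˡ (f 0)))
Σ-last (suc N) f = begin
  Σ (suc (suc N)) f                         ≡⟨ Σ-head (suc N) f ⟩
  f 0 + Σ (suc N) (λ i → f (suc i))         ≡⟨ cong (f 0 +_) (Σ-last N (λ i → f (suc i))) ⟩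
  f 0 + (Σ N (λ i → f (suc i)) + f (suc N)) ≡⟨ sym (QP.+-assoc (f 0) _ _) ⟩
  f 0 + Σ N (λ i → f (suc i)) + f (suc N)   ≡⟨ cong (_+ f (suc N)) (sym (Σ-head N f)) ⟩
  Σ (suc N) f + f (suc N)                   ∎

Σ-cong : ∀ N {f g} → (∀ i → i < N → f i ≡ g i) → Σ N f ≡ Σ N g
Σ-cong zero    eq = refl
Σ-cong (suc N) {f} {g} eq = begin
  Σ (suc N) f   ≡⟨ Σ-last N f ⟩
  Σ N f + f N   ≡⟨ cong₂ _+_ (Σ-cong N (λ i i<N → eq i (ℕP.m<n⇒m<1+n i<N))) (eq N (ℕP.n<1+n N)) ⟩
  Σ N g + g N   ≡⟨ sym (Σ-last N g) ⟩
  Σ (suc N) g   ∎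

Σ-cong′ : ∀ N {f g} → (∀ i → f i ≡ g i) → Σ N f ≡ Σ N g
Σ-cong′ N eq = Σ-cong N (λ i _ → eq i)

Σ-+ : ∀ N f g → Σ N (λ i → f i + g i) ≡ Σ N f + Σ N g
Σ-+ zero    f g = refl
Σ-+ (suc N) f g = begin
  Σ (suc N) (λ i → f i + g i)          ≡⟨ Σ-last N _ ⟩
  Σ N (λ i → f i + g i) + (f N + g N)  ≡⟨ cong (_+ (f N + g N)) (Σ-+ N f g) ⟩
  Σ N f + Σ N g + (f N + g N)          ≡⟨ solve 4 (λ a b c d → a :+ b :+ (c :+ d) := a :+ c :+ (b :+ d)) refl (Σ N f) (Σ N g) (f N) (g N) ⟩
  (Σ N f + f N) + (Σ N g + g N)        ≡⟨ sym (cong₂ _+_ (Σ-last N f) (Σ-last N g)) ⟩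
  Σ (suc N) f + Σ (suc N) g            ∎

Σ-*ˡ : ∀ N c f → Σ N (λ i → c * f i) ≡ c * Σ N f
Σ-*ˡ zero    c f = sym (QP.*-zeroʳ c)
Σ-*ˡ (suc N) c f = begin
  Σ (suc N) (λ i → c * f i)       ≡⟨ Σ-last N _ ⟩
  Σ N (λ i → c * f i) + c * f N   ≡⟨ cong (_+ c * f N) (Σ-*ˡ N c f) ⟩
  c * Σ N f + c * f N             ≡⟨ sym (QP.*-distribˡ-+ c (Σ N f) (f N)) ⟩
  c * (Σ N f + f N)               ≡⟨ cong (c *_) (sym (Σ-last N f)) ⟩
  c * Σ (suc N) f                 ∎

Σ-*ʳ : ∀ N c f → Σ N (λ i → f i * c) ≡ Σ N f * c
Σ-*ʳ N c f = trans (Σ-cong′ N (λ i → QP.*-comm (f i) c)) (trans (Σ-*ˡ N c f) (QP.*-comm c (Σ N f)))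

Σ-zero : ∀ N f → (∀ i → i < N → f i ≡ 0ℚ) → Σ N f ≡ 0ℚ
Σ-zero zero    f eq = refl
Σ-zero (suc N) f eq = begin
  Σ (suc N) f   ≡⟨ Σ-last N f ⟩
  Σ N f + f N   ≡⟨ cong₂ _+_ (Σ-zero N f (λ i i<N → eq i (ℕP.m<n⇒m<1+n i<N))) (eq N (ℕP.n<1+n N)) ⟩
  0ℚ + 0ℚ       ≡⟨ QP.+-identityˡ 0ℚ ⟩
  0ℚ            ∎

Σ-- : ∀ N f g → Σ N (λ i → f i - g i) ≡ Σ N f - Σ N g
Σ-- N f g = begin
  Σ N (λ i → f i - g i)              ≡⟨ Σ-+ N f (λ i → - g i) ⟩
  Σ N f + Σ N (λ i → - g i)          ≡⟨ cong (Σ N f +_) (Σ-cong′ N (λ i → solve 1 (λ x → :- x := con (- 1ℚ) :* x) refl (g i))) ⟩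
  Σ N f + Σ N (λ i → - 1ℚ * g i)     ≡⟨ cong (Σ N f +_) (Σ-*ˡ N (- 1ℚ) g) ⟩
  Σ N f + - 1ℚ * Σ N g               ≡⟨ solve 2 (λ a b → a :+ con (- 1ℚ) :* b := a :- b) refl (Σ N f) (Σ N g) ⟩
  Σ N f - Σ N g                      ∎

Σ-split : ∀ A B f → Σ (A ℕ.+ B) f ≡ Σ A f + Σ B (λ i → f (A ℕ.+ i))
Σ-split zero    B f = sym (QP.+-identityˡ _)
Σ-split (suc A) B f = begin
  Σ (suc (A ℕ.+ B)) f                                                   ≡⟨ Σ-head (A ℕ.+ B) f ⟩
  f 0 + Σ (A ℕ.+ B) (λ i → f (suc i))                                   ≡⟨ cong (f 0 +_) (Σ-split A B (λ i → f (suc i))) ⟩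
  f 0 + (Σ A (λ i → f (suc i)) + Σ B (λ i → f (suc (A ℕ.+ i))))         ≡⟨ sym (QP.+-assoc (f 0) _ _) ⟩
  f 0 + Σ A (λ i → f (suc i)) + Σ B (λ i → f (suc (A ℕ.+ i)))           ≡⟨ cong (_+ Σ B (λ i → f (suc (A ℕ.+ i)))) (sym (Σ-head A f)) ⟩
  Σ (suc A) f + Σ B (λ i → f (suc A ℕ.+ i))                             ∎

Σ-swap : ∀ A B (f : ℕ → ℕ → ℚ) → Σ A (λ i → Σ B (f i)) ≡ Σ B (λ k → Σ A (λ i → f i k))
Σ-swap zero    B f = sym (Σ-zero B (λ _ → 0ℚ) (λ _ _ → refl))
Σ-swap (suc A) B f = begin
  Σ (suc A) (λ i → Σ B (f i))                        ≡⟨ Σ-last A _ ⟩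
  Σ A (λ i → Σ B (f i)) + Σ B (f A)                  ≡⟨ cong (_+ Σ B (f A)) (Σ-swap A B f) ⟩
  Σ B (λ k → Σ A (λ i → f i k)) + Σ B (f A)          ≡⟨ sym (Σ-+ B _ _) ⟩
  Σ B (λ k → Σ A (λ i → f i k) + f A k)              ≡⟨ Σ-cong′ B (λ k → sym (Σ-last A (λ i → f i k))) ⟩
  Σ B (λ k → Σ (suc A) (λ i → f i k))                ∎

Σ-reverse : ∀ N f → Σ N f ≡ Σ N (λ i → f (N ℕ.∸ suc i))
Σ-reverse zero    f = refl
Σ-reverse (suc N) f = begin
  Σ (suc N) f                               ≡⟨ Σ-last N f ⟩
  Σ N f + f N                               ≡⟨ cong (_+ f N) (Σ-reverse N f) ⟩
  Σ N (λ i → f (N ℕ.∸ suc i)) + f N         ≡⟨ QP.+-comm _ (f N) ⟩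
  f N + Σ N (λ i → f (N ℕ.∸ suc i))         ≡⟨ sym (Σ-head N (λ i → f (suc N ℕ.∸ suc i))) ⟩
  Σ (suc N) (λ i → f (suc N ℕ.∸ suc i))     ∎

Σ-single : ∀ N f m → m < N → (∀ i → i < N → i ≢ m → f i ≡ 0ℚ) → Σ N f ≡ f m
Σ-single (suc N) f m m<N z with m ℕP.≟ N
... | yes refl = begin
  Σ (suc m) f      ≡⟨ Σ-last m f ⟩
  Σ m f + f m      ≡⟨ cong (_+ f m) (Σ-zero m f (λ i i<m → z i (ℕP.m<n⇒m<1+n i<m) (λ { refl → ℕP.<-irrefl refl i<m }))) ⟩
  0ℚ + f m         ≡⟨ QP.+-identityˡ (f m) ⟩
  f m              ∎
... | no m≢N = begin
  Σ (suc N) f      ≡⟨ Σ-last N f ⟩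
  Σ N f + f N      ≡⟨ cong₂ _+_ (Σ-single N f m m<N′ (λ i i<N → z i (ℕP.m<n⇒m<1+n i<N))) (z N (ℕP.n<1+n N) (λ e → m≢N (sym e))) ⟩
  f m + 0ℚ         ≡⟨ QP.+-identityʳ (f m) ⟩
  f m              ∎
  where m<N′ = ℕP.≤∧≢⇒< (ℕP.≤-pred m<N) m≢N

Σ-even-odd : ∀ r (F : ℕ → ℚ) → Σ (2· suc r) F ≡ Σ (suc r) (λ k → F (2· k) + F (1+2· k))
Σ-even-odd zero    F = solve 2 (λ a b → a :+ (b :+ con 0ℚ) := a :+ b :+ con 0ℚ) refl (F 0) (F 1)
Σ-even-odd (suc r) F = begin
  Σ (suc (suc (2· suc r))) F                                ≡⟨ Σ-last (suc (2· suc r)) F ⟩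
  Σ (suc (2· suc r)) F + F (1+2· suc r)                     ≡⟨ cong (_+ F (1+2· suc r)) (Σ-last (2· suc r) F) ⟩
  Σ (2· suc r) F + F (2· suc r) + F (1+2· suc r)            ≡⟨ cong (λ z → z + F (2· suc r) + F (1+2· suc r)) (Σ-even-odd r F) ⟩
  Σ (suc r) G + F (2· suc r) + F (1+2· suc r)               ≡⟨ QP.+-assoc (Σ (suc r) G) _ _ ⟩
  Σ (suc r) G + G (suc r)                                   ≡⟨ sym (Σ-last (suc r) G) ⟩
  Σ (suc (suc r)) G                                         ∎
  where
  G : ℕ → ℚ
  G k = F (2· k) + F (1+2· k)

binom : ℕ → ℕ → ℚ
binom m i = ℕ→ℚ (m C i)

binom-pascal : ∀ m i → binom (suc m) (suc i) ≡ binom m i + binom m (suc i)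
binom-pascal m i = trans (cong ℕ→ℚ (sym (nCk+nC[k+1]≡[n+1]C[k+1] m i))) (ℕ→ℚ-+ (m C i) (m C suc i))

binom-over : ∀ m i → m < i → binom m i ≡ 0ℚ
binom-over m i m<i = cong ℕ→ℚ (k>n⇒nCk≡0 m<i)

binom-sym : ∀ m i → i ≤ m → binom m (m ℕ.∸ i) ≡ binom m i
binom-sym m i i≤m = cong ℕ→ℚ (sym (nCk≡nC[n∸k] i≤m))

k!*[n∸k]!*binom : ∀ n k → k ≤ n → ℕ→ℚ (k !) * ℕ→ℚ ((n ℕ.∸ k) !) * binom n k ≡ ℕ→ℚ (n !)
k!*[n∸k]!*binom n k k≤n = begin
  ℕ→ℚ (k !) * ℕ→ℚ ((n ℕ.∸ k) !) * binom n k    ≡⟨ cong (_* binom n k) (sym (ℕ→ℚ-* (k !) ((n ℕ.∸ k) !))) ⟩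
  ℕ→ℚ (k ! ℕ.* (n ℕ.∸ k) !) * binom n k        ≡⟨ sym (ℕ→ℚ-* (k ! ℕ.* (n ℕ.∸ k) !) (n C k)) ⟩
  ℕ→ℚ (k ! ℕ.* (n ℕ.∸ k) ! ℕ.* (n C k))        ≡⟨ cong ℕ→ℚ ℕ-identity ⟩
  ℕ→ℚ (n !)                                     ∎
  where
  ℕ-identity : k ! ℕ.* (n ℕ.∸ k) ! ℕ.* (n C k) ≡ n !
  ℕ-identity = trans (cong (k ! ℕ.* (n ℕ.∸ k) ! ℕ.*_) (nCk≡n!/k![n-k]! k≤n))
                     (m*[n/m]≡n {{k ℕP.!* (n ℕ.∸ k) !≢0}} (k![n∸k]!∣n! k≤n))

binom-absorb : ∀ o i → ℕ→ℚ (suc i) * binom (suc o) (suc i) ≡ ℕ→ℚ (suc o) * binom o i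
binom-absorb o i = by-cases (ℕP.≤-<-connex i o)
  where
  F : ℚ
  F = ℕ→ℚ (i !) * ℕ→ℚ ((o ℕ.∸ i) !)
  absorb : i ≤ o → ℕ→ℚ (suc i) * binom (suc o) (suc i) ≡ ℕ→ℚ (suc o) * binom o i
  absorb i≤o = *-cancelʳ-≢0 (ℕ→ℚ (suc i) * binom (suc o) (suc i)) (ℕ→ℚ (suc o) * binom o i) F
    (*-≢0 (ℕ→ℚ (i !)) (ℕ→ℚ ((o ℕ.∸ i) !)) (ℕ→ℚ-!≢0 i) (ℕ→ℚ-!≢0 (o ℕ.∸ i))) (begin
    ℕ→ℚ (suc i) * binom (suc o) (suc i) * F
      ≡⟨ solve 4 (λ a c f g → a :* c :* (f :* g) := a :* f :* g :* c) refl (ℕ→ℚ (suc i)) (binom (suc o) (suc i)) (ℕ→ℚ (i !)) (ℕ→ℚ ((o ℕ.∸ i) !)) ⟩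
    ℕ→ℚ (suc i) * ℕ→ℚ (i !) * ℕ→ℚ ((o ℕ.∸ i) !) * binom (suc o) (suc i)
      ≡⟨ cong (λ z → z * ℕ→ℚ ((o ℕ.∸ i) !) * binom (suc o) (suc i)) (sym (ℕ→ℚ-* (suc i) (i !))) ⟩
    ℕ→ℚ (suc i !) * ℕ→ℚ ((suc o ℕ.∸ suc i) !) * binom (suc o) (suc i)
      ≡⟨ k!*[n∸k]!*binom (suc o) (suc i) (s≤s i≤o) ⟩
    ℕ→ℚ (suc o !)
      ≡⟨ ℕ→ℚ-* (suc o) (o !) ⟩
    ℕ→ℚ (suc o) * ℕ→ℚ (o !)
      ≡⟨ cong (ℕ→ℚ (suc o) *_) (sym (k!*[n∸k]!*binom o i i≤o)) ⟩
    ℕ→ℚ (suc o) * (F * binom o i)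
      ≡⟨ solve 3 (λ a f c → a :* (f :* c) := a :* c :* f) refl (ℕ→ℚ (suc o)) F (binom o i) ⟩
    ℕ→ℚ (suc o) * binom o i * F ∎)
  vanish : o < i → ℕ→ℚ (suc i) * binom (suc o) (suc i) ≡ ℕ→ℚ (suc o) * binom o i
  vanish o<i = begin
    ℕ→ℚ (suc i) * binom (suc o) (suc i) ≡⟨ cong (ℕ→ℚ (suc i) *_) (binom-over (suc o) (suc i) (s≤s o<i)) ⟩
    ℕ→ℚ (suc i) * 0ℚ                    ≡⟨ QP.*-zeroʳ (ℕ→ℚ (suc i)) ⟩
    0ℚ                                  ≡⟨ sym (QP.*-zeroʳ (ℕ→ℚ (suc o))) ⟩
    ℕ→ℚ (suc o) * 0ℚ                    ≡⟨ cong (ℕ→ℚ (suc o) *_) (sym (binom-over o i o<i)) ⟩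
    ℕ→ℚ (suc o) * binom o i             ∎
  by-cases : i ≤ o ⊎ o < i → ℕ→ℚ (suc i) * binom (suc o) (suc i) ≡ ℕ→ℚ (suc o) * binom o i
  by-cases (inj₁ i≤o) = absorb i≤o
  by-cases (inj₂ o<i) = vanish o<i

-- C(2m+2, m+1) = 2 C(2m+1, m+1) by Pascal and symmetry, then absorb the factor m+1.
central-binom-suc : ∀ m → binom (2· suc m) (suc m) * ℕ→ℚ (suc m) ≡ (1ℚ + 1ℚ) * ℕ→ℚ (1+2· m) * binom (2· m) m
central-binom-suc m = begin
  binom (2· suc m) (suc m) * M1                  ≡⟨ cong (_* M1) (binom-pascal (1+2· m) m) ⟩
  (binom (1+2· m) m + B) * M1                    ≡⟨ cong (λ z → (z + B) * M1) sym-eq ⟩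
  (B + B) * M1                                   ≡⟨ solve 2 (λ b m → (b :+ b) :* m := (con 1ℚ :+ con 1ℚ) :* (m :* b)) refl B M1 ⟩
  (1ℚ + 1ℚ) * (M1 * B)                           ≡⟨ cong ((1ℚ + 1ℚ) *_) (binom-absorb (2· m) m) ⟩
  (1ℚ + 1ℚ) * (ℕ→ℚ (1+2· m) * binom (2· m) m)    ≡⟨ sym (QP.*-assoc (1ℚ + 1ℚ) (ℕ→ℚ (1+2· m)) (binom (2· m) m)) ⟩
  (1ℚ + 1ℚ) * ℕ→ℚ (1+2· m) * binom (2· m) m      ∎
  where
  M1 B : ℚ
  M1 = ℕ→ℚ (suc m)
  B  = binom (1+2· m) (suc m)
  sym-eq : binom (1+2· m) m ≡ B
  sym-eq = trans (cong (binom (1+2· m)) (sym (2·m∸m≡m m))) (binom-sym (1+2· m) (suc m) (s≤s (m≤2·m m)))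

Σ-binom-suc : ∀ m (F : ℕ → ℚ) →
  Σ (suc (suc m)) (λ i → binom (suc m) i * F i) ≡ Σ (suc m) (λ i → binom m i * (F i + F (suc i)))
Σ-binom-suc m F = begin
  Σ (suc (suc m)) (λ i → binom (suc m) i * F i)
    ≡⟨ Σ-head (suc m) (λ i → binom (suc m) i * F i) ⟩
  H0 0 + Σ (suc m) (λ i → binom (suc m) (suc i) * F (suc i))
    ≡⟨ cong (H0 0 +_) (Σ-cong′ (suc m) (λ i → trans (cong (_* F (suc i)) (binom-pascal m i)) (QP.*-distribʳ-+ (F (suc i)) (binom m i) (binom m (suc i))))) ⟩
  H0 0 + Σ (suc m) (λ i → H1 i + H2 i)
    ≡⟨ cong (H0 0 +_) (Σ-+ (suc m) H1 H2) ⟩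
  H0 0 + (X + Σ (suc m) H2)
    ≡⟨ cong (λ z → H0 0 + (X + z)) (Σ-last m H2) ⟩
  H0 0 + (X + (Y + binom m (suc m) * F (suc m)))
    ≡⟨ cong (λ z → H0 0 + (X + (Y + z * F (suc m)))) (binom-over m (suc m) (ℕP.n<1+n m)) ⟩
  H0 0 + (X + (Y + 0ℚ * F (suc m)))
    ≡⟨ solve 4 (λ a x y b → a :+ (x :+ (y :+ con 0ℚ :* b)) := a :+ y :+ x) refl (H0 0) X Y (F (suc m)) ⟩
  (H0 0 + Y) + X
    ≡⟨ cong (_+ X) (sym (Σ-head m H0)) ⟩
  Σ (suc m) H0 + X
    ≡⟨ sym (Σ-+ (suc m) H0 H1) ⟩
  Σ (suc m) (λ i → H0 i + H1 i)
    ≡⟨ Σ-cong′ (suc m) (λ i → sym (QP.*-distribˡ-+ (binom m i) (F i) (F (suc i)))) ⟩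
  Σ (suc m) (λ i → binom m i * (F i + F (suc i))) ∎
  where
  H0 H1 H2 : ℕ → ℚ
  H0 i = binom m i * F i
  H1 i = binom m i * F (suc i)
  H2 i = binom m (suc i) * F (suc i)
  X Y : ℚ
  X = Σ (suc m) H1
  Y = Σ m H2

-- Central differences and central factorials

δ : (ℚ → ℚ) → ℚ → ℚ
δ f t = f (t + ½) - f (t - ½)

δ^ : ℕ → (ℚ → ℚ) → ℚ → ℚ
δ^ zero    f = f
δ^ (suc k) f = δ^ k (δ f)

δ^-cong : ∀ k {f g : ℚ → ℚ} → (∀ t → f t ≡ g t) → ∀ t → δ^ k f t ≡ δ^ k g t
δ^-cong zero    e t = e t
δ^-cong (suc k) e t = δ^-cong k (λ s → cong₂ _-_ (e (s + ½)) (e (s - ½))) t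

δ^-scale : ∀ k c (f : ℚ → ℚ) t → δ^ k (λ s → c * f s) t ≡ c * δ^ k f t
δ^-scale zero    c f t = refl
δ^-scale (suc k) c f t = trans
  (δ^-cong k (λ s → solve 3 (λ c a b → c :* a :- c :* b := c :* (a :- b)) refl c (f (s + ½)) (f (s - ½))) t)
  (δ^-scale k c (δ f) t)

-- cfact m t is the central factorial t (t + m/2 - 1) (t + m/2 - 2) ⋯ (t - m/2 + 1).
cfact : ℕ → ℚ → ℚ
cfact zero          t = 1ℚ
cfact (suc zero)    t = t
cfact (suc (suc m)) t = cfact m t * (t * t - half m * half m)

fall : ℚ → ℕ → ℚ
fall x zero    = 1ℚ
fall x (suc n) = x * fall (x - 1ℚ) n

fall-last : ∀ x n → fall x (suc n) ≡ fall x n * (x - ℕ→ℚ n)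
fall-last x zero    = solve 1 (λ a → a :* con 1ℚ := con 1ℚ :* (a :- con 0ℚ)) refl x
fall-last x (suc n) = begin
  x * fall (x - 1ℚ) (suc n)                   ≡⟨ cong (x *_) (fall-last (x - 1ℚ) n) ⟩
  x * (fall (x - 1ℚ) n * (x - 1ℚ - ℕ→ℚ n))    ≡⟨ solve 3 (λ a b c → a :* (b :* (a :- con 1ℚ :- c)) := a :* b :* (a :- (con 1ℚ :+ c))) refl x (fall (x - 1ℚ) n) (ℕ→ℚ n) ⟩
  x * fall (x - 1ℚ) n * (x - (1ℚ + ℕ→ℚ n))    ≡⟨ cong (λ z → x * fall (x - 1ℚ) n * (x - z)) (sym (ℕ→ℚ-suc n)) ⟩
  x * fall (x - 1ℚ) n * (x - ℕ→ℚ (suc n))     ∎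

x+1-1≡x : ∀ x → x + 1ℚ - 1ℚ ≡ x
x+1-1≡x x = solve 1 (λ a → a :+ con 1ℚ :- con 1ℚ := a) refl x

x-1+1≡x : ∀ x → x - 1ℚ + 1ℚ ≡ x
x-1+1≡x x = solve 1 (λ a → a :- con 1ℚ :+ con 1ℚ := a) refl x

fall-Δ : ∀ x n → fall (x + 1ℚ) (suc n) - fall x (suc n) ≡ ℕ→ℚ (suc n) * fall x n
fall-Δ x zero    = solve 1 (λ a → (a :+ con 1ℚ) :* con 1ℚ :- a :* con 1ℚ := con 1ℚ :* con 1ℚ) refl x
fall-Δ x (suc n) = begin
  (x + 1ℚ) * fall (x + 1ℚ - 1ℚ) (suc n) - x * fall (x - 1ℚ) (suc n)
    ≡⟨ cong₂ (λ u v → (x + 1ℚ) * u - x * v) (cong (λ z → fall z (suc n)) (x+1-1≡x x)) lower ⟩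
  (x + 1ℚ) * (x * B) - x * (x * B - ℕ→ℚ (suc n) * B)
    ≡⟨ cong (λ z → (x + 1ℚ) * (x * B) - x * (x * B - z * B)) (ℕ→ℚ-suc n) ⟩
  (x + 1ℚ) * (x * B) - x * (x * B - (1ℚ + ℕ→ℚ n) * B)
    ≡⟨ solve 3 (λ a b c → (a :+ con 1ℚ) :* (a :* b) :- a :* (a :* b :- (con 1ℚ :+ c) :* b) := (con 1ℚ :+ (con 1ℚ :+ c)) :* (a :* b)) refl x B (ℕ→ℚ n) ⟩
  (1ℚ + (1ℚ + ℕ→ℚ n)) * (x * B)
    ≡⟨ cong (_* (x * B)) (sym (trans (ℕ→ℚ-suc (suc n)) (cong (1ℚ +_) (ℕ→ℚ-suc n)))) ⟩
  ℕ→ℚ (suc (suc n)) * (x * B) ∎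
  where
  B : ℚ
  B = fall (x - 1ℚ) n
  lower : fall (x - 1ℚ) (suc n) ≡ x * B - ℕ→ℚ (suc n) * B
  lower = begin
    fall (x - 1ℚ) (suc n)                                   ≡⟨ solve 2 (λ a b → a := b :- (b :- a)) refl (fall (x - 1ℚ) (suc n)) (x * B) ⟩
    x * B - (x * B - fall (x - 1ℚ) (suc n))                 ≡⟨ cong (λ z → x * B - (fall z (suc n) - fall (x - 1ℚ) (suc n))) (sym (x-1+1≡x x)) ⟩
    x * B - (fall (x - 1ℚ + 1ℚ) (suc n) - fall (x - 1ℚ) (suc n)) ≡⟨ cong (λ z → x * B - z) (fall-Δ (x - 1ℚ) n) ⟩
    x * B - ℕ→ℚ (suc n) * B                                 ∎

cfact≡fall-mean : ∀ m t → cfact m t ≡ (fall (t + half m) m + fall (t + half m - 1ℚ) m) * ½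
cfact≡fall-mean zero          t = refl
cfact≡fall-mean (suc zero)    t = solve 1 (λ t → t := ((t :+ con ½) :* con 1ℚ :+ (t :+ con ½ :- con 1ℚ) :* con 1ℚ) :* con ½) refl t
cfact≡fall-mean (suc (suc m)) t = begin
  cfact m t * (t * t - half m * half m)
    ≡⟨ cong (_* (t * t - half m * half m)) (cfact≡fall-mean m t) ⟩
  (X + Y) * ½ * (t * t - half m * half m)
    ≡⟨ cong (λ z → (X + Y) * ½ * (z * z - half m * half m)) (solve 2 (λ t a → t := t :+ a :- a) refl t (half m)) ⟩
  (X + Y) * ½ * ((x - half m) * (x - half m) - half m * half m)
    ≡⟨ step ⟩
  ((x + 1ℚ) * (x * Y) + X * (x - ℕ→ℚ m) * (x - ℕ→ℚ m - 1ℚ)) * ½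
    ≡⟨ cong₂ (λ u v → (u + v) * ½) up down ⟩
  (fall (x + 1ℚ) (suc (suc m)) + fall x (suc (suc m))) * ½
    ≡⟨ cong₂ (λ u v → (fall u (suc (suc m)) + fall v (suc (suc m))) * ½) x+1≡ (trans (sym (x+1-1≡x x)) (cong (_- 1ℚ) x+1≡)) ⟩
  (fall (t + half (suc (suc m))) (suc (suc m)) + fall (t + half (suc (suc m)) - 1ℚ) (suc (suc m))) * ½ ∎
  where
  x X Y : ℚ
  x = t + half m
  X = fall x m
  Y = fall (x - 1ℚ) m
  X[x-m]≡xY : X * (x - ℕ→ℚ m) ≡ x * Y
  X[x-m]≡xY = sym (fall-last x m)
  step : (X + Y) * ½ * ((x - half m) * (x - half m) - half m * half m)
       ≡ ((x + 1ℚ) * (x * Y) + X * (x - ℕ→ℚ m) * (x - ℕ→ℚ m - 1ℚ)) * ½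
  step = begin
    (X + Y) * ½ * ((x - half m) * (x - half m) - half m * half m)
      ≡⟨ solve 4 (λ x h X Y → (X :+ Y) :* con ½ :* ((x :- h) :* (x :- h) :- h :* h) := con ½ :* (X :* (x :- (h :+ h))) :* x :+ con ½ :* Y :* (x :- (h :+ h)) :* x) refl x (half m) X Y ⟩
    ½ * (X * (x - (half m + half m))) * x + ½ * Y * (x - (half m + half m)) * x
      ≡⟨ cong (λ z → ½ * (X * (x - z)) * x + ½ * Y * (x - z) * x) (half+half m) ⟩
    ½ * (X * (x - ℕ→ℚ m)) * x + ½ * Y * (x - ℕ→ℚ m) * x
      ≡⟨ cong (λ z → ½ * z * x + ½ * Y * (x - ℕ→ℚ m) * x) X[x-m]≡xY ⟩
    ½ * (x * Y) * x + ½ * Y * (x - ℕ→ℚ m) * x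
      ≡⟨ solve 3 (λ x n Y → con ½ :* (x :* Y) :* x :+ con ½ :* Y :* (x :- n) :* x := ((x :+ con 1ℚ) :* (x :* Y) :+ (x :* Y) :* (x :- n :- con 1ℚ)) :* con ½) refl x (ℕ→ℚ m) Y ⟩
    ((x + 1ℚ) * (x * Y) + (x * Y) * (x - ℕ→ℚ m - 1ℚ)) * ½
      ≡⟨ cong (λ z → ((x + 1ℚ) * (x * Y) + z * (x - ℕ→ℚ m - 1ℚ)) * ½) (sym X[x-m]≡xY) ⟩
    ((x + 1ℚ) * (x * Y) + X * (x - ℕ→ℚ m) * (x - ℕ→ℚ m - 1ℚ)) * ½ ∎
  up : (x + 1ℚ) * (x * Y) ≡ fall (x + 1ℚ) (suc (suc m))
  up = cong (λ z → (x + 1ℚ) * (z * fall (z - 1ℚ) m)) (sym (x+1-1≡x x))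
  down : X * (x - ℕ→ℚ m) * (x - ℕ→ℚ m - 1ℚ) ≡ fall x (suc (suc m))
  down = begin
    X * (x - ℕ→ℚ m) * (x - ℕ→ℚ m - 1ℚ)    ≡⟨ cong (λ z → z * (x - ℕ→ℚ m - 1ℚ)) (sym (fall-last x m)) ⟩
    fall x (suc m) * (x - ℕ→ℚ m - 1ℚ)     ≡⟨ cong (λ z → fall x (suc m) * z) (trans (solve 2 (λ a b → a :- b :- con 1ℚ := a :- (con 1ℚ :+ b)) refl x (ℕ→ℚ m)) (cong (λ z → x - z) (sym (ℕ→ℚ-suc m)))) ⟩
    fall x (suc m) * (x - ℕ→ℚ (suc m))    ≡⟨ sym (fall-last x (suc m)) ⟩
    fall x (suc (suc m))                  ∎
  x+1≡ : x + 1ℚ ≡ t + half (suc (suc m))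
  x+1≡ = trans (solve 2 (λ t a → t :+ a :+ con 1ℚ := t :+ (a :+ con 1ℚ)) refl t (half m)) (cong (t +_) (sym (half-suc-suc m)))

δ-cfact : ∀ m t → δ (cfact (suc m)) t ≡ ℕ→ℚ (suc m) * cfact m t
δ-cfact m t = begin
  cfact (suc m) (t + ½) - cfact (suc m) (t - ½)
    ≡⟨ cong₂ _-_ (cfact≡fall-mean (suc m) (t + ½)) (cfact≡fall-mean (suc m) (t - ½)) ⟩
  (F (t + ½ + half (suc m)) + F (t + ½ + half (suc m) - 1ℚ)) * ½ - (F (t - ½ + half (suc m)) + F (t - ½ + half (suc m) - 1ℚ)) * ½
    ≡⟨ cong₂ (λ u v → (F u + F (u - 1ℚ)) * ½ - (F v + F (v - 1ℚ)) * ½) shift₊ shift₋ ⟩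
  (F (x + 1ℚ) + F (x + 1ℚ - 1ℚ)) * ½ - (F x + F (x - 1ℚ)) * ½
    ≡⟨ cong (λ z → (F (x + 1ℚ) + F z) * ½ - (F x + F (x - 1ℚ)) * ½) (x+1-1≡x x) ⟩
  (F (x + 1ℚ) + F x) * ½ - (F x + F (x - 1ℚ)) * ½
    ≡⟨ solve 3 (λ a b c → (a :+ b) :* con ½ :- (b :+ c) :* con ½ := (a :- b) :* con ½ :+ (b :- c) :* con ½) refl (F (x + 1ℚ)) (F x) (F (x - 1ℚ)) ⟩
  (F (x + 1ℚ) - F x) * ½ + (F x - F (x - 1ℚ)) * ½
    ≡⟨ cong₂ (λ u v → u * ½ + v * ½) (fall-Δ x m) lowerΔ ⟩
  N * fall x m * ½ + N * fall (x - 1ℚ) m * ½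
    ≡⟨ solve 3 (λ n a b → n :* a :* con ½ :+ n :* b :* con ½ := n :* ((a :+ b) :* con ½)) refl N (fall x m) (fall (x - 1ℚ) m) ⟩
  N * ((fall x m + fall (x - 1ℚ) m) * ½)
    ≡⟨ cong (N *_) (sym (cfact≡fall-mean m t)) ⟩
  N * cfact m t ∎
  where
  F : ℚ → ℚ
  F y = fall y (suc m)
  x N : ℚ
  x = t + half m
  N = ℕ→ℚ (suc m)
  shift₊ : t + ½ + half (suc m) ≡ x + 1ℚ
  shift₊ = trans (cong (t + ½ +_) (half-suc m)) (solve 2 (λ t a → t :+ con ½ :+ (a :+ con ½) := t :+ a :+ con 1ℚ) refl t (half m))
  shift₋ : t - ½ + half (suc m) ≡ x
  shift₋ = trans (cong (t - ½ +_) (half-suc m)) (solve 2 (λ t a → t :- con ½ :+ (a :+ con ½) := t :+ a) refl t (half m))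
  lowerΔ : F x - F (x - 1ℚ) ≡ N * fall (x - 1ℚ) m
  lowerΔ = trans (cong (λ z → F z - F (x - 1ℚ)) (sym (x-1+1≡x x))) (fall-Δ (x - 1ℚ) m)

δδ-cfact : ∀ m t → δ (δ (cfact (suc (suc m)))) t ≡ ℕ→ℚ (suc (suc m)) * ℕ→ℚ (suc m) * cfact m t
δδ-cfact m t = begin
  δ (cfact (suc (suc m))) (t + ½) - δ (cfact (suc (suc m))) (t - ½)
    ≡⟨ cong₂ _-_ (δ-cfact (suc m) (t + ½)) (δ-cfact (suc m) (t - ½)) ⟩
  N * cfact (suc m) (t + ½) - N * cfact (suc m) (t - ½)
    ≡⟨ solve 3 (λ n a b → n :* a :- n :* b := n :* (a :- b)) refl N (cfact (suc m) (t + ½)) (cfact (suc m) (t - ½)) ⟩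
  N * δ (cfact (suc m)) t
    ≡⟨ cong (N *_) (δ-cfact m t) ⟩
  N * (ℕ→ℚ (suc m) * cfact m t)
    ≡⟨ sym (QP.*-assoc N (ℕ→ℚ (suc m)) (cfact m t)) ⟩
  N * ℕ→ℚ (suc m) * cfact m t ∎
  where
  N : ℚ
  N = ℕ→ℚ (suc (suc m))

cfact-neg : ∀ m t → cfact m (- t) ≡ sgn m * cfact m t
cfact-neg zero          t = refl
cfact-neg (suc zero)    t = solve 1 (λ t → :- t := con (- 1ℚ) :* con 1ℚ :* t) refl t
cfact-neg (suc (suc m)) t = begin
  cfact m (- t) * (- t * - t - half m * half m)      ≡⟨ cong (_* (- t * - t - half m * half m)) (cfact-neg m t) ⟩
  sgn m * cfact m t * (- t * - t - half m * half m)  ≡⟨ solve 4 (λ s a t h → s :* a :* (:- t :* :- t :- h :* h) := con (- 1ℚ) :* (con (- 1ℚ) :* s) :* (a :* (t :* t :- h :* h))) refl (sgn m) (cfact m t) t (half m) ⟩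
  sgn (suc (suc m)) * cfact (suc (suc m)) t          ∎

cfact-0 : ∀ m → cfact (suc m) 0ℚ ≡ 0ℚ
cfact-0 zero          = refl
cfact-0 (suc zero)    = refl
cfact-0 (suc (suc m)) = trans (cong (_* c) (cfact-0 m)) (QP.*-zeroˡ c)
  where c = 0ℚ * 0ℚ - half (suc m) * half (suc m)

cfact-½ : ∀ k → cfact (1+2· suc k) ½ ≡ 0ℚ
cfact-½ zero    = refl
cfact-½ (suc k) = trans (cong (_* c) (cfact-½ k)) (QP.*-zeroˡ c)
  where c = ½ * ½ - half (1+2· suc k) * half (1+2· suc k)

wsum : ℕ → (ℕ → ℚ) → (ℕ → ℚ) → (ℚ → ℚ) → ℚ
wsum N w p f = Σ N (λ i → w i * f (p i))

wsum-cong : ∀ N w p {f g : ℚ → ℚ} → (∀ t → f t ≡ g t) → wsum N w p f ≡ wsum N w p g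
wsum-cong N w p e = Σ-cong′ N (λ i → cong (w i *_) (e (p i)))

wsum-Σ : ∀ N w p K (a : ℕ → ℚ) (g : ℕ → ℚ → ℚ) →
  wsum N w p (λ t → Σ K (λ m → a m * g m t)) ≡ Σ K (λ m → a m * wsum N w p (g m))
wsum-Σ N w p K a g = begin
  Σ N (λ i → w i * Σ K (λ m → a m * g m (p i)))       ≡⟨ Σ-cong′ N (λ i → sym (Σ-*ˡ K (w i) (λ m → a m * g m (p i)))) ⟩
  Σ N (λ i → Σ K (λ m → w i * (a m * g m (p i))))     ≡⟨ Σ-swap N K (λ i m → w i * (a m * g m (p i))) ⟩
  Σ K (λ m → Σ N (λ i → w i * (a m * g m (p i))))     ≡⟨ Σ-cong′ K (λ m → Σ-cong′ N (λ i → solve 3 (λ x y z → x :* (y :* z) := y :* (x :* z)) refl (w i) (a m) (g m (p i)))) ⟩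
  Σ K (λ m → Σ N (λ i → a m * (w i * g m (p i))))     ≡⟨ Σ-cong′ K (λ m → Σ-*ˡ N (a m) (λ i → w i * g m (p i))) ⟩
  Σ K (λ m → a m * wsum N w p (g m))                  ∎

wsum-linear : ∀ N w p a b (f g : ℚ → ℚ) → wsum N w p (λ t → a * f t + b * g t) ≡ a * wsum N w p f + b * wsum N w p g
wsum-linear N w p a b f g = begin
  Σ N (λ i → w i * (a * f (p i) + b * g (p i)))
    ≡⟨ Σ-cong′ N (λ i → solve 5 (λ c a b x y → c :* (a :* x :+ b :* y) := a :* (c :* x) :+ b :* (c :* y)) refl (w i) a b (f (p i)) (g (p i))) ⟩
  Σ N (λ i → a * (w i * f (p i)) + b * (w i * g (p i)))
    ≡⟨ Σ-+ N _ _ ⟩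
  Σ N (λ i → a * (w i * f (p i))) + Σ N (λ i → b * (w i * g (p i)))
    ≡⟨ cong₂ _+_ (Σ-*ˡ N a (λ i → w i * f (p i))) (Σ-*ˡ N b (λ i → w i * g (p i))) ⟩
  a * wsum N w p f + b * wsum N w p g ∎

wsum-scale : ∀ N w p c (f : ℚ → ℚ) → wsum N w p (λ t → c * f t) ≡ c * wsum N w p f
wsum-scale N w p c f = begin
  wsum N w p (λ t → c * f t)                  ≡⟨ wsum-cong N w p (λ t → solve 2 (λ c x → c :* x := c :* x :+ con 0ℚ :* x) refl c (f t)) ⟩
  wsum N w p (λ t → c * f t + 0ℚ * f t)       ≡⟨ wsum-linear N w p c 0ℚ f f ⟩
  c * wsum N w p f + 0ℚ * wsum N w p f        ≡⟨ solve 2 (λ c x → c :* x :+ con 0ℚ :* x := c :* x) refl c (wsum N w p f) ⟩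
  c * wsum N w p f                            ∎

δ^-explicit : ∀ k (f : ℚ → ℚ) t → δ^ k f t ≡ wsum (suc k) (λ i → binom k i * sgn i) (λ i → t + half k - ℕ→ℚ i) f
δ^-explicit zero    f t = trans (cong f (solve 1 (λ t → t := t :+ con 0ℚ :- con 0ℚ) refl t))
  (solve 1 (λ x → x := con 1ℚ :* con 1ℚ :* x :+ con 0ℚ) refl (f (t + 0ℚ - 0ℚ)))
δ^-explicit (suc k) f t = begin
  δ^ k (δ f) t
    ≡⟨ δ^-explicit k (δ f) t ⟩
  Σ (suc k) (λ i → binom k i * sgn i * δ f (t + half k - ℕ→ℚ i))
    ≡⟨ Σ-cong′ (suc k) (λ i → trans (QP.*-assoc (binom k i) (sgn i) (δ f (t + half k - ℕ→ℚ i))) (cong (binom k i *_) (signed-δ i))) ⟩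
  Σ (suc k) (λ i → binom k i * (F i + F (suc i)))
    ≡⟨ sym (Σ-binom-suc k F) ⟩
  Σ (suc (suc k)) (λ i → binom (suc k) i * F i)
    ≡⟨ Σ-cong′ (suc (suc k)) (λ i → sym (QP.*-assoc (binom (suc k) i) (sgn i) (f (t + half (suc k) - ℕ→ℚ i)))) ⟩
  Σ (suc (suc k)) (λ i → binom (suc k) i * sgn i * f (t + half (suc k) - ℕ→ℚ i)) ∎
  where
  F : ℕ → ℚ
  F i = sgn i * f (t + half (suc k) - ℕ→ℚ i)
  signed-δ : ∀ i → sgn i * δ f (t + half k - ℕ→ℚ i) ≡ F i + F (suc i)
  signed-δ i = begin
    sgn i * (f (u + ½) - f (u - ½))
      ≡⟨ cong₂ (λ a b → sgn i * (f a - f b)) u+½ u-½ ⟩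
    sgn i * (f (t + half (suc k) - ℕ→ℚ i) - f (t + half (suc k) - ℕ→ℚ (suc i)))
      ≡⟨ solve 3 (λ s a b → s :* (a :- b) := s :* a :+ con (- 1ℚ) :* s :* b) refl (sgn i) _ _ ⟩
    F i + F (suc i) ∎
    where
    u = t + half k - ℕ→ℚ i
    u+½ : u + ½ ≡ t + half (suc k) - ℕ→ℚ i
    u+½ = trans (solve 3 (λ t h n → t :+ h :- n :+ con ½ := t :+ (h :+ con ½) :- n) refl t (half k) (ℕ→ℚ i))
                (cong (λ z → t + z - ℕ→ℚ i) (sym (half-suc k)))
    u-½ : u - ½ ≡ t + half (suc k) - ℕ→ℚ (suc i)
    u-½ = trans (solve 3 (λ t h n → t :+ h :- n :- con ½ := t :+ (h :+ con ½) :- (con 1ℚ :+ n)) refl t (half k) (ℕ→ℚ i))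
                (cong₂ (λ z w → t + z - w) (sym (half-suc k)) (sym (ℕ→ℚ-suc i)))

ℕ→ℚ-suc-1 : ∀ m → ℕ→ℚ (suc m) - 1ℚ ≡ ℕ→ℚ m
ℕ→ℚ-suc-1 m = trans (cong (_- 1ℚ) (ℕ→ℚ-suc m)) (solve 1 (λ a → con 1ℚ :+ a :- con 1ℚ := a) refl (ℕ→ℚ m))

fall-ℕ-suc : ∀ m k → fall (ℕ→ℚ (suc m)) (suc k) ≡ ℕ→ℚ (suc m) * fall (ℕ→ℚ m) k
fall-ℕ-suc m k = cong (λ z → ℕ→ℚ (suc m) * fall z k) (ℕ→ℚ-suc-1 m)

fall-ℕ-diag : ∀ k → fall (ℕ→ℚ k) k ≡ ℕ→ℚ (k !)
fall-ℕ-diag zero    = refl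
fall-ℕ-diag (suc k) = trans (fall-ℕ-suc k k) (trans (cong (ℕ→ℚ (suc k) *_) (fall-ℕ-diag k)) (sym (ℕ→ℚ-* (suc k) (k !))))

fall-ℕ-over : ∀ m k → m < k → fall (ℕ→ℚ m) k ≡ 0ℚ
fall-ℕ-over zero    (suc k) _         = QP.*-zeroˡ (fall (0ℚ - 1ℚ) k)
fall-ℕ-over (suc m) (suc k) (s≤s m<k) = trans (fall-ℕ-suc m k) (trans (cong (ℕ→ℚ (suc m) *_) (fall-ℕ-over m k m<k)) (QP.*-zeroʳ (ℕ→ℚ (suc m))))

δ^-cfact : ∀ k m t → δ^ k (cfact m) t ≡ fall (ℕ→ℚ m) k * cfact (m ℕ.∸ k) t
δ^-cfact zero    m       t = sym (QP.*-identityˡ (cfact m t))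
δ^-cfact (suc k) zero    t = begin
  δ^ k (δ (cfact 0)) t         ≡⟨ δ^-cong k (λ s → sym (QP.*-zeroˡ 1ℚ)) t ⟩
  δ^ k (λ _ → 0ℚ * 1ℚ) t       ≡⟨ δ^-scale k 0ℚ (λ _ → 1ℚ) t ⟩
  0ℚ * δ^ k (λ _ → 1ℚ) t       ≡⟨ QP.*-zeroˡ (δ^ k (λ _ → 1ℚ) t) ⟩
  0ℚ                           ≡⟨ sym (fall-ℕ-over 0 (suc k) (s≤s z≤n)) ⟩
  fall (ℕ→ℚ 0) (suc k)         ≡⟨ sym (QP.*-identityʳ (fall (ℕ→ℚ 0) (suc k))) ⟩
  fall (ℕ→ℚ 0) (suc k) * 1ℚ    ∎
δ^-cfact (suc k) (suc m) t = begin
  δ^ k (δ (cfact (suc m))) t                         ≡⟨ δ^-cong k (δ-cfact m) t ⟩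
  δ^ k (λ s → ℕ→ℚ (suc m) * cfact m s) t             ≡⟨ δ^-scale k (ℕ→ℚ (suc m)) (cfact m) t ⟩
  ℕ→ℚ (suc m) * δ^ k (cfact m) t                     ≡⟨ cong (ℕ→ℚ (suc m) *_) (δ^-cfact k m t) ⟩
  ℕ→ℚ (suc m) * (fall (ℕ→ℚ m) k * cfact (m ℕ.∸ k) t) ≡⟨ sym (QP.*-assoc (ℕ→ℚ (suc m)) _ _) ⟩
  ℕ→ℚ (suc m) * fall (ℕ→ℚ m) k * cfact (m ℕ.∸ k) t   ≡⟨ cong (_* cfact (m ℕ.∸ k) t) (sym (fall-ℕ-suc m k)) ⟩
  fall (ℕ→ℚ (suc m)) (suc k) * cfact (m ℕ.∸ k) t     ∎

δ₀ : ℕ → (ℚ → ℚ) → ℚ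
δ₀ k f = δ^ k f 0ℚ

δ₀-cfact-diag : ∀ k → δ₀ k (cfact k) ≡ ℕ→ℚ (k !)
δ₀-cfact-diag k = begin
  δ₀ k (cfact k)                                ≡⟨ δ^-cfact k k 0ℚ ⟩
  fall (ℕ→ℚ k) k * cfact (k ℕ.∸ k) 0ℚ           ≡⟨ cong (λ z → fall (ℕ→ℚ k) k * cfact z 0ℚ) (ℕP.n∸n≡0 k) ⟩
  fall (ℕ→ℚ k) k * 1ℚ                           ≡⟨ QP.*-identityʳ _ ⟩
  fall (ℕ→ℚ k) k                                ≡⟨ fall-ℕ-diag k ⟩
  ℕ→ℚ (k !)                                     ∎

δ₀-cfact-off : ∀ k m → m ≢ k → δ₀ k (cfact m) ≡ 0ℚ
δ₀-cfact-off k m m≢k with ℕP.<-cmp m k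
... | tri< m<k _ _ = trans (δ^-cfact k m 0ℚ) (trans (cong (_* c) (fall-ℕ-over m k m<k)) (QP.*-zeroˡ c))
  where c = cfact (m ℕ.∸ k) 0ℚ
... | tri≈ _ m≡k _ = ⊥-elim (m≢k m≡k)
... | tri> _ _ k<m = trans (δ^-cfact k m 0ℚ)
  (trans (cong (λ z → fall (ℕ→ℚ m) k * cfact z 0ℚ) (ℕP.+-∸-assoc 1 k<m))
         (trans (cong (fall (ℕ→ℚ m) k *_) (cfact-0 (m ℕ.∸ suc k))) (QP.*-zeroʳ (fall (ℕ→ℚ m) k))))

δ₀-coefficient : ∀ K (a : ℕ → ℚ) (f : ℚ → ℚ) → (∀ t → f t ≡ Σ K (λ m → a m * cfact m t)) →
  ∀ k → k < K → δ₀ k f ≡ a k * ℕ→ℚ (k !)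
δ₀-coefficient K a f f≡ k k<K = begin
  δ₀ k f                              ≡⟨ δ^-explicit k f 0ℚ ⟩
  wsum (suc k) w p f                  ≡⟨ wsum-cong (suc k) w p f≡ ⟩
  wsum (suc k) w p (λ t → Σ K (λ m → a m * cfact m t))
                                      ≡⟨ wsum-Σ (suc k) w p K a cfact ⟩
  Σ K (λ m → a m * wsum (suc k) w p (cfact m))
                                      ≡⟨ Σ-cong′ K (λ m → cong (a m *_) (sym (δ^-explicit k (cfact m) 0ℚ))) ⟩
  Σ K (λ m → a m * δ₀ k (cfact m))    ≡⟨ Σ-single K _ k k<K (λ m _ m≢k → trans (cong (a m *_) (δ₀-cfact-off k m m≢k)) (QP.*-zeroʳ (a m))) ⟩
  a k * δ₀ k (cfact k)                ≡⟨ cong (a k *_) (δ₀-cfact-diag k) ⟩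
  a k * ℕ→ℚ (k !)                     ∎
  where
  w p : ℕ → ℚ
  w i = binom k i * sgn i
  p i = 0ℚ + half k - ℕ→ℚ i

δ₀-coefficient-zero : ∀ K (a : ℕ → ℚ) (f : ℚ → ℚ) → (∀ t → f t ≡ Σ K (λ m → a m * cfact m t)) →
  ∀ k → k < K → δ₀ k f ≡ 0ℚ → a k ≡ 0ℚ
δ₀-coefficient-zero K a f f≡ k k<K δ₀≡0 = *-cancelʳ-≢0 (a k) 0ℚ (ℕ→ℚ (k !)) (ℕ→ℚ-!≢0 k)
  (trans (sym (δ₀-coefficient K a f f≡ k k<K)) (trans δ₀≡0 (sym (QP.*-zeroˡ (ℕ→ℚ (k !))))))

-- Expansion of powers in central factorials

Σ-pad : ∀ A B f → (∀ i → i < B → f (A ℕ.+ i) ≡ 0ℚ) → Σ (A ℕ.+ B) f ≡ Σ A f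
Σ-pad A B f f≡0 = trans (Σ-split A B f) (trans (cong (Σ A f +_) (Σ-zero B (λ i → f (A ℕ.+ i)) f≡0)) (QP.+-identityʳ (Σ A f)))

shift2 : (ℕ → ℚ) → ℕ → ℚ
shift2 a (suc (suc m)) = a m
shift2 a _             = 0ℚ

Σ-shift2 : ∀ N a (g : ℕ → ℚ) → Σ (suc (suc N)) (λ m → shift2 a m * g m) ≡ Σ N (λ m → a m * g (suc (suc m)))
Σ-shift2 N a g = begin
  Σ (suc (suc N)) (λ m → shift2 a m * g m)                                   ≡⟨ Σ-head (suc N) (λ m → shift2 a m * g m) ⟩
  0ℚ * g 0 + Σ (suc N) (λ m → shift2 a (suc m) * g (suc m))                  ≡⟨ cong (0ℚ * g 0 +_) (Σ-head N (λ m → shift2 a (suc m) * g (suc m))) ⟩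
  0ℚ * g 0 + (0ℚ * g 1 + Σ N (λ m → a m * g (suc (suc m))))                  ≡⟨ solve 3 (λ x y s → con 0ℚ :* x :+ (con 0ℚ :* y :+ s) := s) refl (g 0) (g 1) (Σ N (λ m → a m * g (suc (suc m)))) ⟩
  Σ N (λ m → a m * g (suc (suc m)))                                          ∎

record CFExpansion (N : ℕ) : Set where
  field
    coeff    : ℕ → ℚ
    expands  : ∀ t → t ^ N ≡ Σ (suc N) (λ m → coeff m * cfact m t)
    vanishes : ∀ m → suc N ≤ m → coeff m ≡ 0ℚ

-- From t² t^[m] = t^[m+2] + (m/2)² t^[m].
cfExpansion : ∀ N → CFExpansion N
cfExpansion zero = record
  { coeff    = λ { zero → 1ℚ ; (suc _) → 0ℚ }
  ; expands  = λ t → refl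
  ; vanishes = λ { zero () ; (suc m) _ → refl }
  }
cfExpansion (suc zero) = record
  { coeff    = λ { (suc zero) → 1ℚ ; _ → 0ℚ }
  ; expands  = λ t → solve 1 (λ t → t :* con 1ℚ := con 0ℚ :* con 1ℚ :+ (con 1ℚ :* t :+ con 0ℚ)) refl t
  ; vanishes = λ { zero () ; (suc zero) (s≤s ()) ; (suc (suc m)) _ → refl }
  }
cfExpansion (suc (suc N)) = record { coeff = b ; expands = expands ; vanishes = vanishes }
  where
  open CFExpansion (cfExpansion N) renaming (coeff to a; expands to a-expands; vanishes to a-vanishes)
  b : ℕ → ℚ
  b m = shift2 a m + a m * (half m * half m)
  vanishes : ∀ m → suc (suc (suc N)) ≤ m → b m ≡ 0ℚ
  vanishes (suc (suc m)) (s≤s (s≤s le)) = begin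
    a m + a (suc (suc m)) * h²    ≡⟨ cong₂ (λ x y → x + y * h²) (a-vanishes m le) (a-vanishes (suc (suc m)) (ℕP.m≤n⇒m≤1+n (ℕP.m≤n⇒m≤1+n le))) ⟩
    0ℚ + 0ℚ * h²                  ≡⟨ solve 1 (λ x → con 0ℚ :+ con 0ℚ :* x := con 0ℚ) refl h² ⟩
    0ℚ                            ∎
    where h² = half (suc (suc m)) * half (suc (suc m))
  expands : ∀ t → t ^ suc (suc N) ≡ Σ (suc (suc (suc N))) (λ m → b m * cfact m t)
  expands t = begin
    t * (t * t ^ N)
      ≡⟨ solve 2 (λ t p → t :* (t :* p) := t :* t :* p) refl t (t ^ N) ⟩
    t * t * t ^ N
      ≡⟨ cong (t * t *_) (a-expands t) ⟩
    t * t * Σ (suc N) (λ m → a m * cfact m t)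
      ≡⟨ sym (Σ-*ˡ (suc N) (t * t) (λ m → a m * cfact m t)) ⟩
    Σ (suc N) (λ m → t * t * (a m * cfact m t))
      ≡⟨ Σ-cong′ (suc N) (λ m → solve 4 (λ t a x h → t :* t :* (a :* x) := a :* (x :* (t :* t :- h :* h)) :+ a :* (h :* h) :* x) refl t (a m) (cfact m t) (half m)) ⟩
    Σ (suc N) (λ m → a m * cfact (suc (suc m)) t + H m)
      ≡⟨ Σ-+ (suc N) (λ m → a m * cfact (suc (suc m)) t) H ⟩
    Σ (suc N) (λ m → a m * cfact (suc (suc m)) t) + Σ (suc N) H
      ≡⟨ cong₂ _+_ (sym (Σ-shift2 (suc N) a (λ m → cfact m t))) (sym (trans (cong (λ z → Σ z H) (ℕP.+-comm 2 (suc N))) (Σ-pad (suc N) 2 H H-vanishes))) ⟩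
    Σ (suc (suc (suc N))) (λ m → shift2 a m * cfact m t) + Σ (suc (suc (suc N))) H
      ≡⟨ sym (Σ-+ (suc (suc (suc N))) (λ m → shift2 a m * cfact m t) H) ⟩
    Σ (suc (suc (suc N))) (λ m → shift2 a m * cfact m t + H m)
      ≡⟨ Σ-cong′ (suc (suc (suc N))) (λ m → sym (QP.*-distribʳ-+ (cfact m t) (shift2 a m) (a m * (half m * half m)))) ⟩
    Σ (suc (suc (suc N))) (λ m → b m * cfact m t) ∎
    where
    H : ℕ → ℚ
    H m = a m * (half m * half m) * cfact m t
    H-vanishes : ∀ i → i < 2 → H (suc N ℕ.+ i) ≡ 0ℚ
    H-vanishes i _ = trans (cong (λ z → z * (half (suc N ℕ.+ i) * half (suc N ℕ.+ i)) * cfact (suc N ℕ.+ i) t)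
                                 (a-vanishes (suc N ℕ.+ i) (s≤s (ℕP.m≤m+n N i))))
                           (solve 2 (λ x y → con 0ℚ :* x :* y := con 0ℚ) refl (half (suc N ℕ.+ i) * half (suc N ℕ.+ i)) (cfact (suc N ℕ.+ i) t))

Σ-palindrome : ∀ m n g → (∀ i → i < m ℕ.+ n ℕ.+ m → g (m ℕ.+ n ℕ.+ m ℕ.∸ suc i) ≡ g i) →
  Σ (m ℕ.+ n ℕ.+ m) g ≡ Σ n (λ i → g (m ℕ.+ i)) + (1ℚ + 1ℚ) * Σ m (λ j → g (m ℕ.+ (n ℕ.+ j)))
Σ-palindrome m n g pal = begin
  Σ (m ℕ.+ n ℕ.+ m) g                         ≡⟨ Σ-split (m ℕ.+ n) m g ⟩
  Σ (m ℕ.+ n) g + Σ m (λ j → g (m ℕ.+ n ℕ.+ j))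
                                              ≡⟨ cong₂ _+_ (Σ-split m n g) (Σ-cong′ m (λ j → cong g (ℕP.+-assoc m n j))) ⟩
  Σ m g + C + S                               ≡⟨ cong (λ z → z + C + S) (Σ-reverse m g) ⟩
  Σ m (λ j → g (m ℕ.∸ suc j)) + C + S         ≡⟨ cong (λ z → z + C + S) (Σ-cong m mirror) ⟩
  S + C + S                                   ≡⟨ solve 2 (λ s c → s :+ c :+ s := c :+ (con 1ℚ :+ con 1ℚ) :* s) refl S C ⟩
  C + (1ℚ + 1ℚ) * S                           ∎
  where
  C S : ℚ
  C = Σ n (λ i → g (m ℕ.+ i))
  S = Σ m (λ j → g (m ℕ.+ (n ℕ.+ j)))
  mirror : ∀ j → j < m → g (m ℕ.∸ suc j) ≡ g (m ℕ.+ (n ℕ.+ j))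
  mirror j j<m = begin
    g (m ℕ.∸ suc j)                                    ≡⟨ cong g (sym index) ⟩
    g (m ℕ.+ n ℕ.+ m ℕ.∸ suc (m ℕ.+ (n ℕ.+ j)))         ≡⟨ pal (m ℕ.+ (n ℕ.+ j)) bound ⟩
    g (m ℕ.+ (n ℕ.+ j))                                ∎
    where
    index : m ℕ.+ n ℕ.+ m ℕ.∸ suc (m ℕ.+ (n ℕ.+ j)) ≡ m ℕ.∸ suc j
    index = trans (cong (m ℕ.+ n ℕ.+ m ℕ.∸_) (trans (cong suc (sym (ℕP.+-assoc m n j))) (sym (ℕP.+-suc (m ℕ.+ n) j))))
                  (ℕP.[m+n]∸[m+o]≡n∸o (m ℕ.+ n) m (suc j))
    bound : m ℕ.+ (n ℕ.+ j) < m ℕ.+ n ℕ.+ m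
    bound = ℕP.≤-trans (ℕP.≤-reflexive (cong suc (sym (ℕP.+-assoc m n j)))) (ℕP.+-monoʳ-< (m ℕ.+ n) j<m)

δ₀-term : ℕ → (ℚ → ℚ) → ℕ → ℚ
δ₀-term k f i = binom k i * (sgn i * f (half k - ℕ→ℚ i))

δ₀≡Σ-term : ∀ k f → δ₀ k f ≡ Σ (suc k) (δ₀-term k f)
δ₀≡Σ-term k f = trans (δ^-explicit k f 0ℚ) (Σ-cong′ (suc k) (λ i →
  trans (QP.*-assoc (binom k i) (sgn i) _) (cong (λ z → binom k i * (sgn i * f (z - ℕ→ℚ i))) (QP.+-identityˡ (half k)))))

δ₀-term-reflect : ∀ k f c → (∀ t → f (- t) ≡ c * f t) → ∀ i → i ≤ k → δ₀-term k f (k ℕ.∸ i) ≡ sgn k * c * δ₀-term k f i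
δ₀-term-reflect k f c f-sym i i≤k = begin
  binom k (k ℕ.∸ i) * (sgn (k ℕ.∸ i) * f (half k - ℕ→ℚ (k ℕ.∸ i)))
    ≡⟨ cong₂ (λ u v → u * (v * f (half k - ℕ→ℚ (k ℕ.∸ i)))) (binom-sym k i i≤k) (sgn-∸ k i i≤k) ⟩
  binom k i * (sgn k * sgn i * f (half k - ℕ→ℚ (k ℕ.∸ i)))
    ≡⟨ cong (λ z → binom k i * (sgn k * sgn i * f z)) reflected ⟩
  binom k i * (sgn k * sgn i * f (- (half k - ℕ→ℚ i)))
    ≡⟨ cong (λ z → binom k i * (sgn k * sgn i * z)) (f-sym (half k - ℕ→ℚ i)) ⟩
  binom k i * (sgn k * sgn i * (c * f (half k - ℕ→ℚ i)))
    ≡⟨ solve 5 (λ b s c t x → b :* (s :* t :* (c :* x)) := s :* c :* (b :* (t :* x))) refl (binom k i) (sgn k) c (sgn i) (f (half k - ℕ→ℚ i)) ⟩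
  sgn k * c * δ₀-term k f i ∎
  where
  reflected : half k - ℕ→ℚ (k ℕ.∸ i) ≡ - (half k - ℕ→ℚ i)
  reflected = begin
    half k - ℕ→ℚ (k ℕ.∸ i)                ≡⟨ cong (λ z → half k - z) (ℕ→ℚ-∸ k i i≤k) ⟩
    half k - (ℕ→ℚ k - ℕ→ℚ i)              ≡⟨ cong (λ z → half k - (z - ℕ→ℚ i)) (sym (half+half k)) ⟩
    half k - (half k + half k - ℕ→ℚ i)    ≡⟨ solve 2 (λ h n → h :- (h :+ h :- n) := :- (h :- n)) refl (half k) (ℕ→ℚ i) ⟩
    - (half k - ℕ→ℚ i)                    ∎

δ₀-reflect : ∀ k f c → (∀ t → f (- t) ≡ c * f t) → δ₀ k f ≡ sgn k * c * δ₀ k f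
δ₀-reflect k f c f-sym = begin
  δ₀ k f                                       ≡⟨ δ₀≡Σ-term k f ⟩
  Σ (suc k) (δ₀-term k f)                      ≡⟨ Σ-reverse (suc k) (δ₀-term k f) ⟩
  Σ (suc k) (λ i → δ₀-term k f (k ℕ.∸ i))      ≡⟨ Σ-cong (suc k) (λ i i≤k → δ₀-term-reflect k f c f-sym i (ℕP.≤-pred i≤k)) ⟩
  Σ (suc k) (λ i → sgn k * c * δ₀-term k f i)  ≡⟨ Σ-*ˡ (suc k) (sgn k * c) (δ₀-term k f) ⟩
  sgn k * c * Σ (suc k) (δ₀-term k f)          ≡⟨ cong (sgn k * c *_) (sym (δ₀≡Σ-term k f)) ⟩
  sgn k * c * δ₀ k f                           ∎

δ₀-antisymmetric : ∀ k f c → (∀ t → f (- t) ≡ c * f t) → sgn k * c ≡ - 1ℚ → δ₀ k f ≡ 0ℚ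
δ₀-antisymmetric k f c f-sym sgn*c≡-1 = x≡-x⇒x≡0 (δ₀ k f) (begin
  δ₀ k f                ≡⟨ δ₀-reflect k f c f-sym ⟩
  sgn k * c * δ₀ k f    ≡⟨ cong (_* δ₀ k f) sgn*c≡-1 ⟩
  - 1ℚ * δ₀ k f         ≡⟨ solve 1 (λ x → :- con 1ℚ :* x := :- x) refl (δ₀ k f) ⟩
  - δ₀ k f              ∎)

δ₀-palindrome : ∀ k f c → (∀ t → f (- t) ≡ c * f t) → sgn k * c ≡ 1ℚ →
  ∀ i → i < suc k → δ₀-term k f (suc k ℕ.∸ suc i) ≡ δ₀-term k f i
δ₀-palindrome k f c f-sym sgn*c≡1 i (s≤s i≤k) =
  trans (δ₀-term-reflect k f c f-sym i i≤k) (trans (cong (_* δ₀-term k f i) sgn*c≡1) (QP.*-identityˡ _))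

δ₀-term-2·-centre : ∀ k f → f 0ℚ ≡ 0ℚ → δ₀-term (2· k) f (k ℕ.+ 0) ≡ 0ℚ
δ₀-term-2·-centre k f f0≡0 = begin
  binom (2· k) (k ℕ.+ 0) * (sgn (k ℕ.+ 0) * f (half (2· k) - ℕ→ℚ (k ℕ.+ 0)))
    ≡⟨ cong (λ z → binom (2· k) (k ℕ.+ 0) * (sgn (k ℕ.+ 0) * f z)) at-centre ⟩
  binom (2· k) (k ℕ.+ 0) * (sgn (k ℕ.+ 0) * f 0ℚ)
    ≡⟨ cong (λ z → binom (2· k) (k ℕ.+ 0) * (sgn (k ℕ.+ 0) * z)) f0≡0 ⟩
  binom (2· k) (k ℕ.+ 0) * (sgn (k ℕ.+ 0) * 0ℚ)
    ≡⟨ solve 2 (λ a b → a :* (b :* con 0ℚ) := con 0ℚ) refl (binom (2· k) (k ℕ.+ 0)) (sgn (k ℕ.+ 0)) ⟩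
  0ℚ ∎
  where
  at-centre : half (2· k) - ℕ→ℚ (k ℕ.+ 0) ≡ 0ℚ
  at-centre = trans (cong₂ _-_ (half-2· k) (cong ℕ→ℚ (ℕP.+-identityʳ k))) (QP.+-inverseʳ (ℕ→ℚ k))

δ₀-term-2·-upper : ∀ k f → (∀ t → f (- t) ≡ f t) → ∀ j →
  δ₀-term (2· k) f (k ℕ.+ suc j) ≡ sgn k * (sgn (suc j) * binom (2· k) (k ℕ.+ suc j) * f (ℕ→ℚ (suc j)))
δ₀-term-2·-upper k f f-even j = begin
  B * (sgn (k ℕ.+ suc j) * f (half (2· k) - ℕ→ℚ (k ℕ.+ suc j)))
    ≡⟨ cong₂ (λ u v → B * (u * f v)) (sgn-+ k (suc j)) position ⟩
  B * (sgn k * sgn (suc j) * f (- ℕ→ℚ (suc j)))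
    ≡⟨ cong (λ z → B * (sgn k * sgn (suc j) * z)) (f-even (ℕ→ℚ (suc j))) ⟩
  B * (sgn k * sgn (suc j) * f (ℕ→ℚ (suc j)))
    ≡⟨ solve 4 (λ c s t x → c :* (s :* t :* x) := s :* (t :* c :* x)) refl B (sgn k) (sgn (suc j)) (f (ℕ→ℚ (suc j))) ⟩
  sgn k * (sgn (suc j) * B * f (ℕ→ℚ (suc j))) ∎
  where
  B = binom (2· k) (k ℕ.+ suc j)
  position : half (2· k) - ℕ→ℚ (k ℕ.+ suc j) ≡ - ℕ→ℚ (suc j)
  position = trans (cong₂ _-_ (half-2· k) (ℕ→ℚ-+ k (suc j)))
                   (solve 2 (λ a b → a :- (a :+ b) := :- b) refl (ℕ→ℚ k) (ℕ→ℚ (suc j)))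

δ₀-2·-even : ∀ k f → (∀ t → f (- t) ≡ f t) → f 0ℚ ≡ 0ℚ →
  δ₀ (2· k) f ≡ (1ℚ + 1ℚ) * sgn k * Σ k (λ j → sgn (suc j) * binom (2· k) (k ℕ.+ suc j) * f (ℕ→ℚ (suc j)))
δ₀-2·-even k f f-even f0≡0 = begin
  δ₀ (2· k) f
    ≡⟨ δ₀≡Σ-term (2· k) f ⟩
  Σ (suc (2· k)) τ
    ≡⟨ cong (λ z → Σ z τ) length ⟩
  Σ (k ℕ.+ 1 ℕ.+ k) τ
    ≡⟨ Σ-palindrome k 1 τ (λ i i<L → trans (cong (λ z → τ (z ℕ.∸ suc i)) (sym length)) (δ₀-palindrome (2· k) f 1ℚ f-sym (trans (QP.*-identityʳ (sgn (2· k))) (sgn-2· k)) i (subst (i <_) (sym length) i<L))) ⟩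
  (τ (k ℕ.+ 0) + 0ℚ) + (1ℚ + 1ℚ) * Σ k (λ j → τ (k ℕ.+ suc j))
    ≡⟨ cong₂ (λ u v → (u + 0ℚ) + (1ℚ + 1ℚ) * v) (δ₀-term-2·-centre k f f0≡0) (trans (Σ-cong′ k (δ₀-term-2·-upper k f f-even)) (Σ-*ˡ k (sgn k) T)) ⟩
  (0ℚ + 0ℚ) + (1ℚ + 1ℚ) * (sgn k * Σ k T)
    ≡⟨ solve 2 (λ s x → (con 0ℚ :+ con 0ℚ) :+ (con 1ℚ :+ con 1ℚ) :* (s :* x) := (con 1ℚ :+ con 1ℚ) :* s :* x) refl (sgn k) (Σ k T) ⟩
  (1ℚ + 1ℚ) * sgn k * Σ k T ∎
  where
  τ T : ℕ → ℚ
  τ = δ₀-term (2· k) f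
  T j = sgn (suc j) * binom (2· k) (k ℕ.+ suc j) * f (ℕ→ℚ (suc j))
  f-sym : ∀ t → f (- t) ≡ 1ℚ * f t
  f-sym t = trans (f-even t) (sym (QP.*-identityˡ (f t)))
  length : suc (2· k) ≡ k ℕ.+ 1 ℕ.+ k
  length = trans (cong suc (2·≡+ k)) (cong (ℕ._+ k) (ℕP.+-comm 1 k))

δ₀-term-1+2·-upper : ∀ k f → (∀ t → f (- t) ≡ - f t) → ∀ j →
  δ₀-term (1+2· k) f (suc k ℕ.+ j) ≡ sgn k * (sgn j * binom (1+2· k) (suc k ℕ.+ j) * f (ℕ→ℚ j + ½))
δ₀-term-1+2·-upper k f f-odd j = begin
  B * (sgn (suc k ℕ.+ j) * f (half (1+2· k) - ℕ→ℚ (suc k ℕ.+ j)))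
    ≡⟨ cong₂ (λ u v → B * (u * f v)) (trans (sgn-+ (suc k) j) (cong (_* sgn j) (sgn-suc k))) position ⟩
  B * (- sgn k * sgn j * f (- (ℕ→ℚ j + ½)))
    ≡⟨ cong (λ z → B * (- sgn k * sgn j * z)) (f-odd (ℕ→ℚ j + ½)) ⟩
  B * (- sgn k * sgn j * - f (ℕ→ℚ j + ½))
    ≡⟨ solve 4 (λ c s t x → c :* (:- s :* t :* :- x) := s :* (t :* c :* x)) refl B (sgn k) (sgn j) (f (ℕ→ℚ j + ½)) ⟩
  sgn k * (sgn j * B * f (ℕ→ℚ j + ½)) ∎
  where
  B = binom (1+2· k) (suc k ℕ.+ j)
  position : half (1+2· k) - ℕ→ℚ (suc k ℕ.+ j) ≡ - (ℕ→ℚ j + ½)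
  position = trans (cong₂ _-_ (half-1+2· k) (trans (ℕ→ℚ-+ (suc k) j) (cong (_+ ℕ→ℚ j) (ℕ→ℚ-suc k))))
                   (solve 2 (λ a b → a :+ con ½ :- (con 1ℚ :+ a :+ b) := :- (b :+ con ½)) refl (ℕ→ℚ k) (ℕ→ℚ j))

δ₀-1+2·-odd : ∀ k f → (∀ t → f (- t) ≡ - f t) →
  δ₀ (1+2· k) f ≡ (1ℚ + 1ℚ) * sgn k * Σ (suc k) (λ j → sgn j * binom (1+2· k) (suc k ℕ.+ j) * f (ℕ→ℚ j + ½))
δ₀-1+2·-odd k f f-odd = begin
  δ₀ (1+2· k) f
    ≡⟨ δ₀≡Σ-term (1+2· k) f ⟩
  Σ (2· suc k) τ
    ≡⟨ cong (λ z → Σ z τ) length ⟩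
  Σ (suc k ℕ.+ 0 ℕ.+ suc k) τ
    ≡⟨ Σ-palindrome (suc k) 0 τ (λ i i<L → trans (cong (λ z → τ (z ℕ.∸ suc i)) (sym length)) (δ₀-palindrome (1+2· k) f (- 1ℚ) f-sym sgn*-1 i (subst (i <_) (sym length) i<L))) ⟩
  0ℚ + (1ℚ + 1ℚ) * Σ (suc k) (λ j → τ (suc k ℕ.+ j))
    ≡⟨ cong (λ z → 0ℚ + (1ℚ + 1ℚ) * z) (trans (Σ-cong′ (suc k) (δ₀-term-1+2·-upper k f f-odd)) (Σ-*ˡ (suc k) (sgn k) T)) ⟩
  0ℚ + (1ℚ + 1ℚ) * (sgn k * Σ (suc k) T)
    ≡⟨ solve 2 (λ s x → con 0ℚ :+ (con 1ℚ :+ con 1ℚ) :* (s :* x) := (con 1ℚ :+ con 1ℚ) :* s :* x) refl (sgn k) (Σ (suc k) T) ⟩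
  (1ℚ + 1ℚ) * sgn k * Σ (suc k) T ∎
  where
  τ T : ℕ → ℚ
  τ = δ₀-term (1+2· k) f
  T j = sgn j * binom (1+2· k) (suc k ℕ.+ j) * f (ℕ→ℚ j + ½)
  f-sym : ∀ t → f (- t) ≡ - 1ℚ * f t
  f-sym t = trans (f-odd t) (solve 1 (λ x → :- x := :- con 1ℚ :* x) refl (f t))
  sgn*-1 : sgn (1+2· k) * - 1ℚ ≡ 1ℚ
  sgn*-1 = cong (_* - 1ℚ) (sgn-1+2· k)
  length : 2· suc k ≡ suc k ℕ.+ 0 ℕ.+ suc k
  length = trans (2·≡+ (suc k)) (cong (ℕ._+ suc k) (sym (ℕP.+-identityʳ (suc k))))

poch-shift : ∀ a k → poch (a - 1ℚ) (suc k) ≡ poch a (suc k) - ℕ→ℚ (suc k) * poch a k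
poch-shift a zero    = solve 1 (λ a → con 1ℚ :* (a :- con 1ℚ :+ con 0ℚ) := con 1ℚ :* (a :+ con 0ℚ) :- con 1ℚ :* con 1ℚ) refl a
poch-shift a (suc k) = begin
  poch (a - 1ℚ) (suc k) * (a - 1ℚ + ℕ→ℚ (suc k))
    ≡⟨ cong₂ (λ u v → u * (a - 1ℚ + v)) (trans (poch-shift a k) (cong (λ w → poch a (suc k) - w * poch a k) (ℕ→ℚ-suc k))) (ℕ→ℚ-suc k) ⟩
  (P * (a + K) - (1ℚ + K) * P) * (a - 1ℚ + (1ℚ + K))
    ≡⟨ solve 3 (λ p a k → (p :* (a :+ k) :- (con 1ℚ :+ k) :* p) :* (a :- con 1ℚ :+ (con 1ℚ :+ k)) := p :* (a :+ k) :* (a :+ (con 1ℚ :+ k)) :- (con 1ℚ :+ (con 1ℚ :+ k)) :* (p :* (a :+ k))) refl P a K ⟩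
  P * (a + K) * (a + (1ℚ + K)) - (1ℚ + (1ℚ + K)) * (P * (a + K))
    ≡⟨ cong₂ (λ u v → P * (a + K) * (a + u) - v * (P * (a + K))) (sym (ℕ→ℚ-suc k)) (sym (trans (ℕ→ℚ-suc (suc k)) (cong (1ℚ +_) (ℕ→ℚ-suc k)))) ⟩
  poch a (suc (suc k)) - ℕ→ℚ (suc (suc k)) * poch a (suc k) ∎
  where
  P K : ℚ
  P = poch a k
  K = ℕ→ℚ k

poch-head : ∀ x k → poch x (suc k) ≡ x * poch (x + 1ℚ) k
poch-head x zero    = solve 1 (λ x → con 1ℚ :* (x :+ con 0ℚ) := x :* con 1ℚ) refl x
poch-head x (suc k) = begin
  poch x (suc k) * (x + ℕ→ℚ (suc k))           ≡⟨ cong₂ (λ a b → a * (x + b)) (poch-head x k) (ℕ→ℚ-suc k) ⟩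
  x * poch (x + 1ℚ) k * (x + (1ℚ + ℕ→ℚ k))     ≡⟨ solve 3 (λ x p k → x :* p :* (x :+ (con 1ℚ :+ k)) := x :* (p :* (x :+ con 1ℚ :+ k))) refl x (poch (x + 1ℚ) k) (ℕ→ℚ k) ⟩
  x * (poch (x + 1ℚ) k * (x + 1ℚ + ℕ→ℚ k))     ∎

poch-vanishes : ∀ x j k → j < k → x + ℕ→ℚ j ≡ 0ℚ → poch x k ≡ 0ℚ
poch-vanishes x j (suc k) (s≤s j≤k) x+j≡0 with ℕP.m≤n⇒m<n∨m≡n j≤k
... | inj₁ j<k  = trans (cong (_* (x + ℕ→ℚ k)) (poch-vanishes x j k j<k x+j≡0)) (QP.*-zeroˡ (x + ℕ→ℚ k))
... | inj₂ refl = trans (cong (poch x j *_) x+j≡0) (QP.*-zeroʳ (poch x j))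

poch-ℕ-suc : ∀ k j → poch (ℕ→ℚ (suc k)) j * ℕ→ℚ (k !) ≡ ℕ→ℚ ((k ℕ.+ j) !)
poch-ℕ-suc k zero    = trans (QP.*-identityˡ (ℕ→ℚ (k !))) (cong (λ z → ℕ→ℚ (z !)) (sym (ℕP.+-identityʳ k)))
poch-ℕ-suc k (suc j) = begin
  poch (ℕ→ℚ (suc k)) j * (ℕ→ℚ (suc k) + ℕ→ℚ j) * ℕ→ℚ (k !)
    ≡⟨ solve 3 (λ p a b → p :* a :* b := a :* (p :* b)) refl (poch (ℕ→ℚ (suc k)) j) (ℕ→ℚ (suc k) + ℕ→ℚ j) (ℕ→ℚ (k !)) ⟩
  (ℕ→ℚ (suc k) + ℕ→ℚ j) * (poch (ℕ→ℚ (suc k)) j * ℕ→ℚ (k !))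
    ≡⟨ cong₂ _*_ (sym (ℕ→ℚ-+ (suc k) j)) (poch-ℕ-suc k j) ⟩
  ℕ→ℚ (suc k ℕ.+ j) * ℕ→ℚ ((k ℕ.+ j) !)
    ≡⟨ sym (ℕ→ℚ-* (suc (k ℕ.+ j)) ((k ℕ.+ j) !)) ⟩
  ℕ→ℚ (suc (k ℕ.+ j) !)
    ≡⟨ cong (λ z → ℕ→ℚ (z !)) (sym (ℕP.+-suc k j)) ⟩
  ℕ→ℚ ((k ℕ.+ suc j) !) ∎

cfact-2·-½ : ∀ k → cfact (2· k) ½ ≡ sgn k * (poch (- ½) k * poch ½ k)
cfact-2·-½ zero    = refl
cfact-2·-½ (suc k) = begin
  cfact (2· k) ½ * (½ * ½ - half (2· k) * half (2· k))
    ≡⟨ cong₂ (λ u v → u * (½ * ½ - v * v)) (cfact-2·-½ k) (half-2· k) ⟩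
  sgn k * (poch (- ½) k * poch ½ k) * (½ * ½ - ℕ→ℚ k * ℕ→ℚ k)
    ≡⟨ solve 4 (λ s a b k → s :* (a :* b) :* (con ½ :* con ½ :- k :* k) := con (- 1ℚ) :* s :* (a :* (:- con ½ :+ k) :* (b :* (con ½ :+ k)))) refl (sgn k) (poch (- ½) k) (poch ½ k) (ℕ→ℚ k) ⟩
  sgn (suc k) * (poch (- ½) (suc k) * poch ½ (suc k)) ∎

-- The binomial functional Σ_i C(n,i) g(n/2 - i)

-- By definition U r n = binomialSum n (λ t → ∣ t ∣ ^ r).
binomialSum : ℕ → (ℚ → ℚ) → ℚ
binomialSum n = wsum (suc n) (binom n) (λ i → half n - ℕ→ℚ i)

binomialSum-cong : ∀ n {f g : ℚ → ℚ} → (∀ t → f t ≡ g t) → binomialSum n f ≡ binomialSum n g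
binomialSum-cong n = wsum-cong (suc n) (binom n) (λ i → half n - ℕ→ℚ i)

binomialSum-suc : ∀ n g → binomialSum (suc n) g ≡ binomialSum n (λ t → g (t + ½) + g (t - ½))
binomialSum-suc n g = begin
  Σ (suc (suc n)) (λ i → binom (suc n) i * F i)
    ≡⟨ Σ-binom-suc n F ⟩
  Σ (suc n) (λ i → binom n i * (F i + F (suc i)))
    ≡⟨ Σ-cong′ (suc n) (λ i → cong (binom n i *_) (cong₂ _+_ (cong g (up i)) (cong g (down i)))) ⟩
  binomialSum n (λ t → g (t + ½) + g (t - ½)) ∎
  where
  F : ℕ → ℚ
  F i = g (half (suc n) - ℕ→ℚ i)
  up : ∀ i → half (suc n) - ℕ→ℚ i ≡ half n - ℕ→ℚ i + ½
  up i = trans (cong (_- ℕ→ℚ i) (half-suc n)) (solve 2 (λ h x → h :+ con ½ :- x := h :- x :+ con ½) refl (half n) (ℕ→ℚ i))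
  down : ∀ i → half (suc n) - ℕ→ℚ (suc i) ≡ half n - ℕ→ℚ i - ½
  down i = trans (cong₂ _-_ (half-suc n) (ℕ→ℚ-suc i)) (solve 2 (λ h x → h :+ con ½ :- (con 1ℚ :+ x) := h :- x :- con ½) refl (half n) (ℕ→ℚ i))

secondSum : (ℚ → ℚ) → ℚ → ℚ
secondSum g t = g (t + 1ℚ) + (1ℚ + 1ℚ) * g t + g (t - 1ℚ)

secondSum-δδ : ∀ (g : ℚ → ℚ) t → secondSum g t ≡ ℕ→ℚ 4 * g t + 1ℚ * δ (δ g) t
secondSum-δδ g t = begin
  g (t + 1ℚ) + (1ℚ + 1ℚ) * g t + g (t - 1ℚ)
    ≡⟨ cong₂ (λ a b → g a + (1ℚ + 1ℚ) * g t + g b) (solve 1 (λ t → t :+ con 1ℚ := t :+ con ½ :+ con ½) refl t) (solve 1 (λ t → t :- con 1ℚ := t :- con ½ :- con ½) refl t) ⟩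
  g (t + ½ + ½) + (1ℚ + 1ℚ) * g t + g (t - ½ - ½)
    ≡⟨ solve 3 (λ a b c → a :+ (con 1ℚ :+ con 1ℚ) :* b :+ c := con (ℕ→ℚ 4) :* b :+ con 1ℚ :* ((a :- b) :- (b :- c))) refl (g (t + ½ + ½)) (g t) (g (t - ½ - ½)) ⟩
  ℕ→ℚ 4 * g t + 1ℚ * ((g (t + ½ + ½) - g t) - (g t - g (t - ½ - ½)))
    ≡⟨ cong₂ (λ u v → ℕ→ℚ 4 * g t + 1ℚ * ((g (t + ½ + ½) - g u) - (g v - g (t - ½ - ½)))) (solve 1 (λ t → t := t :+ con ½ :- con ½) refl t) (solve 1 (λ t → t := t :- con ½ :+ con ½) refl t) ⟩
  ℕ→ℚ 4 * g t + 1ℚ * δ (δ g) t ∎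

binomialSum-suc-suc : ∀ n g → binomialSum (suc (suc n)) g ≡ binomialSum n (secondSum g)
binomialSum-suc-suc n g = begin
  binomialSum (suc (suc n)) g
    ≡⟨ binomialSum-suc (suc n) g ⟩
  binomialSum (suc n) (λ t → g (t + ½) + g (t - ½))
    ≡⟨ binomialSum-suc n (λ t → g (t + ½) + g (t - ½)) ⟩
  binomialSum n (λ t → (g (t + ½ + ½) + g (t + ½ - ½)) + (g (t - ½ + ½) + g (t - ½ - ½)))
    ≡⟨ binomialSum-cong n regroup ⟩
  binomialSum n (secondSum g) ∎
  where
  regroup : ∀ t → (g (t + ½ + ½) + g (t + ½ - ½)) + (g (t - ½ + ½) + g (t - ½ - ½)) ≡ secondSum g t
  regroup t = begin
    (g (t + ½ + ½) + g (t + ½ - ½)) + (g (t - ½ + ½) + g (t - ½ - ½))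
      ≡⟨ cong₂ (λ a b → (g (t + ½ + ½) + g a) + (g b + g (t - ½ - ½))) (solve 1 (λ t → t :+ con ½ :- con ½ := t) refl t) (solve 1 (λ t → t :- con ½ :+ con ½ := t) refl t) ⟩
    (g (t + ½ + ½) + g t) + (g t + g (t - ½ - ½))
      ≡⟨ solve 3 (λ a b c → (a :+ b) :+ (b :+ c) := a :+ (con 1ℚ :+ con 1ℚ) :* b :+ c) refl (g (t + ½ + ½)) (g t) (g (t - ½ - ½)) ⟩
    g (t + ½ + ½) + (1ℚ + 1ℚ) * g t + g (t - ½ - ½)
      ≡⟨ cong₂ (λ a b → g a + (1ℚ + 1ℚ) * g t + g b) (solve 1 (λ t → t :+ con ½ :+ con ½ := t :+ con 1ℚ) refl t) (solve 1 (λ t → t :- con ½ :- con ½ := t :- con 1ℚ) refl t) ⟩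
    secondSum g t ∎

binomialSum-recurrence : ∀ n g → binomialSum (suc (suc n)) g ≡ ℕ→ℚ 4 * binomialSum n g + 1ℚ * binomialSum n (δ (δ g))
binomialSum-recurrence n g = begin
  binomialSum (suc (suc n)) g                               ≡⟨ binomialSum-suc-suc n g ⟩
  binomialSum n (secondSum g)                               ≡⟨ binomialSum-cong n (secondSum-δδ g) ⟩
  binomialSum n (λ t → ℕ→ℚ 4 * g t + 1ℚ * δ (δ g) t)        ≡⟨ wsum-linear (suc n) (binom n) (λ i → half n - ℕ→ℚ i) (ℕ→ℚ 4) 1ℚ g (δ (δ g)) ⟩
  ℕ→ℚ 4 * binomialSum n g + 1ℚ * binomialSum n (δ (δ g))    ∎

binomialSum-scale : ∀ n c (f : ℚ → ℚ) → binomialSum n (λ t → c * f t) ≡ c * binomialSum n f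
binomialSum-scale n = wsum-scale (suc n) (binom n) (λ i → half n - ℕ→ℚ i)

binomialValue : ℕ → ℕ → ℚ
binomialValue n k = ℕ→ℚ 2 ^ n * sgn k * (poch (- half n) k * poch ½ k)

binomialValue-recurrence : ∀ n k →
  ℕ→ℚ 4 * binomialValue n (suc k) + 1ℚ * (ℕ→ℚ (2· suc k) * ℕ→ℚ (1+2· k) * binomialValue n k) ≡ binomialValue (suc (suc n)) (suc k)
binomialValue-recurrence n k = begin
  ℕ→ℚ 4 * (T * sgn (suc k) * (poch a (suc k) * poch ½ (suc k))) + 1ℚ * (c * (T * S * (Pa * Ph)))
    ≡⟨ cong (λ z → ℕ→ℚ 4 * (T * sgn (suc k) * (poch a (suc k) * poch ½ (suc k))) + 1ℚ * (z * (T * S * (Pa * Ph)))) c≡ ⟩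
  ℕ→ℚ 4 * (T * (- 1ℚ * S) * (Pa * (a + K) * (Ph * (½ + K)))) + 1ℚ * ((1ℚ + 1ℚ + (K + K)) * (1ℚ + (K + K)) * (T * S * (Pa * Ph)))
    ≡⟨ solve 6 (λ t s pa ph a k → con (ℕ→ℚ 4) :* (t :* (con (- 1ℚ) :* s) :* (pa :* (a :+ k) :* (ph :* (con ½ :+ k)))) :+ con 1ℚ :* ((con 1ℚ :+ con 1ℚ :+ (k :+ k)) :* (con 1ℚ :+ (k :+ k)) :* (t :* s :* (pa :* ph)))
              := con (ℕ→ℚ 2) :* (con (ℕ→ℚ 2) :* t) :* (con (- 1ℚ) :* s) :* ((pa :* (a :+ k) :- (con 1ℚ :+ k) :* pa) :* (ph :* (con ½ :+ k)))) refl T S Pa Ph a K ⟩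
  ℕ→ℚ 2 ^ suc (suc n) * sgn (suc k) * ((Pa * (a + K) - (1ℚ + K) * Pa) * (Ph * (½ + K)))
    ≡⟨ cong (λ z → ℕ→ℚ 2 ^ suc (suc n) * sgn (suc k) * ((Pa * (a + K) - z * Pa) * (Ph * (½ + K)))) (sym (ℕ→ℚ-suc k)) ⟩
  ℕ→ℚ 2 ^ suc (suc n) * sgn (suc k) * ((poch a (suc k) - ℕ→ℚ (suc k) * Pa) * poch ½ (suc k))
    ≡⟨ cong (λ z → ℕ→ℚ 2 ^ suc (suc n) * sgn (suc k) * (z * poch ½ (suc k))) (sym (poch-shift a k)) ⟩
  ℕ→ℚ 2 ^ suc (suc n) * sgn (suc k) * (poch (a - 1ℚ) (suc k) * poch ½ (suc k))
    ≡⟨ cong (λ z → ℕ→ℚ 2 ^ suc (suc n) * sgn (suc k) * (poch z (suc k) * poch ½ (suc k))) a-1≡ ⟩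
  binomialValue (suc (suc n)) (suc k) ∎
  where
  a T S Pa Ph K c : ℚ
  a  = - half n
  T  = ℕ→ℚ 2 ^ n
  S  = sgn k
  Pa = poch a k
  Ph = poch ½ k
  K  = ℕ→ℚ k
  c  = ℕ→ℚ (2· suc k) * ℕ→ℚ (1+2· k)
  c≡ : c ≡ (1ℚ + 1ℚ + (K + K)) * (1ℚ + (K + K))
  c≡ = begin
    ℕ→ℚ (suc (suc (2· k))) * ℕ→ℚ (suc (2· k))        ≡⟨ cong₂ _*_ (trans (ℕ→ℚ-suc (suc (2· k))) (cong (1ℚ +_) (ℕ→ℚ-suc (2· k)))) (ℕ→ℚ-suc (2· k)) ⟩
    (1ℚ + (1ℚ + ℕ→ℚ (2· k))) * (1ℚ + ℕ→ℚ (2· k))    ≡⟨ cong (λ z → (1ℚ + (1ℚ + z)) * (1ℚ + z)) (ℕ→ℚ-2· k) ⟩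
    (1ℚ + (1ℚ + (K + K))) * (1ℚ + (K + K))          ≡⟨ cong (_* (1ℚ + (K + K))) (sym (QP.+-assoc 1ℚ 1ℚ (K + K))) ⟩
    (1ℚ + 1ℚ + (K + K)) * (1ℚ + (K + K))            ∎
  a-1≡ : a - 1ℚ ≡ - half (suc (suc n))
  a-1≡ = trans (solve 1 (λ h → :- h :- con 1ℚ := :- (h :+ con 1ℚ)) refl (half n)) (cong -_ (sym (half-suc-suc n)))

-- δδ t^[2k+2] = (2k+2)(2k+1) t^[2k] turns binomialSum-recurrence into binomialValue-recurrence.
binomialSum-cfact-2· : ∀ n k → binomialSum n (cfact (2· k)) ≡ binomialValue n k
binomialSum-cfact-2· zero zero    = refl
binomialSum-cfact-2· zero (suc k) = begin
  binomialSum 0 (cfact (2· suc k))          ≡⟨ solve 1 (λ x → con 1ℚ :* x :+ con 0ℚ := x) refl (cfact (2· suc k) 0ℚ) ⟩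
  cfact (suc (suc (2· k))) 0ℚ               ≡⟨ cfact-0 (suc (2· k)) ⟩
  0ℚ                                        ≡⟨ solve 2 (λ s b → con 0ℚ := con 1ℚ :* s :* (con 0ℚ :* b)) refl (sgn (suc k)) (poch ½ (suc k)) ⟩
  1ℚ * sgn (suc k) * (0ℚ * poch ½ (suc k))  ≡⟨ cong (λ z → 1ℚ * sgn (suc k) * (z * poch ½ (suc k))) (sym (poch-vanishes 0ℚ 0 (suc k) (s≤s z≤n) refl)) ⟩
  binomialValue 0 (suc k)                   ∎
binomialSum-cfact-2· (suc zero) k = begin
  binomialSum 1 (cfact (2· k))
    ≡⟨ solve 2 (λ x y → con 1ℚ :* x :+ (con 1ℚ :* y :+ con 0ℚ) := x :+ y) refl (cfact (2· k) ½) (cfact (2· k) (- ½)) ⟩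
  cfact (2· k) ½ + cfact (2· k) (- ½)
    ≡⟨ cong (cfact (2· k) ½ +_) (trans (cfact-neg (2· k) ½) (trans (cong (_* cfact (2· k) ½) (sgn-2· k)) (QP.*-identityˡ (cfact (2· k) ½)))) ⟩
  cfact (2· k) ½ + cfact (2· k) ½
    ≡⟨ cong (λ z → z + z) (cfact-2·-½ k) ⟩
  X + X
    ≡⟨ solve 1 (λ x → x :+ x := con (ℕ→ℚ 2) :* con 1ℚ :* x) refl X ⟩
  ℕ→ℚ 2 * 1ℚ * X
    ≡⟨ sym (QP.*-assoc (ℕ→ℚ 2 * 1ℚ) (sgn k) (poch (- ½) k * poch ½ k)) ⟩
  binomialValue 1 k ∎
  where
  X : ℚ
  X = sgn k * (poch (- ½) k * poch ½ k)
binomialSum-cfact-2· (suc (suc n)) zero = begin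
  binomialSum (suc (suc n)) (cfact 0)
    ≡⟨ binomialSum-recurrence n (cfact 0) ⟩
  ℕ→ℚ 4 * binomialSum n (cfact 0) + 1ℚ * binomialSum n (δ (δ (cfact 0)))
    ≡⟨ cong₂ (λ u v → ℕ→ℚ 4 * u + 1ℚ * v) (binomialSum-cfact-2· n zero) (trans (binomialSum-cong n {g = λ t → 0ℚ * cfact 0 t} (λ t → refl)) (binomialSum-scale n 0ℚ (cfact 0))) ⟩
  ℕ→ℚ 4 * (ℕ→ℚ 2 ^ n * 1ℚ * (1ℚ * 1ℚ)) + 1ℚ * (0ℚ * binomialSum n (cfact 0))
    ≡⟨ solve 2 (λ p l → con (ℕ→ℚ 4) :* (p :* con 1ℚ :* (con 1ℚ :* con 1ℚ)) :+ con 1ℚ :* (con 0ℚ :* l) := con (ℕ→ℚ 2) :* (con (ℕ→ℚ 2) :* p) :* con 1ℚ :* (con 1ℚ :* con 1ℚ)) refl (ℕ→ℚ 2 ^ n) (binomialSum n (cfact 0)) ⟩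
  binomialValue (suc (suc n)) zero ∎
binomialSum-cfact-2· (suc (suc n)) (suc k) = begin
  binomialSum (suc (suc n)) (cfact (2· suc k))
    ≡⟨ binomialSum-recurrence n (cfact (2· suc k)) ⟩
  ℕ→ℚ 4 * binomialSum n (cfact (2· suc k)) + 1ℚ * binomialSum n (δ (δ (cfact (2· suc k))))
    ≡⟨ cong (λ z → ℕ→ℚ 4 * binomialSum n (cfact (2· suc k)) + 1ℚ * z) (trans (binomialSum-cong n (δδ-cfact (2· k))) (binomialSum-scale n (ℕ→ℚ (2· suc k) * ℕ→ℚ (1+2· k)) (cfact (2· k)))) ⟩
  ℕ→ℚ 4 * binomialSum n (cfact (2· suc k)) + 1ℚ * (ℕ→ℚ (2· suc k) * ℕ→ℚ (1+2· k) * binomialSum n (cfact (2· k)))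
    ≡⟨ cong₂ (λ u v → ℕ→ℚ 4 * u + 1ℚ * (ℕ→ℚ (2· suc k) * ℕ→ℚ (1+2· k) * v)) (binomialSum-cfact-2· n (suc k)) (binomialSum-cfact-2· n k) ⟩
  ℕ→ℚ 4 * binomialValue n (suc k) + 1ℚ * (ℕ→ℚ (2· suc k) * ℕ→ℚ (1+2· k) * binomialValue n k)
    ≡⟨ binomialValue-recurrence n k ⟩
  binomialValue (suc (suc n)) (suc k) ∎

-- The folded binomial functional Σ_i C(2n+1,i) g(|n + 1/2 - i|)

fold : (ℚ → ℚ) → ℚ → ℚ
fold g t = g ∣ t ∣

-- By definition U r (2n+1) = foldedBinomialSum n (_^ r).
foldedBinomialSum : ℕ → (ℚ → ℚ) → ℚ
foldedBinomialSum n g = binomialSum (1+2· n) (fold g)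

foldedBinomialSum-cong : ∀ n {f g : ℚ → ℚ} → (∀ t → f t ≡ g t) → foldedBinomialSum n f ≡ foldedBinomialSum n g
foldedBinomialSum-cong n e = binomialSum-cong (1+2· n) (λ t → e ∣ t ∣)

foldedBinomialSum-linear : ∀ n a b (f g : ℚ → ℚ) →
  foldedBinomialSum n (λ t → a * f t + b * g t) ≡ a * foldedBinomialSum n f + b * foldedBinomialSum n g
foldedBinomialSum-linear n a b f g = wsum-linear (suc (1+2· n)) (binom (1+2· n)) (λ i → half (1+2· n) - ℕ→ℚ i) a b (fold f) (fold g)

foldedBinomialSum-scale : ∀ n c (f : ℚ → ℚ) → foldedBinomialSum n (λ t → c * f t) ≡ c * foldedBinomialSum n f
foldedBinomialSum-scale n c f = binomialSum-scale (1+2· n) c (fold f)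

secondSum-fold-regular : ∀ g a → secondSum (fold g) (ℕ→ℚ (suc a) + ½) ≡ secondSum g (ℕ→ℚ (suc a) + ½)
secondSum-fold-regular g a = cong₃ (λ x y z → g x + (1ℚ + 1ℚ) * g y + g z)
  (unfold (suc (suc a)) t+1≡) (unfold (suc a) refl) (unfold a t-1≡)
  where
  t : ℚ
  t = ℕ→ℚ (suc a) + ½
  unfold : ∀ b {y} → y ≡ ℕ→ℚ b + ½ → ∣ y ∣ ≡ y
  unfold b refl = ∣ℕ→ℚ+½∣ b
  t+1≡ : t + 1ℚ ≡ ℕ→ℚ (suc (suc a)) + ½
  t+1≡ = begin
    ℕ→ℚ (suc a) + ½ + 1ℚ         ≡⟨ cong (λ z → z + ½ + 1ℚ) (ℕ→ℚ-suc a) ⟩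
    1ℚ + ℕ→ℚ a + ½ + 1ℚ          ≡⟨ solve 1 (λ x → con 1ℚ :+ x :+ con ½ :+ con 1ℚ := con 1ℚ :+ (con 1ℚ :+ x) :+ con ½) refl (ℕ→ℚ a) ⟩
    1ℚ + (1ℚ + ℕ→ℚ a) + ½        ≡⟨ cong (_+ ½) (sym (trans (ℕ→ℚ-suc (suc a)) (cong (1ℚ +_) (ℕ→ℚ-suc a)))) ⟩
    ℕ→ℚ (suc (suc a)) + ½        ∎
  t-1≡ : t - 1ℚ ≡ ℕ→ℚ a + ½
  t-1≡ = trans (cong (λ z → z + ½ - 1ℚ) (ℕ→ℚ-suc a)) (solve 1 (λ x → con 1ℚ :+ x :+ con ½ :- con 1ℚ := x :+ con ½) refl (ℕ→ℚ a))

-- The kink of |t| at 0 contributes g(1/2) - g(-1/2) at t = ±1/2.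
secondSum-fold-½ : ∀ g → secondSum (fold g) ½ ≡ secondSum g ½ + (g ½ - g (- ½))
secondSum-fold-½ g = solve 3 (λ x y z → x :+ (con 1ℚ :+ con 1ℚ) :* y :+ y := x :+ (con 1ℚ :+ con 1ℚ) :* y :+ z :+ (y :- z)) refl (g (½ + 1ℚ)) (g ½) (g (- ½))

secondSum-fold-neg : ∀ g t → secondSum (fold g) (- t) ≡ secondSum (fold g) t
secondSum-fold-neg g t = begin
  g ∣ - t + 1ℚ ∣ + (1ℚ + 1ℚ) * g ∣ - t ∣ + g ∣ - t - 1ℚ ∣
    ≡⟨ cong₂ (λ u v → g ∣ u ∣ + (1ℚ + 1ℚ) * g ∣ - t ∣ + g ∣ v ∣) (solve 1 (λ t → :- t :+ con 1ℚ := :- (t :- con 1ℚ)) refl t) (solve 1 (λ t → :- t :- con 1ℚ := :- (t :+ con 1ℚ)) refl t) ⟩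
  g ∣ - (t - 1ℚ) ∣ + (1ℚ + 1ℚ) * g ∣ - t ∣ + g ∣ - (t + 1ℚ) ∣
    ≡⟨ cong₂ (λ u v → u + (1ℚ + 1ℚ) * g ∣ - t ∣ + v) (cong g (QP.∣-p∣≡∣p∣ (t - 1ℚ))) (cong g (QP.∣-p∣≡∣p∣ (t + 1ℚ))) ⟩
  g ∣ t - 1ℚ ∣ + (1ℚ + 1ℚ) * g ∣ - t ∣ + g ∣ t + 1ℚ ∣
    ≡⟨ cong (λ z → g ∣ t - 1ℚ ∣ + (1ℚ + 1ℚ) * g z + g ∣ t + 1ℚ ∣) (QP.∣-p∣≡∣p∣ t) ⟩
  g ∣ t - 1ℚ ∣ + (1ℚ + 1ℚ) * g ∣ t ∣ + g ∣ t + 1ℚ ∣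
    ≡⟨ solve 3 (λ a b c → a :+ (con 1ℚ :+ con 1ℚ) :* b :+ c := c :+ (con 1ℚ :+ con 1ℚ) :* b :+ a) refl (g ∣ t - 1ℚ ∣) (g ∣ t ∣) (g ∣ t + 1ℚ ∣) ⟩
  g ∣ t + 1ℚ ∣ + (1ℚ + 1ℚ) * g ∣ t ∣ + g ∣ t - 1ℚ ∣ ∎

indicator : ℕ → ℕ → ℚ
indicator zero    zero    = 1ℚ
indicator zero    (suc i) = 0ℚ
indicator (suc a) zero    = 0ℚ
indicator (suc a) (suc i) = indicator a i

indicator-same : ∀ a → indicator a a ≡ 1ℚ
indicator-same zero    = refl
indicator-same (suc a) = indicator-same a

indicator-diff : ∀ a i → i ≢ a → indicator a i ≡ 0ℚ
indicator-diff zero    zero    i≢a = ⊥-elim (i≢a refl)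
indicator-diff zero    (suc i) i≢a = refl
indicator-diff (suc a) zero    i≢a = refl
indicator-diff (suc a) (suc i) i≢a = indicator-diff a i (λ e → i≢a (cong suc e))

Σ-indicator : ∀ N (c : ℕ → ℚ) a → a < N → Σ N (λ i → c i * indicator a i) ≡ c a
Σ-indicator N c a a<N = begin
  Σ N (λ i → c i * indicator a i)   ≡⟨ Σ-single N (λ i → c i * indicator a i) a a<N (λ i _ i≢a → trans (cong (c i *_) (indicator-diff a i i≢a)) (QP.*-zeroʳ (c i))) ⟩
  c a * indicator a a               ≡⟨ cong (c a *_) (indicator-same a) ⟩
  c a * 1ℚ                          ≡⟨ QP.*-identityʳ (c a) ⟩
  c a                               ∎

FoldedSecondSum : (ℚ → ℚ) → ℕ → ℕ → Set
FoldedSecondSum g n i = secondSum (fold g) (half (1+2· n) - ℕ→ℚ i)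
  ≡ secondSum g ∣ half (1+2· n) - ℕ→ℚ i ∣ + (g ½ - g (- ½)) * (indicator n i + indicator (suc n) i)

secondSum-fold-below : ∀ g n i → i < n → FoldedSecondSum g n i
secondSum-fold-below g n i i<n = begin
  secondSum (fold g) u                      ≡⟨ cong (secondSum (fold g)) u≡ ⟩
  secondSum (fold g) v                      ≡⟨ secondSum-fold-regular g a ⟩
  secondSum g v                             ≡⟨ cong (secondSum g) (sym (trans (cong ∣_∣ u≡) (∣ℕ→ℚ+½∣ (suc a)))) ⟩
  secondSum g ∣ u ∣                         ≡⟨ solve 2 (λ x d → x := x :+ d :* (con 0ℚ :+ con 0ℚ)) refl (secondSum g ∣ u ∣) d ⟩
  secondSum g ∣ u ∣ + d * (0ℚ + 0ℚ)        ≡⟨ cong (λ z → secondSum g ∣ u ∣ + d * z) (sym (cong₂ _+_ (indicator-diff n i (λ e → ℕP.<-irrefl e i<n)) (indicator-diff (suc n) i (λ e → ℕP.<-irrefl e (ℕP.m<n⇒m<1+n i<n))))) ⟩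
  secondSum g ∣ u ∣ + d * (indicator n i + indicator (suc n) i) ∎
  where
  a = n ℕ.∸ suc i
  u d v : ℚ
  u = half (1+2· n) - ℕ→ℚ i
  d = g ½ - g (- ½)
  v = ℕ→ℚ (suc a) + ½
  u≡ : u ≡ v
  u≡ = begin
    half (1+2· n) - ℕ→ℚ i                    ≡⟨ cong (_- ℕ→ℚ i) (half-1+2· n) ⟩
    ℕ→ℚ n + ½ - ℕ→ℚ i                        ≡⟨ cong (λ z → ℕ→ℚ z + ½ - ℕ→ℚ i) (sym (ℕP.m+[n∸m]≡n i<n)) ⟩
    ℕ→ℚ (suc i ℕ.+ a) + ½ - ℕ→ℚ i            ≡⟨ cong (λ z → z + ½ - ℕ→ℚ i) (trans (ℕ→ℚ-+ (suc i) a) (cong (_+ ℕ→ℚ a) (ℕ→ℚ-suc i))) ⟩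
    1ℚ + ℕ→ℚ i + ℕ→ℚ a + ½ - ℕ→ℚ i           ≡⟨ solve 2 (λ x y → con 1ℚ :+ x :+ y :+ con ½ :- x := con 1ℚ :+ y :+ con ½) refl (ℕ→ℚ i) (ℕ→ℚ a) ⟩
    1ℚ + ℕ→ℚ a + ½                           ≡⟨ cong (_+ ½) (sym (ℕ→ℚ-suc a)) ⟩
    v                                        ∎

secondSum-fold-centre : ∀ g n → FoldedSecondSum g n n
secondSum-fold-centre g n = begin
  secondSum (fold g) u                      ≡⟨ cong (secondSum (fold g)) u≡½ ⟩
  secondSum (fold g) ½                      ≡⟨ secondSum-fold-½ g ⟩
  secondSum g ½ + d                         ≡⟨ solve 2 (λ x d → x :+ d := x :+ d :* (con 1ℚ :+ con 0ℚ)) refl (secondSum g ½) d ⟩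
  secondSum g ½ + d * (1ℚ + 0ℚ)            ≡⟨ cong₂ (λ x y → secondSum g x + d * y) (sym (cong ∣_∣ u≡½)) (sym (cong₂ _+_ (indicator-same n) (indicator-diff (suc n) n (λ e → ℕP.<-irrefl e (ℕP.n<1+n n))))) ⟩
  secondSum g ∣ u ∣ + d * (indicator n n + indicator (suc n) n) ∎
  where
  u d : ℚ
  u = half (1+2· n) - ℕ→ℚ n
  d = g ½ - g (- ½)
  u≡½ : u ≡ ½
  u≡½ = trans (cong (_- ℕ→ℚ n) (half-1+2· n)) (solve 1 (λ x → x :+ con ½ :- x := con ½) refl (ℕ→ℚ n))

secondSum-fold-centre′ : ∀ g n → FoldedSecondSum g n (suc n)
secondSum-fold-centre′ g n = begin
  secondSum (fold g) u                      ≡⟨ cong (secondSum (fold g)) u≡-½ ⟩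
  secondSum (fold g) (- ½)                  ≡⟨ secondSum-fold-neg g ½ ⟩
  secondSum (fold g) ½                      ≡⟨ secondSum-fold-½ g ⟩
  secondSum g ½ + d                         ≡⟨ solve 2 (λ x d → x :+ d := x :+ d :* (con 0ℚ :+ con 1ℚ)) refl (secondSum g ½) d ⟩
  secondSum g ½ + d * (0ℚ + 1ℚ)            ≡⟨ cong₂ (λ x y → secondSum g x + d * y) (sym (cong ∣_∣ u≡-½)) (sym (cong₂ _+_ (indicator-diff n (suc n) (λ e → ℕP.<-irrefl (sym e) (ℕP.n<1+n n))) (indicator-same (suc n)))) ⟩
  secondSum g ∣ u ∣ + d * (indicator n (suc n) + indicator (suc n) (suc n)) ∎
  where
  u d : ℚ
  u = half (1+2· n) - ℕ→ℚ (suc n)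
  d = g ½ - g (- ½)
  u≡-½ : u ≡ - ½
  u≡-½ = trans (cong₂ _-_ (half-1+2· n) (ℕ→ℚ-suc n)) (solve 1 (λ x → x :+ con ½ :- (con 1ℚ :+ x) := :- con ½) refl (ℕ→ℚ n))

secondSum-fold-above : ∀ g n i → suc n < i → FoldedSecondSum g n i
secondSum-fold-above g n i 1+n<i = begin
  secondSum (fold g) u                      ≡⟨ cong (secondSum (fold g)) u≡ ⟩
  secondSum (fold g) (- v)                  ≡⟨ secondSum-fold-neg g v ⟩
  secondSum (fold g) v                      ≡⟨ secondSum-fold-regular g b ⟩
  secondSum g v                             ≡⟨ cong (secondSum g) (sym (trans (cong ∣_∣ u≡) (∣-[ℕ→ℚ+½]∣ (suc b)))) ⟩
  secondSum g ∣ u ∣                         ≡⟨ solve 2 (λ x d → x := x :+ d :* (con 0ℚ :+ con 0ℚ)) refl (secondSum g ∣ u ∣) d ⟩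
  secondSum g ∣ u ∣ + d * (0ℚ + 0ℚ)        ≡⟨ cong (λ z → secondSum g ∣ u ∣ + d * z) (sym (cong₂ _+_ (indicator-diff n i (λ e → ℕP.<-irrefl (sym e) (ℕP.<-trans (ℕP.n<1+n n) 1+n<i))) (indicator-diff (suc n) i (λ e → ℕP.<-irrefl (sym e) 1+n<i)))) ⟩
  secondSum g ∣ u ∣ + d * (indicator n i + indicator (suc n) i) ∎
  where
  b = i ℕ.∸ suc (suc n)
  u d v : ℚ
  u = half (1+2· n) - ℕ→ℚ i
  d = g ½ - g (- ½)
  v = ℕ→ℚ (suc b) + ½
  u≡ : u ≡ - v
  u≡ = begin
    half (1+2· n) - ℕ→ℚ i                        ≡⟨ cong₂ _-_ (half-1+2· n) (cong ℕ→ℚ (sym (ℕP.m+[n∸m]≡n 1+n<i))) ⟩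
    ℕ→ℚ n + ½ - ℕ→ℚ (suc (suc n) ℕ.+ b)          ≡⟨ cong (λ z → ℕ→ℚ n + ½ - z) (trans (ℕ→ℚ-+ (suc (suc n)) b) (cong (_+ ℕ→ℚ b) (trans (ℕ→ℚ-suc (suc n)) (cong (1ℚ +_) (ℕ→ℚ-suc n))))) ⟩
    ℕ→ℚ n + ½ - (1ℚ + (1ℚ + ℕ→ℚ n) + ℕ→ℚ b)      ≡⟨ solve 2 (λ x y → x :+ con ½ :- (con 1ℚ :+ (con 1ℚ :+ x) :+ y) := :- (con 1ℚ :+ y :+ con ½)) refl (ℕ→ℚ n) (ℕ→ℚ b) ⟩
    - (1ℚ + ℕ→ℚ b + ½)                           ≡⟨ cong (λ z → - (z + ½)) (sym (ℕ→ℚ-suc b)) ⟩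
    - v                                          ∎

secondSum-fold-at : ∀ g n i → FoldedSecondSum g n i
secondSum-fold-at g n i = by-cases i (ℕP.<-cmp i n) (ℕP.<-cmp i (suc n))
  where
  by-cases : ∀ i → Tri (i < n) (i ≡ n) (n < i) → Tri (i < suc n) (i ≡ suc n) (suc n < i) → FoldedSecondSum g n i
  by-cases i (tri< i<n _ _) _                 = secondSum-fold-below g n i i<n
  by-cases i (tri≈ _ refl _) _                = secondSum-fold-centre g n
  by-cases i (tri> _ _ n<i) (tri< i<1+n _ _)  = ⊥-elim (ℕP.<-irrefl refl (ℕP.<-≤-trans n<i (ℕP.≤-pred i<1+n)))
  by-cases i (tri> _ _ _) (tri≈ _ refl _)     = secondSum-fold-centre′ g n
  by-cases i (tri> _ _ _) (tri> _ _ 1+n<i)    = secondSum-fold-above g n i 1+n<i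

foldedBinomialSum-suc : ∀ n g →
  foldedBinomialSum (suc n) g ≡ foldedBinomialSum n (secondSum g) + binom (2· suc n) (suc n) * (g ½ - g (- ½))
foldedBinomialSum-suc n g = begin
  foldedBinomialSum (suc n) g
    ≡⟨ binomialSum-suc-suc (1+2· n) (fold g) ⟩
  Σ (suc o) (λ i → binom o i * secondSum (fold g) (u i))
    ≡⟨ Σ-cong′ (suc o) (λ i → trans (cong (binom o i *_) (secondSum-fold-at g n i)) (spread i)) ⟩
  Σ (suc o) (λ i → A i + d * (binom o i * indicator n i) + d * (binom o i * indicator (suc n) i))
    ≡⟨ Σ-+ (suc o) (λ i → A i + d * (binom o i * indicator n i)) (λ i → d * (binom o i * indicator (suc n) i)) ⟩
  Σ (suc o) (λ i → A i + d * (binom o i * indicator n i)) + Σ (suc o) (λ i → d * (binom o i * indicator (suc n) i))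
    ≡⟨ cong₂ _+_ (Σ-+ (suc o) A (λ i → d * (binom o i * indicator n i))) (Σ-*ˡ (suc o) d (λ i → binom o i * indicator (suc n) i)) ⟩
  Σ (suc o) A + Σ (suc o) (λ i → d * (binom o i * indicator n i)) + d * Σ (suc o) (λ i → binom o i * indicator (suc n) i)
    ≡⟨ cong₂ (λ x y → Σ (suc o) A + x + d * y) (trans (Σ-*ˡ (suc o) d (λ i → binom o i * indicator n i)) (cong (d *_) (Σ-indicator (suc o) (binom o) n n<)))
                                               (Σ-indicator (suc o) (binom o) (suc n) 1+n<) ⟩
  foldedBinomialSum n (secondSum g) + d * binom o n + d * binom o (suc n)
    ≡⟨ solve 4 (λ p d a b → p :+ d :* a :+ d :* b := p :+ (a :+ b) :* d) refl (foldedBinomialSum n (secondSum g)) d (binom o n) (binom o (suc n)) ⟩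
  foldedBinomialSum n (secondSum g) + (binom o n + binom o (suc n)) * d
    ≡⟨ cong (λ z → foldedBinomialSum n (secondSum g) + z * d) (sym (binom-pascal o n)) ⟩
  foldedBinomialSum n (secondSum g) + binom (2· suc n) (suc n) * d ∎
  where
  o = 1+2· n
  d : ℚ
  d = g ½ - g (- ½)
  u A : ℕ → ℚ
  u i = half o - ℕ→ℚ i
  A i = binom o i * secondSum g ∣ u i ∣
  spread : ∀ i → binom o i * (secondSum g ∣ u i ∣ + d * (indicator n i + indicator (suc n) i))
               ≡ A i + d * (binom o i * indicator n i) + d * (binom o i * indicator (suc n) i)
  spread i = solve 5 (λ c x d a b → c :* (x :+ d :* (a :+ b)) := c :* x :+ d :* (c :* a) :+ d :* (c :* b)) refl (binom o i) (secondSum g ∣ u i ∣) d (indicator n i) (indicator (suc n) i)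
  n< : n < suc o
  n< = s≤s (ℕP.≤-trans (m≤2·m n) (ℕP.n≤1+n (2· n)))
  1+n< : suc n < suc o
  1+n< = s≤s (s≤s (m≤2·m n))

foldedBinomialSum-recurrence : ∀ n g → foldedBinomialSum (suc n) g
  ≡ ℕ→ℚ 4 * foldedBinomialSum n g + 1ℚ * foldedBinomialSum n (δ (δ g)) + binom (2· suc n) (suc n) * (g ½ - g (- ½))
foldedBinomialSum-recurrence n g =
  trans (foldedBinomialSum-suc n g)
        (cong (_+ binom (2· suc n) (suc n) * (g ½ - g (- ½)))
              (trans (foldedBinomialSum-cong n (secondSum-δδ g)) (foldedBinomialSum-linear n (ℕ→ℚ 4) 1ℚ g (δ (δ g)))))

foldedValue : ℕ → ℕ → ℚ
foldedValue n k = binom (2· suc n) (suc n) * sgn (suc k) * poch (- ℕ→ℚ (suc n)) (suc k) * ℕ→ℚ (k !) * ½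

foldedValue-recurrence₀ : ∀ n → ℕ→ℚ 4 * foldedValue n 0 + binom (2· suc n) (suc n) * 1ℚ ≡ foldedValue (suc n) 0
foldedValue-recurrence₀ n = begin
  ℕ→ℚ 4 * (Cn * sgn 1 * (1ℚ * (- M1 + 0ℚ)) * 1ℚ * ½) + Cn * 1ℚ
    ≡⟨ cong (λ z → ℕ→ℚ 4 * (Cn * sgn 1 * (1ℚ * (- z + 0ℚ)) * 1ℚ * ½) + Cn * 1ℚ) (ℕ→ℚ-suc n) ⟩
  ℕ→ℚ 4 * (Cn * sgn 1 * (1ℚ * (- (1ℚ + N) + 0ℚ)) * 1ℚ * ½) + Cn * 1ℚ
    ≡⟨ solve 2 (λ c n → con (ℕ→ℚ 4) :* (c :* con (- 1ℚ) :* (con 1ℚ :* (:- (con 1ℚ :+ n) :+ con 0ℚ)) :* con 1ℚ :* con ½) :+ c :* con 1ℚ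
               := con ½ :* ((con 1ℚ :+ con 1ℚ) :* (con 1ℚ :+ (con 1ℚ :+ n :+ (con 1ℚ :+ n))) :* c)) refl Cn N ⟩
  ½ * ((1ℚ + 1ℚ) * (1ℚ + (1ℚ + N + (1ℚ + N))) * Cn)
    ≡⟨ cong (λ z → ½ * ((1ℚ + 1ℚ) * z * Cn)) (sym ℕ→ℚ-1+2·[1+n]) ⟩
  ½ * ((1ℚ + 1ℚ) * ℕ→ℚ (1+2· suc n) * Cn)
    ≡⟨ cong (½ *_) (sym (central-binom-suc (suc n))) ⟩
  ½ * (binom (2· suc (suc n)) (suc (suc n)) * ℕ→ℚ (suc (suc n)))
    ≡⟨ solve 2 (λ c m → con ½ :* (c :* m) := c :* con (- 1ℚ) :* (con 1ℚ :* (:- m :+ con 0ℚ)) :* con 1ℚ :* con ½) refl (binom (2· suc (suc n)) (suc (suc n))) (ℕ→ℚ (suc (suc n))) ⟩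
  foldedValue (suc n) 0 ∎
  where
  Cn N M1 : ℚ
  Cn = binom (2· suc n) (suc n)
  N  = ℕ→ℚ n
  M1 = ℕ→ℚ (suc n)
  ℕ→ℚ-1+2·[1+n] : ℕ→ℚ (1+2· suc n) ≡ 1ℚ + (1ℚ + N + (1ℚ + N))
  ℕ→ℚ-1+2·[1+n] = trans (ℕ→ℚ-suc (2· suc n)) (cong (1ℚ +_) (trans (ℕ→ℚ-2· (suc n)) (cong₂ _+_ (ℕ→ℚ-suc n) (ℕ→ℚ-suc n))))

foldedValue-recurrence : ∀ n k →
  ℕ→ℚ 4 * foldedValue n (suc k) + 1ℚ * (ℕ→ℚ (1+2· suc k) * ℕ→ℚ (2· suc k) * foldedValue n k) ≡ foldedValue (suc n) (suc k)
foldedValue-recurrence n k = begin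
  ℕ→ℚ 4 * (Cn * sgn (suc (suc k)) * (Pk * (a + ℕ→ℚ (suc k))) * ℕ→ℚ (suc k !) * ½) + 1ℚ * (c * (Cn * sgn (suc k) * Pk * F * ½))
    ≡⟨ cong₃ (λ u v w → ℕ→ℚ 4 * (Cn * sgn (suc (suc k)) * (Pk * (a + u)) * v * ½) + 1ℚ * (w * (Cn * sgn (suc k) * Pk * F * ½)))
             (ℕ→ℚ-suc k) (trans (ℕ→ℚ-* (suc k) (k !)) (cong (_* F) (ℕ→ℚ-suc k))) c≡ ⟩
  ℕ→ℚ 4 * (Cn * sgn (suc (suc k)) * (Pk * (a + (1ℚ + K))) * ((1ℚ + K) * F) * ½) + 1ℚ * ((1ℚ + (1ℚ + (1ℚ + (K + K)))) * (1ℚ + (1ℚ + (K + K))) * (Cn * sgn (suc k) * Pk * F * ½))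
    ≡⟨ solve 6 (λ c s pk f k m →
          con (ℕ→ℚ 4) :* (c :* (con (- 1ℚ) :* (con (- 1ℚ) :* s)) :* (pk :* (:- m :+ (con 1ℚ :+ k))) :* ((con 1ℚ :+ k) :* f) :* con ½) :+ con 1ℚ :* ((con 1ℚ :+ (con 1ℚ :+ (con 1ℚ :+ (k :+ k)))) :* (con 1ℚ :+ (con 1ℚ :+ (k :+ k))) :* (c :* (con (- 1ℚ) :* s) :* pk :* f :* con ½))
          := (con 1ℚ :+ con 1ℚ) :* (con 1ℚ :+ (m :+ m)) :* c :* (:- (s :* pk :* (con 1ℚ :+ k) :* f :* con ½))) refl Cn S Pk F K M1 ⟩
  (1ℚ + 1ℚ) * (1ℚ + (M1 + M1)) * Cn * (- (S * Pk * (1ℚ + K) * F * ½))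
    ≡⟨ cong (λ z → (1ℚ + 1ℚ) * z * Cn * (- (S * Pk * (1ℚ + K) * F * ½))) (sym (trans (ℕ→ℚ-suc (2· suc n)) (cong (1ℚ +_) (ℕ→ℚ-2· (suc n))))) ⟩
  (1ℚ + 1ℚ) * ℕ→ℚ (1+2· suc n) * Cn * (- (S * Pk * (1ℚ + K) * F * ½))
    ≡⟨ cong (_* (- (S * Pk * (1ℚ + K) * F * ½))) (sym (central-binom-suc (suc n))) ⟩
  Cn′ * M2 * (- (S * Pk * (1ℚ + K) * F * ½))
    ≡⟨ solve 6 (λ c m s p k f → c :* m :* (:- (s :* p :* (con 1ℚ :+ k) :* f :* con ½)) := c :* (con (- 1ℚ) :* (con (- 1ℚ) :* s)) :* (:- m :* p) :* ((con 1ℚ :+ k) :* f) :* con ½) refl Cn′ M2 S Pk K F ⟩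
  Cn′ * sgn (suc (suc k)) * (- M2 * Pk) * ((1ℚ + K) * F) * ½
    ≡⟨ cong₂ (λ u v → Cn′ * sgn (suc (suc k)) * u * v * ½) (sym poch-M2) (sym (trans (ℕ→ℚ-* (suc k) (k !)) (cong (_* F) (ℕ→ℚ-suc k)))) ⟩
  foldedValue (suc n) (suc k) ∎
  where
  Cn Cn′ K F S Pk a M1 M2 c : ℚ
  Cn  = binom (2· suc n) (suc n)
  Cn′ = binom (2· suc (suc n)) (suc (suc n))
  K   = ℕ→ℚ k
  F   = ℕ→ℚ (k !)
  S   = sgn k
  M1  = ℕ→ℚ (suc n)
  M2  = ℕ→ℚ (suc (suc n))
  a   = - M1
  Pk  = poch a (suc k)
  c   = ℕ→ℚ (1+2· suc k) * ℕ→ℚ (2· suc k)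
  c≡ : c ≡ (1ℚ + (1ℚ + (1ℚ + (K + K)))) * (1ℚ + (1ℚ + (K + K)))
  c≡ = cong₂ _*_ (trans (ℕ→ℚ-suc (suc (1+2· k))) (cong (1ℚ +_) (trans (ℕ→ℚ-suc (1+2· k)) (cong (1ℚ +_) (trans (ℕ→ℚ-suc (2· k)) (cong (1ℚ +_) (ℕ→ℚ-2· k)))))))
                 (trans (ℕ→ℚ-suc (1+2· k)) (cong (1ℚ +_) (trans (ℕ→ℚ-suc (2· k)) (cong (1ℚ +_) (ℕ→ℚ-2· k)))))
  poch-M2 : poch (- M2) (suc (suc k)) ≡ - M2 * Pk
  poch-M2 = trans (poch-head (- M2) (suc k)) (cong (λ z → - M2 * poch z (suc k))
              (trans (cong (λ z → - z + 1ℚ) (ℕ→ℚ-suc (suc n))) (solve 1 (λ m → :- (con 1ℚ :+ m) :+ con 1ℚ := :- m) refl M1)))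

-- Here the boundary term of foldedBinomialSum-recurrence vanishes except for t^[1], since t^[2k+3] vanishes at ±1/2.
foldedBinomialSum-cfact-1+2· : ∀ n k → foldedBinomialSum n (cfact (1+2· k)) ≡ foldedValue n k
foldedBinomialSum-cfact-1+2· zero zero = refl
foldedBinomialSum-cfact-1+2· zero (suc k) = begin
  foldedBinomialSum 0 (cfact (1+2· suc k))
    ≡⟨ solve 1 (λ x → con 1ℚ :* x :+ (con 1ℚ :* x :+ con 0ℚ) := x :+ x) refl (cfact (1+2· suc k) ½) ⟩
  cfact (1+2· suc k) ½ + cfact (1+2· suc k) ½
    ≡⟨ cong (λ z → z + z) (cfact-½ k) ⟩
  0ℚ + 0ℚ
    ≡⟨ solve 4 (λ a b c d → con 0ℚ :+ con 0ℚ := a :* b :* con 0ℚ :* c :* d) refl (binom 2 1) (sgn (suc (suc k))) (ℕ→ℚ (suc k !)) ½ ⟩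
  binom 2 1 * sgn (suc (suc k)) * 0ℚ * ℕ→ℚ (suc k !) * ½
    ≡⟨ cong (λ z → binom 2 1 * sgn (suc (suc k)) * z * ℕ→ℚ (suc k !) * ½) (sym (poch-vanishes (- ℕ→ℚ 1) 1 (suc (suc k)) (s≤s (s≤s z≤n)) refl)) ⟩
  foldedValue 0 (suc k) ∎
foldedBinomialSum-cfact-1+2· (suc n) zero = begin
  foldedBinomialSum (suc n) (cfact 1)
    ≡⟨ foldedBinomialSum-recurrence n (cfact 1) ⟩
  ℕ→ℚ 4 * foldedBinomialSum n (cfact 1) + 1ℚ * foldedBinomialSum n (δ (δ (cfact 1))) + Cn * (cfact 1 ½ - cfact 1 (- ½))
    ≡⟨ cong₂ (λ a b → ℕ→ℚ 4 * a + 1ℚ * b + Cn * 1ℚ) (foldedBinomialSum-cfact-1+2· n zero)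
             (trans (foldedBinomialSum-cong n δδ-cfact-1) (foldedBinomialSum-scale n 0ℚ (cfact 1))) ⟩
  ℕ→ℚ 4 * foldedValue n 0 + 1ℚ * (0ℚ * foldedBinomialSum n (cfact 1)) + Cn * 1ℚ
    ≡⟨ solve 3 (λ v x c → con (ℕ→ℚ 4) :* v :+ con 1ℚ :* (con 0ℚ :* x) :+ c :* con 1ℚ := con (ℕ→ℚ 4) :* v :+ c :* con 1ℚ) refl (foldedValue n 0) (foldedBinomialSum n (cfact 1)) Cn ⟩
  ℕ→ℚ 4 * foldedValue n 0 + Cn * 1ℚ
    ≡⟨ foldedValue-recurrence₀ n ⟩
  foldedValue (suc n) 0 ∎
  where
  Cn : ℚ
  Cn = binom (2· suc n) (suc n)
  δδ-cfact-1 : ∀ t → δ (δ (cfact 1)) t ≡ 0ℚ * cfact 1 t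
  δδ-cfact-1 t = solve 1 (λ t → t :+ con ½ :+ con ½ :- (t :+ con ½ :- con ½) :- (t :- con ½ :+ con ½ :- (t :- con ½ :- con ½)) := con 0ℚ :* t) refl t
foldedBinomialSum-cfact-1+2· (suc n) (suc k) = begin
  foldedBinomialSum (suc n) (cfact (1+2· suc k))
    ≡⟨ foldedBinomialSum-recurrence n (cfact (1+2· suc k)) ⟩
  ℕ→ℚ 4 * foldedBinomialSum n (cfact (1+2· suc k)) + 1ℚ * foldedBinomialSum n (δ (δ (cfact (1+2· suc k)))) + Cn * (cfact (1+2· suc k) ½ - cfact (1+2· suc k) (- ½))
    ≡⟨ cong₃ (λ a b d → ℕ→ℚ 4 * a + 1ℚ * b + Cn * d)
             (foldedBinomialSum-cfact-1+2· n (suc k))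
             (trans (foldedBinomialSum-cong n (δδ-cfact (1+2· k))) (trans (foldedBinomialSum-scale n c (cfact (1+2· k))) (cong (c *_) (foldedBinomialSum-cfact-1+2· n k))))
             boundary ⟩
  ℕ→ℚ 4 * foldedValue n (suc k) + 1ℚ * (c * foldedValue n k) + Cn * 0ℚ
    ≡⟨ solve 2 (λ x c → x :+ c :* con 0ℚ := x) refl (ℕ→ℚ 4 * foldedValue n (suc k) + 1ℚ * (c * foldedValue n k)) Cn ⟩
  ℕ→ℚ 4 * foldedValue n (suc k) + 1ℚ * (c * foldedValue n k)
    ≡⟨ foldedValue-recurrence n k ⟩
  foldedValue (suc n) (suc k) ∎
  where
  Cn c : ℚ
  Cn = binom (2· suc n) (suc n)
  c  = ℕ→ℚ (1+2· suc k) * ℕ→ℚ (2· suc k)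
  boundary : cfact (1+2· suc k) ½ - cfact (1+2· suc k) (- ½) ≡ 0ℚ
  boundary = begin
    cfact (1+2· suc k) ½ - cfact (1+2· suc k) (- ½)                        ≡⟨ cong (λ z → cfact (1+2· suc k) ½ - z) (cfact-neg (1+2· suc k) ½) ⟩
    cfact (1+2· suc k) ½ - sgn (1+2· suc k) * cfact (1+2· suc k) ½         ≡⟨ cong (λ z → z - sgn (1+2· suc k) * z) (cfact-½ k) ⟩
    0ℚ - sgn (1+2· suc k) * 0ℚ                                             ≡⟨ solve 1 (λ s → con 0ℚ :- s :* con 0ℚ := con 0ℚ) refl (sgn (1+2· suc k)) ⟩
    0ℚ                                                                     ∎

Σ-head-odd-even : ∀ r (F : ℕ → ℚ) → Σ (suc (2· r)) F ≡ F 0 + Σ r (λ k → F (1+2· k) + F (2· suc k))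
Σ-head-odd-even zero    F = refl
Σ-head-odd-even (suc r) F = begin
  Σ (suc (2· suc r)) F                                  ≡⟨ Σ-last (2· suc r) F ⟩
  Σ (2· suc r) F + F (2· suc r)                         ≡⟨ cong (_+ F (2· suc r)) (Σ-last (1+2· r) F) ⟩
  Σ (suc (2· r)) F + F (1+2· r) + F (2· suc r)          ≡⟨ cong (λ z → z + F (1+2· r) + F (2· suc r)) (Σ-head-odd-even r F) ⟩
  F 0 + Σ r G + F (1+2· r) + F (2· suc r)               ≡⟨ solve 4 (λ a b c d → a :+ b :+ c :+ d := a :+ (b :+ (c :+ d))) refl (F 0) (Σ r G) (F (1+2· r)) (F (2· suc r)) ⟩
  F 0 + (Σ r G + G r)                                   ≡⟨ cong (F 0 +_) (sym (Σ-last r G)) ⟩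
  F 0 + Σ (suc r) G                                     ∎
  where
  G : ℕ → ℚ
  G k = F (1+2· k) + F (2· suc k)

sum1jkr-Σ : ∀ r c (F : ℕ → ℚ) (g : ℕ → ℕ → ℚ) →
  (∀ k → k < r → F k ≡ c * Σ (suc k) (λ j → g (suc j) (suc k))) → Σ r F ≡ c * sum1jkr r g
sum1jkr-Σ r c F g F≡ = begin
  Σ r F                                                   ≡⟨ Σ-cong r F≡ ⟩
  Σ r (λ k → c * Σ (suc k) (λ j → g (suc j) (suc k)))     ≡⟨ Σ-*ˡ r c _ ⟩
  c * Σ r (λ k → Σ (suc k) (λ j → g (suc j) (suc k)))     ≡⟨ cong (c *_) (Σ-cong′ r (λ k → sym (sumFrom≡Σ 1 (suc k) (λ j → g j (suc k))))) ⟩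
  c * Σ r (λ k → sumFrom 1 (suc k) (λ j → g j (suc k)))   ≡⟨ cong (c *_) (sym (sumFrom≡Σ 1 r (λ k → sumFrom 1 k (λ j → g j k)))) ⟩
  c * sum1jkr r g                                         ∎

÷₀-factorials : ∀ A a b → (A ÷₀ (ℕ→ℚ (a !) * ℕ→ℚ (b !))) * ℕ→ℚ ((b ℕ.+ a) !) ≡ A * binom (b ℕ.+ a) b
÷₀-factorials A a b = begin
  (A ÷₀ d) * ℕ→ℚ ((b ℕ.+ a) !)      ≡⟨ cong ((A ÷₀ d) *_) (sym d*C) ⟩
  (A ÷₀ d) * (d * C)                ≡⟨ sym (QP.*-assoc (A ÷₀ d) d C) ⟩
  (A ÷₀ d) * d * C                  ≡⟨ cong (_* C) (÷₀-*-cancel A d (*-≢0 _ _ (ℕ→ℚ-!≢0 a) (ℕ→ℚ-!≢0 b))) ⟩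
  A * C                             ∎
  where
  d C : ℚ
  d = ℕ→ℚ (a !) * ℕ→ℚ (b !)
  C = binom (b ℕ.+ a) b
  d*C : d * C ≡ ℕ→ℚ ((b ℕ.+ a) !)
  d*C = begin
    ℕ→ℚ (a !) * ℕ→ℚ (b !) * C                        ≡⟨ cong (_* C) (QP.*-comm (ℕ→ℚ (a !)) (ℕ→ℚ (b !))) ⟩
    ℕ→ℚ (b !) * ℕ→ℚ (a !) * C                        ≡⟨ cong (λ z → ℕ→ℚ (b !) * ℕ→ℚ (z !) * C) (sym (ℕP.m+n∸m≡n b a)) ⟩
    ℕ→ℚ (b !) * ℕ→ℚ ((b ℕ.+ a ℕ.∸ b) !) * C          ≡⟨ k!*[n∸k]!*binom (b ℕ.+ a) b (ℕP.m≤m+n b a) ⟩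
    ℕ→ℚ ((b ℕ.+ a) !)                                ∎

cancel-! : ∀ m x y → x * ℕ→ℚ (m !) ≡ y * ℕ→ℚ (m !) → x ≡ y
cancel-! m x y = *-cancelʳ-≢0 x y (ℕ→ℚ (m !)) (ℕ→ℚ-!≢0 m)

Σ-scaled : ∀ K W X (t τ : ℕ → ℚ) → (∀ j → j < K → t j * W ≡ X * τ j) → Σ K t * W ≡ X * Σ K τ
Σ-scaled K W X t τ t≡ = begin
  Σ K t * W                 ≡⟨ sym (Σ-*ʳ K W t) ⟩
  Σ K (λ j → t j * W)       ≡⟨ Σ-cong K t≡ ⟩
  Σ K (λ j → X * τ j)       ≡⟨ Σ-*ˡ K X τ ⟩
  X * Σ K τ                 ∎

2·≡+j+∸ : ∀ K j → j ≤ K → 2· K ≡ K ℕ.+ j ℕ.+ (K ℕ.∸ j)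
2·≡+j+∸ K j j≤K = trans (2·≡+ K) (trans (cong (K ℕ.+_) (sym (ℕP.m+[n∸m]≡n j≤K))) (sym (ℕP.+-assoc K j (K ℕ.∸ j))))

÷₀-central : ∀ A K j → j ≤ K → (A ÷₀ ℕ→ℚ ((K ℕ.∸ j) ! ℕ.* (K ℕ.+ j) !)) * ℕ→ℚ ((2· K) !) ≡ A * binom (2· K) (K ℕ.+ j)
÷₀-central A K j j≤K = begin
  (A ÷₀ ℕ→ℚ ((K ℕ.∸ j) ! ℕ.* (K ℕ.+ j) !)) * ℕ→ℚ ((2· K) !)
    ≡⟨ cong₂ (λ u v → (A ÷₀ u) * ℕ→ℚ (v !)) (ℕ→ℚ-* ((K ℕ.∸ j) !) ((K ℕ.+ j) !)) (2·≡+j+∸ K j j≤K) ⟩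
  (A ÷₀ (ℕ→ℚ ((K ℕ.∸ j) !) * ℕ→ℚ ((K ℕ.+ j) !))) * ℕ→ℚ ((K ℕ.+ j ℕ.+ (K ℕ.∸ j)) !)
    ≡⟨ ÷₀-factorials A (K ℕ.∸ j) (K ℕ.+ j) ⟩
  A * binom (K ℕ.+ j ℕ.+ (K ℕ.∸ j)) (K ℕ.+ j)
    ≡⟨ cong (λ v → A * binom v (K ℕ.+ j)) (sym (2·≡+j+∸ K j j≤K)) ⟩
  A * binom (2· K) (K ℕ.+ j) ∎

-- termᵢ N n j k is the (j,k) summand of the i-th formula, N being the exponent of j (resp. j - 1/2).
term₁ : ℕ → ℕ → ℕ → ℕ → ℚ
term₁ N n j k = sgn j * ((poch (- half n) k * poch ½ k) ÷₀ ℕ→ℚ (((k ℕ.∸ j) !) ℕ.* ((k ℕ.+ j) !))) * (ℕ→ℚ j ^ N)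

term₁-scaled : ∀ N n K j → j ≤ K →
  term₁ N n j K * ℕ→ℚ ((2· K) !) ≡ (poch (- half n) K * poch ½ K) * (sgn j * binom (2· K) (K ℕ.+ j) * ℕ→ℚ j ^ N)
term₁-scaled N n K j j≤K = begin
  sgn j * Q * x * W              ≡⟨ solve 4 (λ s q x w → s :* q :* x :* w := s :* (q :* w) :* x) refl (sgn j) Q x W ⟩
  sgn j * (Q * W) * x            ≡⟨ cong (λ z → sgn j * z * x) (÷₀-central A K j j≤K) ⟩
  sgn j * (A * B) * x            ≡⟨ solve 4 (λ s a c x → s :* (a :* c) :* x := a :* (s :* c :* x)) refl (sgn j) A B x ⟩
  A * (sgn j * B * x)            ∎
  where
  A Q B x W : ℚ
  A = poch (- half n) K * poch ½ K
  Q = A ÷₀ ℕ→ℚ ((K ℕ.∸ j) ! ℕ.* (K ℕ.+ j) !)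
  B = binom (2· K) (K ℕ.+ j)
  x = ℕ→ℚ j ^ N
  W = ℕ→ℚ ((2· K) !)

formula₁-term : ∀ r n (a : ℕ → ℚ) → (∀ t → t ^ 2· r ≡ Σ (suc (2· r)) (λ m → a m * cfact m t)) → ∀ k → k < r →
  a (2· suc k) * binomialSum n (cfact (2· suc k)) ≡ ℕ→ℚ 2 ^ (n ℕ.+ 1) * Σ (suc k) (λ j → term₁ (2· r) n (suc j) (suc k))
formula₁-term r n a expands k k<r = cancel-! (2· K) _ _ (begin
  a (2· K) * L * W                         ≡⟨ solve 3 (λ a l w → a :* l :* w := l :* (a :* w)) refl (a (2· K)) L W ⟩
  L * (a (2· K) * W)                       ≡⟨ cong₂ _*_ (binomialSum-cfact-2· n K) coefficient ⟩
  ℕ→ℚ 2 ^ n * sgn K * A * ((1ℚ + 1ℚ) * sgn K * S)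
                                           ≡⟨ solve 4 (λ p s a x → p :* s :* a :* ((con 1ℚ :+ con 1ℚ) :* s :* x) := con (ℕ→ℚ 2) :* p :* (a :* x) :* (s :* s)) refl (ℕ→ℚ 2 ^ n) (sgn K) A S ⟩
  ℕ→ℚ 2 * ℕ→ℚ 2 ^ n * (A * S) * (sgn K * sgn K)
                                           ≡⟨ cong₂ (λ u v → u * (A * S) * v) (cong (ℕ→ℚ 2 ^_) (ℕP.+-comm 1 n)) (sgn*sgn K) ⟩
  T * (A * S) * 1ℚ                         ≡⟨ QP.*-identityʳ (T * (A * S)) ⟩
  T * (A * S)                              ≡⟨ cong (T *_) (sym (Σ-scaled K W A t τ (λ j j<K → term₁-scaled (2· r) n K (suc j) j<K))) ⟩
  T * (Σ K t * W)                          ≡⟨ sym (QP.*-assoc T (Σ K t) W) ⟩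
  T * Σ K t * W                            ∎)
  where
  K = suc k
  p : ℚ → ℚ
  p t = t ^ 2· r
  A L W S T : ℚ
  A = poch (- half n) K * poch ½ K
  L = binomialSum n (cfact (2· K))
  W = ℕ→ℚ ((2· K) !)
  t τ : ℕ → ℚ
  t j = term₁ (2· r) n (suc j) K
  τ j = sgn (suc j) * binom (2· K) (K ℕ.+ suc j) * p (ℕ→ℚ (suc j))
  S = Σ K τ
  T = ℕ→ℚ 2 ^ (n ℕ.+ 1)
  coefficient : a (2· K) * W ≡ (1ℚ + 1ℚ) * sgn K * S
  coefficient = trans (sym (δ₀-coefficient (suc (2· r)) a p expands (2· K) (s≤s (2·-mono-≤ k<r))))
                      (δ₀-2·-even K p (λ t → -[x]^2· t r) (0^2· r (ℕP.≤-trans (s≤s z≤n) k<r)))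

formula₁ : ∀ r n → U (2· suc r) n ≡ ℕ→ℚ 2 ^ (n ℕ.+ 1) * sum1jkr (suc r) (term₁ (2· suc r) n)
formula₁ r n = begin
  U (2· R) n                                       ≡⟨ binomialSum-cong n (λ t → ∣x∣^2· t R) ⟩
  binomialSum n p                                  ≡⟨ binomialSum-cong n expands ⟩
  binomialSum n (λ t → Σ (suc (2· R)) (λ m → a m * cfact m t))
                                                   ≡⟨ wsum-Σ (suc n) (binom n) (λ i → half n - ℕ→ℚ i) (suc (2· R)) a cfact ⟩
  Σ (suc (2· R)) F                                 ≡⟨ Σ-head-odd-even R F ⟩
  F 0 + Σ R (λ k → F (1+2· k) + F (2· suc k))      ≡⟨ cong₂ _+_ (vanishing 0 (s≤s z≤n) F0) (Σ-cong R (λ k k<R → trans (cong (_+ F (2· suc k)) (vanishing (1+2· k) (s≤s (ℕP.<⇒≤ (2·-mono-≤ k<R))) (odd k)))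
                                                                                                (QP.+-identityˡ (F (2· suc k))))) ⟩
  0ℚ + Σ R (λ k → F (2· suc k))                   ≡⟨ QP.+-identityˡ (Σ R (λ k → F (2· suc k))) ⟩
  Σ R (λ k → F (2· suc k))                         ≡⟨ sum1jkr-Σ R (ℕ→ℚ 2 ^ (n ℕ.+ 1)) (λ k → F (2· suc k)) (term₁ (2· R) n) (formula₁-term R n a expands) ⟩
  ℕ→ℚ 2 ^ (n ℕ.+ 1) * sum1jkr R (term₁ (2· R) n) ∎
  where
  R = suc r
  open CFExpansion (cfExpansion (2· R)) renaming (coeff to a)
  p : ℚ → ℚ
  p t = t ^ 2· R
  F : ℕ → ℚ
  F m = a m * binomialSum n (cfact m)
  vanishing : ∀ m → m < suc (2· R) → δ₀ m p ≡ 0ℚ → F m ≡ 0ℚ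
  vanishing m m< δ₀≡0 = trans (cong (_* binomialSum n (cfact m)) (δ₀-coefficient-zero (suc (2· R)) a p expands m m< δ₀≡0)) (QP.*-zeroˡ (binomialSum n (cfact m)))
  F0 : δ₀ 0 p ≡ 0ℚ
  F0 = 0^suc (suc (2· r))
  odd : ∀ k → δ₀ (1+2· k) p ≡ 0ℚ
  odd k = δ₀-antisymmetric (1+2· k) p 1ℚ (λ t → trans (-[x]^2· t R) (sym (QP.*-identityˡ (p t)))) (trans (QP.*-identityʳ _) (sgn-1+2· k))

÷₀-rising : ∀ A a k j → (A ÷₀ (ℕ→ℚ (a !) * poch (ℕ→ℚ (suc k)) j)) * ℕ→ℚ ((k ℕ.+ j ℕ.+ a) !)
                        ≡ A * ℕ→ℚ (k !) * binom (k ℕ.+ j ℕ.+ a) (k ℕ.+ j)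
÷₀-rising A a k j = begin
  (A ÷₀ d) * ℕ→ℚ ((k ℕ.+ j ℕ.+ a) !)
    ≡⟨ cong (_* ℕ→ℚ ((k ℕ.+ j ℕ.+ a) !)) (÷₀-*-both A d (ℕ→ℚ (k !)) d≢0 (ℕ→ℚ-!≢0 k)) ⟩
  ((A * ℕ→ℚ (k !)) ÷₀ (d * ℕ→ℚ (k !))) * ℕ→ℚ ((k ℕ.+ j ℕ.+ a) !)
    ≡⟨ cong (λ z → ((A * ℕ→ℚ (k !)) ÷₀ z) * ℕ→ℚ ((k ℕ.+ j ℕ.+ a) !)) d*k! ⟩
  ((A * ℕ→ℚ (k !)) ÷₀ (ℕ→ℚ (a !) * ℕ→ℚ ((k ℕ.+ j) !))) * ℕ→ℚ ((k ℕ.+ j ℕ.+ a) !)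
    ≡⟨ ÷₀-factorials (A * ℕ→ℚ (k !)) a (k ℕ.+ j) ⟩
  A * ℕ→ℚ (k !) * binom (k ℕ.+ j ℕ.+ a) (k ℕ.+ j) ∎
  where
  d : ℚ
  d = ℕ→ℚ (a !) * poch (ℕ→ℚ (suc k)) j
  d*k! : d * ℕ→ℚ (k !) ≡ ℕ→ℚ (a !) * ℕ→ℚ ((k ℕ.+ j) !)
  d*k! = trans (QP.*-assoc (ℕ→ℚ (a !)) _ _) (cong (ℕ→ℚ (a !) *_) (poch-ℕ-suc k j))
  d≢0 : d ≢ 0ℚ
  d≢0 d≡0 = *-≢0 _ _ (ℕ→ℚ-!≢0 a) (ℕ→ℚ-!≢0 (k ℕ.+ j)) (trans (sym d*k!) (trans (cong (_* ℕ→ℚ (k !)) d≡0) (QP.*-zeroˡ (ℕ→ℚ (k !)))))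

foldedBinomialSum-odd : ∀ n r f (b : ℕ → ℚ) → (∀ t → f t ≡ Σ (2· suc r) (λ m → b m * cfact m t)) → (∀ t → f (- t) ≡ - f t) →
  foldedBinomialSum n f ≡ Σ (suc r) (λ k → b (1+2· k) * foldedBinomialSum n (cfact (1+2· k)))
foldedBinomialSum-odd n r f b expands f-odd = begin
  foldedBinomialSum n f
    ≡⟨ foldedBinomialSum-cong n expands ⟩
  foldedBinomialSum n (λ t → Σ (2· suc r) (λ m → b m * cfact m t))
    ≡⟨ wsum-Σ (suc (1+2· n)) (binom (1+2· n)) (λ i → half (1+2· n) - ℕ→ℚ i) (2· suc r) b (λ m t → cfact m ∣ t ∣) ⟩
  Σ (2· suc r) F
    ≡⟨ Σ-even-odd r F ⟩
  Σ (suc r) (λ k → F (2· k) + F (1+2· k))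
    ≡⟨ Σ-cong (suc r) (λ k k<1+r → trans (cong (_+ F (1+2· k)) (even-vanishes k k<1+r)) (QP.+-identityˡ (F (1+2· k)))) ⟩
  Σ (suc r) (λ k → F (1+2· k)) ∎
  where
  F : ℕ → ℚ
  F m = b m * foldedBinomialSum n (cfact m)
  even-vanishes : ∀ k → k < suc r → F (2· k) ≡ 0ℚ
  even-vanishes k (s≤s k≤r) = trans (cong (_* foldedBinomialSum n (cfact (2· k))) b≡0) (QP.*-zeroˡ (foldedBinomialSum n (cfact (2· k))))
    where
    b≡0 : b (2· k) ≡ 0ℚ
    b≡0 = δ₀-coefficient-zero (2· suc r) b f expands (2· k) (s≤s (ℕP.≤-trans (2·-mono-≤ k≤r) (ℕP.n≤1+n (2· r))))
            (δ₀-antisymmetric (2· k) f (- 1ℚ) (λ t → trans (f-odd t) (solve 1 (λ x → :- x := :- con 1ℚ :* x) refl (f t)))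
                              (cong (_* - 1ℚ) (sgn-2· k)))

term₃ : ℕ → ℕ → ℕ → ℕ → ℚ
term₃ N n j k = sgn j * (poch (- ℕ→ℚ n) k ÷₀ (ℕ→ℚ ((k ℕ.∸ j) !) * poch (ℕ→ℚ k) j)) * ((ℕ→ℚ j - ½) ^ N)

÷₀-rising-odd : ∀ A k j → j ≤ k →
  (A ÷₀ (ℕ→ℚ ((k ℕ.∸ j) !) * poch (ℕ→ℚ (suc k)) (suc j))) * ℕ→ℚ ((1+2· k) !) ≡ A * ℕ→ℚ (k !) * binom (1+2· k) (suc k ℕ.+ j)
÷₀-rising-odd A k j j≤k = begin
  (A ÷₀ (ℕ→ℚ ((k ℕ.∸ j) !) * poch (ℕ→ℚ (suc k)) (suc j))) * ℕ→ℚ ((1+2· k) !)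
    ≡⟨ cong (λ v → (A ÷₀ (ℕ→ℚ ((k ℕ.∸ j) !) * poch (ℕ→ℚ (suc k)) (suc j))) * ℕ→ℚ (v !)) split ⟩
  (A ÷₀ (ℕ→ℚ ((k ℕ.∸ j) !) * poch (ℕ→ℚ (suc k)) (suc j))) * ℕ→ℚ ((k ℕ.+ suc j ℕ.+ (k ℕ.∸ j)) !)
    ≡⟨ ÷₀-rising A (k ℕ.∸ j) k (suc j) ⟩
  A * ℕ→ℚ (k !) * binom (k ℕ.+ suc j ℕ.+ (k ℕ.∸ j)) (k ℕ.+ suc j)
    ≡⟨ cong₂ (λ v w → A * ℕ→ℚ (k !) * binom v w) (sym split) (ℕP.+-suc k j) ⟩
  A * ℕ→ℚ (k !) * binom (1+2· k) (suc k ℕ.+ j) ∎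
  where
  split : 1+2· k ≡ k ℕ.+ suc j ℕ.+ (k ℕ.∸ j)
  split = trans (cong suc (2·≡+j+∸ k j j≤k)) (cong (ℕ._+ (k ℕ.∸ j)) (sym (ℕP.+-suc k j)))

term₃-scaled : ∀ N n k j → j ≤ k →
  term₃ N n (suc j) (suc k) * ℕ→ℚ ((1+2· k) !)
  ≡ - (poch (- ℕ→ℚ n) (suc k) * ℕ→ℚ (k !)) * (sgn j * binom (1+2· k) (suc k ℕ.+ j) * (ℕ→ℚ j + ½) ^ N)
term₃-scaled N n k j j≤k = begin
  sgn (suc j) * Q * x * W                 ≡⟨ solve 4 (λ s q x w → s :* q :* x :* w := s :* (q :* w) :* x) refl (sgn (suc j)) Q x W ⟩
  sgn (suc j) * (Q * W) * x               ≡⟨ cong₂ (λ u v → sgn (suc j) * u * v ^ N) (÷₀-rising-odd P k j j≤k) shift ⟩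
  sgn (suc j) * (P * F * B) * y           ≡⟨ solve 5 (λ s p f b y → con (- 1ℚ) :* s :* (p :* f :* b) :* y := :- (p :* f) :* (s :* b :* y)) refl (sgn j) P F B y ⟩
  - (P * F) * (sgn j * B * y)             ∎
  where
  P Q F B x y W : ℚ
  P = poch (- ℕ→ℚ n) (suc k)
  Q = P ÷₀ (ℕ→ℚ ((k ℕ.∸ j) !) * poch (ℕ→ℚ (suc k)) (suc j))
  F = ℕ→ℚ (k !)
  B = binom (1+2· k) (suc k ℕ.+ j)
  x = (ℕ→ℚ (suc j) - ½) ^ N
  y = (ℕ→ℚ j + ½) ^ N
  W = ℕ→ℚ ((1+2· k) !)
  shift : ℕ→ℚ (suc j) - ½ ≡ ℕ→ℚ j + ½
  shift = trans (cong (_- ½) (ℕ→ℚ-suc j)) (solve 1 (λ x → con 1ℚ :+ x :- con ½ := x :+ con ½) refl (ℕ→ℚ j))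

formula₃-term : ∀ n r (a : ℕ → ℚ) → (∀ t → t ^ 1+2· r ≡ Σ (2· suc r) (λ m → a m * cfact m t)) → ∀ k → k < suc r →
  a (1+2· k) * foldedBinomialSum n (cfact (1+2· k)) ≡ binom (2· suc n) (suc n) * Σ (suc k) (λ j → term₃ (1+2· r) (suc n) (suc j) (suc k))
formula₃-term n r a expands k k<1+r = cancel-! (1+2· k) _ _ (begin
  a (1+2· k) * Fo * W                      ≡⟨ solve 3 (λ a l w → a :* l :* w := l :* (a :* w)) refl (a (1+2· k)) Fo W ⟩
  Fo * (a (1+2· k) * W)                    ≡⟨ cong₂ _*_ (foldedBinomialSum-cfact-1+2· n k) coefficient ⟩
  Cn * sgn (suc k) * P * F * ½ * ((1ℚ + 1ℚ) * sgn k * S)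
                                           ≡⟨ solve 5 (λ c s p f x → c :* (con (- 1ℚ) :* s) :* p :* f :* con ½ :* ((con 1ℚ :+ con 1ℚ) :* s :* x) := c :* (:- (p :* f) :* x) :* (s :* s)) refl Cn (sgn k) P F S ⟩
  Cn * (- (P * F) * S) * (sgn k * sgn k)   ≡⟨ cong (Cn * (- (P * F) * S) *_) (sgn*sgn k) ⟩
  Cn * (- (P * F) * S) * 1ℚ                ≡⟨ QP.*-identityʳ (Cn * (- (P * F) * S)) ⟩
  Cn * (- (P * F) * S)                     ≡⟨ cong (Cn *_) (sym (Σ-scaled (suc k) W (- (P * F)) t τ (λ j j<1+k → term₃-scaled (1+2· r) (suc n) k j (ℕP.≤-pred j<1+k)))) ⟩
  Cn * (Σ (suc k) t * W)                   ≡⟨ sym (QP.*-assoc Cn (Σ (suc k) t) W) ⟩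
  Cn * Σ (suc k) t * W                     ∎)
  where
  p : ℚ → ℚ
  p x = x ^ 1+2· r
  Fo W Cn P F S : ℚ
  Fo = foldedBinomialSum n (cfact (1+2· k))
  W  = ℕ→ℚ ((1+2· k) !)
  Cn = binom (2· suc n) (suc n)
  P  = poch (- ℕ→ℚ (suc n)) (suc k)
  F  = ℕ→ℚ (k !)
  τ t : ℕ → ℚ
  τ j = sgn j * binom (1+2· k) (suc k ℕ.+ j) * p (ℕ→ℚ j + ½)
  S = Σ (suc k) τ
  t j = term₃ (1+2· r) (suc n) (suc j) (suc k)
  coefficient : a (1+2· k) * W ≡ (1ℚ + 1ℚ) * sgn k * S
  coefficient = trans (sym (δ₀-coefficient (2· suc r) a p expands (1+2· k) (s≤s (s≤s (2·-mono-≤ (ℕP.≤-pred k<1+r))))))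
                      (δ₀-1+2·-odd k p (λ x → -[x]^1+2· x r))

formula₃ : ∀ r n → U (1+2· r) (1+2· n) ≡ binom (2· suc n) (suc n) * sum1jkr (suc r) (term₃ (1+2· r) (suc n))
formula₃ r n = begin
  foldedBinomialSum n p
    ≡⟨ foldedBinomialSum-odd n r p a expands (λ t → -[x]^1+2· t r) ⟩
  Σ (suc r) (λ k → a (1+2· k) * foldedBinomialSum n (cfact (1+2· k)))
    ≡⟨ sum1jkr-Σ (suc r) (binom (2· suc n) (suc n)) (λ k → a (1+2· k) * foldedBinomialSum n (cfact (1+2· k))) (term₃ (1+2· r) (suc n)) (formula₃-term n r a expands) ⟩
  binom (2· suc n) (suc n) * sum1jkr (suc r) (term₃ (1+2· r) (suc n)) ∎
  where
  open CFExpansion (cfExpansion (1+2· r)) renaming (coeff to a)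
  p : ℚ → ℚ
  p t = t ^ 1+2· r

-- Abel summation for U_{2r+1}(2n)

binomPrev : ℕ → ℕ → ℚ
binomPrev o zero    = 0ℚ
binomPrev o (suc i) = binom o i

binom-suc-prev : ∀ o i → binom (suc o) i ≡ binom o i + binomPrev o i
binom-suc-prev o zero    = refl
binom-suc-prev o (suc i) = trans (binom-pascal o i) (QP.+-comm (binom o i) (binom o (suc i)))

binom-absorb-prev : ∀ o i → ℕ→ℚ i * binom (suc o) i ≡ ℕ→ℚ (suc o) * binomPrev o i
binom-absorb-prev o zero    = trans (QP.*-zeroˡ (binom (suc o) 0)) (sym (QP.*-zeroʳ (ℕ→ℚ (suc o))))
binom-absorb-prev o (suc i) = binom-absorb o i

binom-2·-diff : ∀ n i → binom (2· suc n) i * (ℕ→ℚ (suc n) - ℕ→ℚ i) ≡ ℕ→ℚ (suc n) * (binom (1+2· n) i - binomPrev (1+2· n) i)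
binom-2·-diff n i = begin
  binom (suc o) i * (M - ℕ→ℚ i)                         ≡⟨ solve 3 (λ c m x → c :* (m :- x) := m :* c :- x :* c) refl (binom (suc o) i) M (ℕ→ℚ i) ⟩
  M * binom (suc o) i - ℕ→ℚ i * binom (suc o) i         ≡⟨ cong₂ (λ u v → M * u - v) (binom-suc-prev o i) (binom-absorb-prev o i) ⟩
  M * (binom o i + binomPrev o i) - ℕ→ℚ (suc o) * binomPrev o i
                                                        ≡⟨ cong (λ z → M * (binom o i + binomPrev o i) - z * binomPrev o i) (ℕ→ℚ-2· (suc n)) ⟩
  M * (binom o i + binomPrev o i) - (M + M) * binomPrev o i
                                                        ≡⟨ solve 3 (λ m a b → m :* (a :+ b) :- (m :+ m) :* b := m :* (a :- b)) refl M (binom o i) (binomPrev o i) ⟩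
  M * (binom o i - binomPrev o i)                       ∎
  where
  o = 1+2· n
  M : ℚ
  M = ℕ→ℚ (suc n)

Σ-abel : ∀ o (G : ℕ → ℚ) →
  Σ (suc (suc o)) (λ i → (binom o i - binomPrev o i) * G i) ≡ Σ (suc o) (λ s → binom o s * (G s - G (suc s)))
Σ-abel o G = begin
  Σ (suc (suc o)) (λ i → (binom o i - binomPrev o i) * G i)
    ≡⟨ Σ-cong′ (suc (suc o)) (λ i → solve 3 (λ a b g → (a :- b) :* g := a :* g :- b :* g) refl (binom o i) (binomPrev o i) (G i)) ⟩
  Σ (suc (suc o)) (λ i → binom o i * G i - binomPrev o i * G i)
    ≡⟨ Σ-- (suc (suc o)) (λ i → binom o i * G i) (λ i → binomPrev o i * G i) ⟩
  Σ (suc (suc o)) (λ i → binom o i * G i) - Σ (suc (suc o)) (λ i → binomPrev o i * G i)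
    ≡⟨ cong₂ _-_ (Σ-last (suc o) (λ i → binom o i * G i)) (Σ-head (suc o) (λ i → binomPrev o i * G i)) ⟩
  X + binom o (suc o) * G (suc o) - (0ℚ * G 0 + Y)
    ≡⟨ cong (λ z → X + z * G (suc o) - (0ℚ * G 0 + Y)) (binom-over o (suc o) (ℕP.n<1+n o)) ⟩
  X + 0ℚ * G (suc o) - (0ℚ * G 0 + Y)
    ≡⟨ solve 4 (λ a b c d → a :+ con 0ℚ :* b :- (con 0ℚ :* c :+ d) := a :- d) refl X (G (suc o)) (G 0) Y ⟩
  X - Y
    ≡⟨ sym (Σ-- (suc o) (λ i → binom o i * G i) (λ i → binom o i * G (suc i))) ⟩
  Σ (suc o) (λ s → binom o s * G s - binom o s * G (suc s))
    ≡⟨ Σ-cong′ (suc o) (λ s → solve 3 (λ c a b → c :* a :- c :* b := c :* (a :- b)) refl (binom o s) (G s) (G (suc s))) ⟩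
  Σ (suc o) (λ s → binom o s * (G s - G (suc s))) ∎
  where
  X Y : ℚ
  X = Σ (suc o) (λ i → binom o i * G i)
  Y = Σ (suc o) (λ i → binom o i * G (suc i))

-- sign(m - i) (m - i)^N, taking the sign of 0 to be +.
signedPow : ℕ → ℕ → ℕ → ℚ
signedPow N m i with i ℕP.≤? m
... | yes _ = (ℕ→ℚ m - ℕ→ℚ i) ^ N
... | no  _ = - ((ℕ→ℚ m - ℕ→ℚ i) ^ N)

signedPow-≤ : ∀ N m i → i ≤ m → signedPow N m i ≡ (ℕ→ℚ m - ℕ→ℚ i) ^ N
signedPow-≤ N m i i≤m with i ℕP.≤? m
... | yes _   = refl
... | no  i≰m = ⊥-elim (i≰m i≤m)

signedPow-> : ∀ N m i → m < i → signedPow N m i ≡ - ((ℕ→ℚ m - ℕ→ℚ i) ^ N)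
signedPow-> N m i m<i with i ℕP.≤? m
... | yes i≤m = ⊥-elim (ℕP.<⇒≱ m<i i≤m)
... | no  _   = refl

signedPow-≥ : ∀ r m i → m ≤ i → signedPow (suc r) m i ≡ - ((ℕ→ℚ m - ℕ→ℚ i) ^ suc r)
signedPow-≥ r m i m≤i with ℕP.m≤n⇒m<n∨m≡n m≤i
... | inj₁ m<i  = signedPow-> (suc r) m i m<i
... | inj₂ refl = begin
  signedPow (suc r) m m              ≡⟨ signedPow-≤ (suc r) m m ℕP.≤-refl ⟩
  (ℕ→ℚ m - ℕ→ℚ m) ^ suc r            ≡⟨ cong (_^ suc r) (QP.+-inverseʳ (ℕ→ℚ m)) ⟩
  0ℚ ^ suc r                         ≡⟨ 0^suc r ⟩
  0ℚ                                 ≡⟨ sym (cong -_ (0^suc r)) ⟩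
  - (0ℚ ^ suc r)                     ≡⟨ cong (λ z → - (z ^ suc r)) (sym (QP.+-inverseʳ (ℕ→ℚ m))) ⟩
  - ((ℕ→ℚ m - ℕ→ℚ m) ^ suc r)        ∎

∣ℕ-ℕ∣^1+2·-≤ : ∀ r m i → i ≤ m → ∣ ℕ→ℚ m - ℕ→ℚ i ∣ ^ 1+2· r ≡ (ℕ→ℚ m - ℕ→ℚ i) * signedPow (2· r) m i
∣ℕ-ℕ∣^1+2·-≤ r m i i≤m = begin
  ∣ x ∣ ^ 1+2· r                     ≡⟨ cong (λ z → ∣ z ∣ ^ 1+2· r) (sym m-i) ⟩
  ∣ ℕ→ℚ (m ℕ.∸ i) ∣ ^ 1+2· r         ≡⟨ cong (_^ 1+2· r) (trans (∣ℕ→ℚ∣ (m ℕ.∸ i)) m-i) ⟩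
  x * x ^ 2· r                       ≡⟨ cong (x *_) (sym (signedPow-≤ (2· r) m i i≤m)) ⟩
  x * signedPow (2· r) m i           ∎
  where
  x = ℕ→ℚ m - ℕ→ℚ i
  m-i = ℕ→ℚ-∸ m i i≤m

∣ℕ-ℕ∣^1+2·-> : ∀ r m i → m < i → ∣ ℕ→ℚ m - ℕ→ℚ i ∣ ^ 1+2· r ≡ (ℕ→ℚ m - ℕ→ℚ i) * signedPow (2· r) m i
∣ℕ-ℕ∣^1+2·-> r m i m<i = begin
  ∣ x ∣ ^ 1+2· r                     ≡⟨ cong (_^ 1+2· r) ∣x∣≡-x ⟩
  (- x) ^ 1+2· r                     ≡⟨ -[x]^1+2· x r ⟩
  - (x * x ^ 2· r)                   ≡⟨ solve 2 (λ x p → :- (x :* p) := x :* (:- p)) refl x (x ^ 2· r) ⟩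
  x * - (x ^ 2· r)                   ≡⟨ cong (x *_) (sym (signedPow-> (2· r) m i m<i)) ⟩
  x * signedPow (2· r) m i           ∎
  where
  x y : ℚ
  x = ℕ→ℚ m - ℕ→ℚ i
  y = ℕ→ℚ (i ℕ.∸ m)
  x≡-y : x ≡ - y
  x≡-y = trans (cong (λ z → ℕ→ℚ m - z) (trans (cong ℕ→ℚ (sym (ℕP.m+[n∸m]≡n (ℕP.<⇒≤ m<i)))) (ℕ→ℚ-+ m (i ℕ.∸ m))))
               (solve 2 (λ a b → a :- (a :+ b) := :- b) refl (ℕ→ℚ m) y)
  ∣x∣≡-x : ∣ x ∣ ≡ - x
  ∣x∣≡-x = trans (cong ∣_∣ x≡-y) (trans (QP.∣-p∣≡∣p∣ y) (trans (∣ℕ→ℚ∣ (i ℕ.∸ m))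
             (trans (solve 1 (λ a → a := :- (:- a)) refl y) (cong -_ (sym x≡-y)))))

∣ℕ-ℕ∣^1+2· : ∀ r m i → ∣ ℕ→ℚ m - ℕ→ℚ i ∣ ^ 1+2· r ≡ (ℕ→ℚ m - ℕ→ℚ i) * signedPow (2· r) m i
∣ℕ-ℕ∣^1+2· r m i = by-cases (ℕP.≤-<-connex i m)
  where
  by-cases : i ≤ m ⊎ m < i → ∣ ℕ→ℚ m - ℕ→ℚ i ∣ ^ 1+2· r ≡ (ℕ→ℚ m - ℕ→ℚ i) * signedPow (2· r) m i
  by-cases (inj₁ i≤m) = ∣ℕ-ℕ∣^1+2·-≤ r m i i≤m
  by-cases (inj₂ m<i) = ∣ℕ-ℕ∣^1+2·-> r m i m<i

signedPow-Δ-below : ∀ n r s → s < suc n → signedPow (2· suc r) (suc n) s - signedPow (2· suc r) (suc n) (suc s)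
                                  ≡ δ (_^ 2· suc r) ∣ half (1+2· n) - ℕ→ℚ s ∣
signedPow-Δ-below n r s s≤n = begin
  signedPow E m s - signedPow E m (suc s)       ≡⟨ cong₂ _-_ (signedPow-≤ E m s (ℕP.<⇒≤ s≤n)) (signedPow-≤ E m (suc s) s≤n) ⟩
  (M - ℕ→ℚ s) ^ E - (M - ℕ→ℚ (suc s)) ^ E       ≡⟨ cong₂ (λ a b → a ^ E - b ^ E) up down ⟩
  δ (_^ E) u                                    ≡⟨ cong (δ (_^ E)) (sym (trans (cong ∣_∣ u≡) (trans (∣ℕ→ℚ+½∣ (n ℕ.∸ s)) (sym u≡)))) ⟩
  δ (_^ E) ∣ u ∣                                ∎
  where
  E = 2· suc r
  m = suc n
  M u : ℚ
  M = ℕ→ℚ m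
  u = half (1+2· n) - ℕ→ℚ s
  u≡ : u ≡ ℕ→ℚ (n ℕ.∸ s) + ½
  u≡ = trans (cong (_- ℕ→ℚ s) (half-1+2· n))
             (trans (solve 2 (λ a b → a :+ con ½ :- b := a :- b :+ con ½) refl (ℕ→ℚ n) (ℕ→ℚ s))
                    (cong (_+ ½) (sym (ℕ→ℚ-∸ n s (ℕP.≤-pred s≤n)))))
  up : M - ℕ→ℚ s ≡ u + ½
  up = trans (cong (_- ℕ→ℚ s) (ℕ→ℚ-suc n))
             (trans (solve 2 (λ a b → con 1ℚ :+ a :- b := a :+ con ½ :- b :+ con ½) refl (ℕ→ℚ n) (ℕ→ℚ s))
                    (cong (λ z → z - ℕ→ℚ s + ½) (sym (half-1+2· n))))
  down : M - ℕ→ℚ (suc s) ≡ u - ½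
  down = trans (cong₂ _-_ (ℕ→ℚ-suc n) (ℕ→ℚ-suc s))
               (trans (solve 2 (λ a b → con 1ℚ :+ a :- (con 1ℚ :+ b) := a :+ con ½ :- b :- con ½) refl (ℕ→ℚ n) (ℕ→ℚ s))
                      (cong (λ z → z - ℕ→ℚ s - ½) (sym (half-1+2· n))))

signedPow-Δ-above : ∀ n r s → suc n ≤ s → signedPow (2· suc r) (suc n) s - signedPow (2· suc r) (suc n) (suc s)
                                  ≡ δ (_^ 2· suc r) ∣ half (1+2· n) - ℕ→ℚ s ∣
signedPow-Δ-above n r s m≤s = begin
  signedPow E m s - signedPow E m (suc s)       ≡⟨ cong₂ _-_ (signedPow-≥ (1+2· r) m s m≤s) (signedPow-> E m (suc s) (s≤s m≤s)) ⟩
  - ((M - ℕ→ℚ s) ^ E) - - ((M - ℕ→ℚ (suc s)) ^ E)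
                                                ≡⟨ cong₂ (λ a b → - (a ^ E) - - (b ^ E)) at-s at-1+s ⟩
  - ((- B) ^ E) - - ((- (B + 1ℚ)) ^ E)          ≡⟨ cong₂ (λ a b → - a - - b) (-[x]^2· B (suc r)) (-[x]^2· (B + 1ℚ) (suc r)) ⟩
  - (B ^ E) - - ((B + 1ℚ) ^ E)                  ≡⟨ solve 2 (λ a b → :- a :- :- b := b :- a) refl (B ^ E) ((B + 1ℚ) ^ E) ⟩
  (B + 1ℚ) ^ E - B ^ E                          ≡⟨ cong₂ (λ a b → a ^ E - b ^ E) (solve 1 (λ b → b :+ con 1ℚ := b :+ con ½ :+ con ½) refl B) (solve 1 (λ b → b := b :+ con ½ :- con ½) refl B) ⟩
  δ (_^ E) (B + ½)                              ≡⟨ cong (δ (_^ E)) (sym (trans (cong ∣_∣ u≡) (∣-[ℕ→ℚ+½]∣ b))) ⟩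
  δ (_^ E) ∣ half (1+2· n) - ℕ→ℚ s ∣            ∎
  where
  E = 2· suc r
  m = suc n
  b = s ℕ.∸ m
  M B : ℚ
  M = ℕ→ℚ m
  B = ℕ→ℚ b
  s≡ : ℕ→ℚ s ≡ 1ℚ + ℕ→ℚ n + B
  s≡ = trans (cong ℕ→ℚ (sym (ℕP.m+[n∸m]≡n m≤s))) (trans (ℕ→ℚ-+ m b) (cong (_+ B) (ℕ→ℚ-suc n)))
  u≡ : half (1+2· n) - ℕ→ℚ s ≡ - (B + ½)
  u≡ = trans (cong₂ _-_ (half-1+2· n) s≡) (solve 2 (λ a b → a :+ con ½ :- (con 1ℚ :+ a :+ b) := :- (b :+ con ½)) refl (ℕ→ℚ n) B)
  at-s : M - ℕ→ℚ s ≡ - B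
  at-s = trans (cong₂ _-_ (ℕ→ℚ-suc n) s≡) (solve 2 (λ a b → con 1ℚ :+ a :- (con 1ℚ :+ a :+ b) := :- b) refl (ℕ→ℚ n) B)
  at-1+s : M - ℕ→ℚ (suc s) ≡ - (B + 1ℚ)
  at-1+s = trans (cong₂ _-_ (ℕ→ℚ-suc n) (trans (ℕ→ℚ-suc s) (cong (1ℚ +_) s≡)))
                 (solve 2 (λ a b → con 1ℚ :+ a :- (con 1ℚ :+ (con 1ℚ :+ a :+ b)) := :- (b :+ con 1ℚ)) refl (ℕ→ℚ n) B)

signedPow-Δ : ∀ n r s → signedPow (2· suc r) (suc n) s - signedPow (2· suc r) (suc n) (suc s)
                        ≡ δ (_^ 2· suc r) ∣ half (1+2· n) - ℕ→ℚ s ∣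
signedPow-Δ n r s = by-cases (ℕP.≤-<-connex (suc n) s)
  where
  by-cases : suc n ≤ s ⊎ s < suc n → signedPow (2· suc r) (suc n) s - signedPow (2· suc r) (suc n) (suc s)
                                     ≡ δ (_^ 2· suc r) ∣ half (1+2· n) - ℕ→ℚ s ∣
  by-cases (inj₁ m≤s) = signedPow-Δ-above n r s m≤s
  by-cases (inj₂ s≤n) = signedPow-Δ-below n r s s≤n

U-1+2·-2· : ∀ n r → U (1+2· suc r) (2· suc n) ≡ ℕ→ℚ (suc n) * foldedBinomialSum n (δ (_^ 2· suc r))
U-1+2·-2· n r = begin
  Σ (suc (suc o)) (λ i → binom (2· m) i * (∣ half (2· m) - ℕ→ℚ i ∣ ^ 1+2· R))
    ≡⟨ Σ-cong′ (suc (suc o)) pointwise ⟩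
  Σ (suc (suc o)) (λ i → M * ((binom o i - binomPrev o i) * G i))
    ≡⟨ Σ-*ˡ (suc (suc o)) M (λ i → (binom o i - binomPrev o i) * G i) ⟩
  M * Σ (suc (suc o)) (λ i → (binom o i - binomPrev o i) * G i)
    ≡⟨ cong (M *_) (Σ-abel o G) ⟩
  M * Σ (suc o) (λ s → binom o s * (G s - G (suc s)))
    ≡⟨ cong (M *_) (Σ-cong′ (suc o) (λ s → cong (binom o s *_) (signedPow-Δ n r s))) ⟩
  M * foldedBinomialSum n (δ (_^ 2· R)) ∎
  where
  R = suc r
  m = suc n
  o = 1+2· n
  M : ℚ
  M = ℕ→ℚ m
  G : ℕ → ℚ
  G = signedPow (2· R) m
  pointwise : ∀ i → binom (2· m) i * (∣ half (2· m) - ℕ→ℚ i ∣ ^ 1+2· R) ≡ M * ((binom o i - binomPrev o i) * G i)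
  pointwise i = begin
    binom (2· m) i * (∣ half (2· m) - ℕ→ℚ i ∣ ^ 1+2· R)    ≡⟨ cong (λ z → binom (2· m) i * (∣ z - ℕ→ℚ i ∣ ^ 1+2· R)) (half-2· m) ⟩
    binom (2· m) i * (∣ M - ℕ→ℚ i ∣ ^ 1+2· R)              ≡⟨ cong (binom (2· m) i *_) (∣ℕ-ℕ∣^1+2· R m i) ⟩
    binom (2· m) i * ((M - ℕ→ℚ i) * G i)                   ≡⟨ sym (QP.*-assoc (binom (2· m) i) (M - ℕ→ℚ i) (G i)) ⟩
    binom (2· m) i * (M - ℕ→ℚ i) * G i                     ≡⟨ cong (_* G i) (binom-2·-diff n i) ⟩
    M * (binom o i - binomPrev o i) * G i                  ≡⟨ QP.*-assoc M (binom o i - binomPrev o i) (G i) ⟩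
    M * ((binom o i - binomPrev o i) * G i)                ∎

δ-expansion : ∀ N (a : ℕ → ℚ) (f : ℚ → ℚ) → (∀ t → f t ≡ Σ (suc N) (λ m → a m * cfact m t)) →
  ∀ t → δ f t ≡ Σ N (λ i → a (suc i) * ℕ→ℚ (suc i) * cfact i t)
δ-expansion N a f expands t = begin
  f (t + ½) - f (t - ½)
    ≡⟨ cong₂ _-_ (expands (t + ½)) (expands (t - ½)) ⟩
  Σ (suc N) (λ m → a m * cfact m (t + ½)) - Σ (suc N) (λ m → a m * cfact m (t - ½))
    ≡⟨ sym (Σ-- (suc N) (λ m → a m * cfact m (t + ½)) (λ m → a m * cfact m (t - ½))) ⟩
  Σ (suc N) (λ m → a m * cfact m (t + ½) - a m * cfact m (t - ½))
    ≡⟨ Σ-head N (λ m → a m * cfact m (t + ½) - a m * cfact m (t - ½)) ⟩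
  a 0 * 1ℚ - a 0 * 1ℚ + Σ N (λ i → a (suc i) * cfact (suc i) (t + ½) - a (suc i) * cfact (suc i) (t - ½))
    ≡⟨ cong₂ _+_ (QP.+-inverseʳ (a 0 * 1ℚ)) (Σ-cong′ N differentiate) ⟩
  0ℚ + Σ N (λ i → a (suc i) * ℕ→ℚ (suc i) * cfact i t)
    ≡⟨ QP.+-identityˡ _ ⟩
  Σ N (λ i → a (suc i) * ℕ→ℚ (suc i) * cfact i t) ∎
  where
  differentiate : ∀ i → a (suc i) * cfact (suc i) (t + ½) - a (suc i) * cfact (suc i) (t - ½) ≡ a (suc i) * ℕ→ℚ (suc i) * cfact i t
  differentiate i = begin
    a (suc i) * cfact (suc i) (t + ½) - a (suc i) * cfact (suc i) (t - ½)
      ≡⟨ solve 3 (λ a x y → a :* x :- a :* y := a :* (x :- y)) refl (a (suc i)) (cfact (suc i) (t + ½)) (cfact (suc i) (t - ½)) ⟩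
    a (suc i) * δ (cfact (suc i)) t
      ≡⟨ cong (a (suc i) *_) (δ-cfact i t) ⟩
    a (suc i) * (ℕ→ℚ (suc i) * cfact i t)
      ≡⟨ sym (QP.*-assoc (a (suc i)) (ℕ→ℚ (suc i)) (cfact i t)) ⟩
    a (suc i) * ℕ→ℚ (suc i) * cfact i t ∎

δ-even-odd : ∀ (f : ℚ → ℚ) → (∀ t → f (- t) ≡ f t) → ∀ t → δ f (- t) ≡ - δ f t
δ-even-odd f f-even t = begin
  f (- t + ½) - f (- t - ½)           ≡⟨ cong₂ (λ u v → f u - f v) (solve 1 (λ t → :- t :+ con ½ := :- (t :- con ½)) refl t) (solve 1 (λ t → :- t :- con ½ := :- (t :+ con ½)) refl t) ⟩
  f (- (t - ½)) - f (- (t + ½))       ≡⟨ cong₂ _-_ (f-even (t - ½)) (f-even (t + ½)) ⟩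
  f (t - ½) - f (t + ½)               ≡⟨ solve 2 (λ x y → y :- x := :- (x :- y)) refl (f (t + ½)) (f (t - ½)) ⟩
  - δ f t                             ∎

term₂ : ℕ → ℕ → ℕ → ℕ → ℚ
term₂ N n j k = sgn j * (poch (- ℕ→ℚ n) k ÷₀ (ℕ→ℚ ((k ℕ.∸ j) !) * poch (ℕ→ℚ (k ℕ.+ 1)) j)) * (ℕ→ℚ j ^ N)

÷₀-rising-even : ∀ A K j → j ≤ K →
  (A ÷₀ (ℕ→ℚ ((K ℕ.∸ j) !) * poch (ℕ→ℚ (K ℕ.+ 1)) j)) * ℕ→ℚ ((2· K) !) ≡ A * ℕ→ℚ (K !) * binom (2· K) (K ℕ.+ j)
÷₀-rising-even A K j j≤K = begin
  (A ÷₀ (ℕ→ℚ ((K ℕ.∸ j) !) * poch (ℕ→ℚ (K ℕ.+ 1)) j)) * ℕ→ℚ ((2· K) !)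
    ≡⟨ cong₂ (λ u v → (A ÷₀ (ℕ→ℚ ((K ℕ.∸ j) !) * poch (ℕ→ℚ u) j)) * ℕ→ℚ (v !)) (ℕP.+-comm K 1) (2·≡+j+∸ K j j≤K) ⟩
  (A ÷₀ (ℕ→ℚ ((K ℕ.∸ j) !) * poch (ℕ→ℚ (suc K)) j)) * ℕ→ℚ ((K ℕ.+ j ℕ.+ (K ℕ.∸ j)) !)
    ≡⟨ ÷₀-rising A (K ℕ.∸ j) K j ⟩
  A * ℕ→ℚ (K !) * binom (K ℕ.+ j ℕ.+ (K ℕ.∸ j)) (K ℕ.+ j)
    ≡⟨ cong (λ v → A * ℕ→ℚ (K !) * binom v (K ℕ.+ j)) (sym (2·≡+j+∸ K j j≤K)) ⟩
  A * ℕ→ℚ (K !) * binom (2· K) (K ℕ.+ j) ∎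

term₂-scaled : ∀ N n K j → j ≤ K →
  term₂ N n j K * ℕ→ℚ ((2· K) !) ≡ (poch (- ℕ→ℚ n) K * ℕ→ℚ (K !)) * (sgn j * binom (2· K) (K ℕ.+ j) * ℕ→ℚ j ^ N)
term₂-scaled N n K j j≤K = begin
  sgn j * Q * x * W              ≡⟨ solve 4 (λ s q x w → s :* q :* x :* w := s :* (q :* w) :* x) refl (sgn j) Q x W ⟩
  sgn j * (Q * W) * x            ≡⟨ cong (λ z → sgn j * z * x) (÷₀-rising-even P K j j≤K) ⟩
  sgn j * (P * F * B) * x        ≡⟨ solve 5 (λ s p f b x → s :* (p :* f :* b) :* x := p :* f :* (s :* b :* x)) refl (sgn j) P F B x ⟩
  P * F * (sgn j * B * x)        ∎
  where
  P Q F B x W : ℚ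
  P = poch (- ℕ→ℚ n) K
  Q = P ÷₀ (ℕ→ℚ ((K ℕ.∸ j) !) * poch (ℕ→ℚ (K ℕ.+ 1)) j)
  F = ℕ→ℚ (K !)
  B = binom (2· K) (K ℕ.+ j)
  x = ℕ→ℚ j ^ N
  W = ℕ→ℚ ((2· K) !)

formula₂-term : ∀ n r (a : ℕ → ℚ) → (∀ t → t ^ 2· suc r ≡ Σ (suc (2· suc r)) (λ m → a m * cfact m t)) → ∀ k → k < suc r →
  ℕ→ℚ (suc n) * (a (2· suc k) * ℕ→ℚ (2· suc k) * foldedBinomialSum n (cfact (1+2· k)))
  ≡ ℕ→ℚ (2· suc n) * binom (2· suc n) (suc n) * Σ (suc k) (λ j → term₂ (2· suc r) (suc n) (suc j) (suc k))
formula₂-term n r a expands k k<1+r = cancel-! (2· K) _ _ (begin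
  M * (a (2· K) * E * Fo) * W            ≡⟨ solve 5 (λ m a e f w → m :* (a :* e :* f) :* w := m :* e :* f :* (a :* w)) refl M (a (2· K)) E Fo W ⟩
  M * E * Fo * (a (2· K) * W)            ≡⟨ cong₃ (λ e f c → M * e * f * c) E≡ (foldedBinomialSum-cfact-1+2· n k) coefficient ⟩
  M * ((1ℚ + Kq) + (1ℚ + Kq)) * (Cm * sgn K * P * F * ½) * ((1ℚ + 1ℚ) * sgn K * S)
                                         ≡⟨ solve 7 (λ m k c s p f x → m :* ((con 1ℚ :+ k) :+ (con 1ℚ :+ k)) :* (c :* (con (- 1ℚ) :* s) :* p :* f :* con ½) :* ((con 1ℚ :+ con 1ℚ) :* (con (- 1ℚ) :* s) :* x)
                                                   := (m :+ m) :* c :* (p :* ((con 1ℚ :+ k) :* f) :* x) :* (s :* s)) refl M Kq Cm (sgn k) P F S ⟩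
  (M + M) * Cm * (P * ((1ℚ + Kq) * F) * S) * (sgn k * sgn k)
                                         ≡⟨ cong₃ (λ u v w → u * Cm * (P * v * S) * w) (sym (ℕ→ℚ-2· (suc n))) (sym K!≡) (sgn*sgn k) ⟩
  T * (P * ℕ→ℚ (K !) * S) * 1ℚ           ≡⟨ QP.*-identityʳ (T * (P * ℕ→ℚ (K !) * S)) ⟩
  T * (P * ℕ→ℚ (K !) * S)                ≡⟨ cong (T *_) (sym (Σ-scaled K W (P * ℕ→ℚ (K !)) t τ (λ j j<K → term₂-scaled (2· suc r) (suc n) K (suc j) j<K))) ⟩
  T * (Σ K t * W)                        ≡⟨ sym (QP.*-assoc T (Σ K t) W) ⟩
  T * Σ K t * W                          ∎)
  where
  K = suc k
  p : ℚ → ℚ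
  p x = x ^ 2· suc r
  M E Fo W Cm P F Kq S T : ℚ
  M  = ℕ→ℚ (suc n)
  E  = ℕ→ℚ (2· K)
  Fo = foldedBinomialSum n (cfact (1+2· k))
  W  = ℕ→ℚ ((2· K) !)
  Cm = binom (2· suc n) (suc n)
  P  = poch (- M) K
  F  = ℕ→ℚ (k !)
  Kq = ℕ→ℚ k
  τ t : ℕ → ℚ
  τ j = sgn (suc j) * binom (2· K) (K ℕ.+ suc j) * p (ℕ→ℚ (suc j))
  S = Σ K τ
  T = ℕ→ℚ (2· suc n) * Cm
  t j = term₂ (2· suc r) (suc n) (suc j) K
  E≡ : E ≡ (1ℚ + Kq) + (1ℚ + Kq)
  E≡ = trans (ℕ→ℚ-2· K) (cong₂ _+_ (ℕ→ℚ-suc k) (ℕ→ℚ-suc k))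
  K!≡ : ℕ→ℚ (K !) ≡ (1ℚ + Kq) * F
  K!≡ = trans (ℕ→ℚ-* K (k !)) (cong (_* F) (ℕ→ℚ-suc k))
  coefficient : a (2· K) * W ≡ (1ℚ + 1ℚ) * sgn K * S
  coefficient = trans (sym (δ₀-coefficient (suc (2· suc r)) a p expands (2· K) (s≤s (2·-mono-≤ k<1+r))))
                      (δ₀-2·-even K p (λ x → -[x]^2· x (suc r)) (0^suc (1+2· r)))

formula₂ : ∀ r n → U (1+2· suc r) (2· suc n)
  ≡ ℕ→ℚ (2· suc n) * binom (2· suc n) (suc n) * sum1jkr (suc r) (term₂ (2· suc r) (suc n))
formula₂ r n = begin
  U (1+2· suc r) (2· suc n)
    ≡⟨ U-1+2·-2· n r ⟩
  M * foldedBinomialSum n (δ p)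
    ≡⟨ cong (M *_) (foldedBinomialSum-odd n r (δ p) b (δ-expansion (2· suc r) a p expands) (δ-even-odd p (λ t → -[x]^2· t (suc r)))) ⟩
  M * Σ (suc r) (λ k → b (1+2· k) * foldedBinomialSum n (cfact (1+2· k)))
    ≡⟨ sym (Σ-*ˡ (suc r) M F) ⟩
  Σ (suc r) (λ k → M * F k)
    ≡⟨ sum1jkr-Σ (suc r) (ℕ→ℚ (2· suc n) * binom (2· suc n) (suc n)) (λ k → M * F k) (term₂ (2· suc r) (suc n)) (formula₂-term n r a expands) ⟩
  ℕ→ℚ (2· suc n) * binom (2· suc n) (suc n) * sum1jkr (suc r) (term₂ (2· suc r) (suc n)) ∎
  where
  open CFExpansion (cfExpansion (2· suc r)) renaming (coeff to a)
  M : ℚ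
  M = ℕ→ℚ (suc n)
  p : ℚ → ℚ
  p t = t ^ 2· suc r
  b F : ℕ → ℚ
  b i = a (suc i) * ℕ→ℚ (suc i)
  F k = b (1+2· k) * foldedBinomialSum n (cfact (1+2· k))

theorem3 : (r n : ℕ) → r ≥ 1 → n ≥ 1 →
    (U (2 ℕ.* r) n ≡ (ℕ→ℚ 2 ^ (n ℕ.+ 1)) * sum1jkr r (λ j k → sgn j * ((poch (- (ℕ→ℚ n * ½)) k * poch ½ k) ÷₀ ℕ→ℚ (((k ℕ.∸ j) !) ℕ.* ((k ℕ.+ j) !))) * (ℕ→ℚ j ^ (2 ℕ.* r))))
    × (U (2 ℕ.* r ℕ.+ 1) (2 ℕ.* n) ≡ ℕ→ℚ (2 ℕ.* n) * ℕ→ℚ ((2 ℕ.* n) C n) * sum1jkr r (λ j k → sgn j * (poch (- ℕ→ℚ n) k ÷₀ (ℕ→ℚ ((k ℕ.∸ j) !) * poch (ℕ→ℚ (k ℕ.+ 1)) j)) * (ℕ→ℚ j ^ (2 ℕ.* r))))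
    × (U (2 ℕ.* r ℕ.∸ 1) (2 ℕ.* n ℕ.∸ 1) ≡ ℕ→ℚ ((2 ℕ.* n) C n) * sum1jkr r (λ j k → sgn j * (poch (- ℕ→ℚ n) k ÷₀ (ℕ→ℚ ((k ℕ.∸ j) !) * poch (ℕ→ℚ k) j)) * ((ℕ→ℚ j - ½) ^ (2 ℕ.* r ℕ.∸ 1))))
theorem3 (suc r) (suc n) _ _ =
    subst (λ N → U N (suc n) ≡ ℕ→ℚ 2 ^ (suc n ℕ.+ 1) * sum1jkr (suc r) (term₁ N (suc n)))
          (2·≡2* (suc r)) (formula₁ r (suc n))
  , trans (cong (λ N → U N (2 ℕ.* suc n)) (ℕP.+-comm (2 ℕ.* suc r) 1))
          (subst₂ (λ N X → U (suc N) X ≡ ℕ→ℚ X * binom X (suc n) * sum1jkr (suc r) (term₂ N (suc n)))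
                  (2·≡2* (suc r)) (2·≡2* (suc n)) (formula₂ r n))
  , subst₂ (λ N X → U (N ℕ.∸ 1) (X ℕ.∸ 1) ≡ binom X (suc n) * sum1jkr (suc r) (term₃ (N ℕ.∸ 1) (suc n)))
           (2·≡2* (suc r)) (2·≡2* (suc n)) (formula₃ r n)
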